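{- Let $\lambda$ be a partition with $n=\ell(\lambda)$ parts, let $\sigma\in\mathcal{T}(\lambda)$ be a canonical filling with largest entry $N$, and for $1\le i\le j\le n$ let $\nu_{i,j}^k$ and $s_m^h=s_m^h(i,j)$ be as defined below. Then for all $1\le i\le j\le n$: (a) $D_{i,j}(\sigma)=(j-i)\sum_{k=1}^{N-1}\big(s_N^k-s_k^k\big)$; (b) $\bar\eta_{i,j}(\sigma)=\xi_1(s,\nu_{i,j})+\sum_{k=1}^{N}\binom{\nu_{i,j}^k-\nu_{i,j}^{k-1}}{2}+\sum_{k=1}^{N-1}\sum_{h=1}^{k}(s_{k+1}^h-s_k^h)s_k^h+\sum_{k=1}^{N-1}\big(\nu_{i,j}^{k+1}-s_{k+1}^{1,k}-\nu_{i,j}^{k}+s_k^{1,k}\big)\big(\nu_{i,j}^{k}-s_k^{1,k}\big)$, where $\xi_1(s,\nu_{i,j})=\sum_{1\le h\le k<N}(s_{k+1}^h-s_k^h)(\nu_{i,j}^k-s_k^{h,k})$; and moreover (c) $\overline{\mathrm{quinv}}(\sigma)=\sum_{1\le i\le j\le n}\Big[(\lambda_i-\lambda_j)\sum_{k=1}^{N-1}\big(s_N^k(i,j)-s_k^k(i,j)\big)+\sum_{k=1}^{N}\sum_{\ell=j+1}^{n}(\nu_{i,j}^k-\nu_{i,j}^{k-1})(\nu_{i,\ell}^k-\nu_{i+1,\ell}^{k-1})\Big]$.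
   Context: $\lambda=(\lambda_1\ge\cdots\ge\lambda_n>0)$, $\lambda_{n+1}=0$; French Young diagram with cells $(r,c)$ (row $r$ from bottom, column $c$ from left), $\lambda'_c$ = height of column $c$. Fillings assign positive integers; convention: an extra entry $0$ on top of each column ($\sigma(\lambda'_c+1,c)=0$). For $1\le j\le n$, $\sigma_j$ is the restriction of $\sigma$ to the columns of height $j$ (columns $\lambda_{j+1}<c\le\lambda_j$), with row $j+1$ of $\sigma_j$ consisting of $0$'s. Canonical: a rectangular filling of height $m$ (row $m+1$ all $0$) is canonical if for every $1\le r\le m$: (I) whenever two columns have the same entry $a$ in row $r+1$ and entries $b$ (left) and $c$ (right) in row $r$, then $a>b\ge c$ or $c\ge a>b$ or $b\ge c\ge a$; (II) whenever two columns, the left with $a$ (row $r+1$) over $c$ (row $r$) and the right with $b$ over $d$, satisfy $a\le c$ and $b\le d$, then $a\ge b$ implies $c\ge d$ and $a<b$ implies $c\le d$. $\sigma$ is canonical if every $\sigma_j$ is. Quantities: $\nu_{i,j}^k$ ($0\le k\le N$) is the number of entries $\ge N+1-k$ in row $i$ of $\sigma_j$ (so $\nu_{i,j}^0=0$), and $\nu_{\ell+1,\ell}^k:=0$. For $1\le h\le m\le N$, $s_m^h(i,j)$ is the number of columns of $\sigma_j$ whose entry in row $i+1$ is $N+1-h$ and whose entry in row $i$ is $\ge N+1-m$; $s_m^{h,k}=\sum_{a=h}^k s_m^a$ (in (a),(b) $s$ means $s(i,j)$). $D_{i,j}(\sigma)=\sum(\lambda'_c-i)$ over the columns $c$ of $\sigma_j$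 with $\sigma(i+1,c)>\sigma(i,c)$ (the contribution to $\mathrm{maj}(\sigma)$ of descents in row $i+1$ of $\sigma_j$; here $\lambda'_c-i=j-i$). Pattern set $S_2$: consists of the chains $z=w>v>u$, $u\ge z=w>v$, $v>u\ge z=w$ (set $S^*$) and six chains $z>v\ge w>u$, $u\ge z>v\ge w$, $z>w>v>u$, $v>u\ge z>w$, $z>u>v\ge w$, $v\ge z>w>u$. $Q_{S_2}(z,w,u,v)=1$ iff $(z,w,u,v)$ satisfies a chain of $S^*$, or one of the six chains, or $(w,z,v,u)$ satisfies one of the six chains; else $0$. $\bar\eta_{i,j}(\sigma)$ is the number of 4-tuples of cells $(i+1,c),(i+1,d),(i,c),(i,d)$ with $c<d$ columns of $\sigma_j$ and $Q_{S_2}(\sigma(i+1,c),\sigma(i+1,d),\sigma(i,c),\sigma(i,d))=0$. $Q(a,b,c)=1$ iff $a<b<c$ or $b<c<a$ or $c<a<b$ or $a=b\ne c$. $\overline{\mathrm{quinv}}(\sigma)$ is the number of triples of cells $((r+1,c),(r,c),(r,d))$ with $c<d$, $1\le r\le\lambda'_d<\lambda'_c$ and $Q(\sigma(r+1,c),\sigma(r,c),\sigma(r,d))=0$. -}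

module Defs where

open import Data.Nat using (ℕ; zero; suc; _+_; _∸_; _≤_; _<_; _≤ᵇ_; _<ᵇ_; _≡ᵇ_)
open import Data.Bool using (Bool; true; false; _∧_; _∨_; not; if_then_else_)
open import Data.Integer using (ℤ; +_) renaming (_+_ to _+ℤ_)
open import Data.List using (List; map; upTo; foldr)
open import Data.Product using (_×_; ∃₂)
open import Data.Sum using (_⊎_)
open import Relation.Binary.PropositionalEquality using (_≡_)

-- the list [a, a+1, ..., b]  (empty if b < a)
range : ℕ → ℕ → List ℕ
range a b = map (λ k → a + k) (upTo (suc b ∸ a))

sumℤ : ℕ → ℕ → (ℕ → ℤ) → ℤ
sumℤ a b f = foldr (λ k acc → f k +ℤ acc) (+ 0) (range a b)

sumℕ : ℕ → ℕ → (ℕ → ℕ) → ℕ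
sumℕ a b f = foldr (λ k acc → f k + acc) 0 (range a b)

count : ℕ → ℕ → (ℕ → Bool) → ℕ
count a b P = sumℕ a b (λ k → if P k then 1 else 0)

-- Partitions: λ is given as a function ℕ → ℕ, with parts λ 1 ≥ ... ≥ λ n > 0
-- and λ i = 0 for i > n (in particular λ_{n+1} = 0).

record IsPartition (n : ℕ) (lam : ℕ → ℕ) : Set where
  field
    positive  : ∀ i → 1 ≤ i → i ≤ n → 1 ≤ lam i
    decreasing : ∀ i → 1 ≤ i → lam (suc i) ≤ lam i
    vanishing : ∀ i → n < i → lam i ≡ 0

module _ (n : ℕ) (lam : ℕ → ℕ) where

  conj : ℕ → ℕ
  conj c = count 1 n (λ i → c ≤ᵇ lam i)

  -- (r,c) is a cell of the (French) diagram of λ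
  isCell : ℕ → ℕ → Bool
  isCell r c = (1 ≤ᵇ r) ∧ ((r ≤ᵇ conj c) ∧ (1 ≤ᵇ c))

  -- column c is a column of σ_j, i.e. λ_{j+1} < c ≤ λ_j
  inSigma : ℕ → ℕ → Bool
  inSigma j c = (lam (suc j) <ᵇ c) ∧ (c ≤ᵇ lam j)

  -- A filling is a function σ r c (row r, column c); only its values on
  -- cells matter.  Fillings in T(λ) have positive entries.
  IsFilling : (ℕ → ℕ → ℕ) → Set
  IsFilling σ = ∀ r c → 1 ≤ r → 1 ≤ c → r ≤ conj c → 1 ≤ σ r c

  LargestEntry : (ℕ → ℕ → ℕ) → ℕ → Set
  LargestEntry σ N =
    (∀ r c → 1 ≤ r → 1 ≤ c → r ≤ conj c → σ r c ≤ N) ×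
    ∃₂ (λ r c → (1 ≤ r) × (1 ≤ c) × (r ≤ conj c) × (σ r c ≡ N))

  module _ (σ : ℕ → ℕ → ℕ) where

    -- entries with the convention: 0 outside the diagram
    -- (in particular 0 on top of each column)
    E : ℕ → ℕ → ℕ
    E r c = if isCell r c then σ r c else 0

    -- Condition (I): a = common entry in row r+1, b (left) and c (right) in row r
    CondI : ℕ → ℕ → ℕ → Set
    CondI a b c = ((b < a) × (c ≤ b)) ⊎ ((a ≤ c) × (b < a)) ⊎ ((c ≤ b) × (a ≤ c))

    -- Condition (II): left column a over c, right column b over d
    CondII : ℕ → ℕ → ℕ → ℕ → Set
    CondII a c b d = a ≤ c → b ≤ d → (b ≤ a → d ≤ c) × (a < b → c ≤ d)

    -- σ_j is canonical (rows 1..j, row j+1 consists of 0's)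
    CanonicalAt : ℕ → Set
    CanonicalAt j = ∀ r → 1 ≤ r → r ≤ j → ∀ c d →
      lam (suc j) < c → c < d → d ≤ lam j →
      (E (suc r) c ≡ E (suc r) d → CondI (E (suc r) c) (E r c) (E r d)) ×
      CondII (E (suc r) c) (E r c) (E (suc r) d) (E r d)

    Canonical : Set
    Canonical = ∀ j → 1 ≤ j → j ≤ n → CanonicalAt j

    D : ℕ → ℕ → ℕ
    D i j = sumℕ 1 (lam j) (λ c →
      if inSigma j c ∧ (E i c <ᵇ E (suc i) c) then conj c ∸ i else 0)

    S* : ℕ → ℕ → ℕ → ℕ → Bool
    S* z w u v =
      ((z ≡ᵇ w) ∧ (v <ᵇ w) ∧ (u <ᵇ v)) ∨
      ((z ≤ᵇ u) ∧ (z ≡ᵇ w) ∧ (v <ᵇ w)) ∨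
      ((u <ᵇ v) ∧ (z ≤ᵇ u) ∧ (z ≡ᵇ w))

    six : ℕ → ℕ → ℕ → ℕ → Bool
    six z w u v =
      ((v <ᵇ z) ∧ (w ≤ᵇ v) ∧ (u <ᵇ w)) ∨
      ((z ≤ᵇ u) ∧ (v <ᵇ z) ∧ (w ≤ᵇ v)) ∨
      ((w <ᵇ z) ∧ (v <ᵇ w) ∧ (u <ᵇ v)) ∨
      ((u <ᵇ v) ∧ (z ≤ᵇ u) ∧ (w <ᵇ z)) ∨
      ((u <ᵇ z) ∧ (v <ᵇ u) ∧ (w ≤ᵇ v)) ∨
      ((z ≤ᵇ v) ∧ (w <ᵇ z) ∧ (u <ᵇ w))

    QS2 : ℕ → ℕ → ℕ → ℕ → Bool
    QS2 z w u v = S* z w u v ∨ six z w u v ∨ six w z v u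

    ηbar : ℕ → ℕ → ℕ
    ηbar i j = sumℕ 1 (lam j) (λ c → count 1 (lam j) (λ d →
      inSigma j c ∧ inSigma j d ∧ (c <ᵇ d) ∧
      not (QS2 (E (suc i) c) (E (suc i) d) (E i c) (E i d))))

    Q : ℕ → ℕ → ℕ → Bool
    Q a b c =
      ((a <ᵇ b) ∧ (b <ᵇ c)) ∨ ((b <ᵇ c) ∧ (c <ᵇ a)) ∨
      ((c <ᵇ a) ∧ (a <ᵇ b)) ∨ ((a ≡ᵇ b) ∧ not (b ≡ᵇ c))

    quinvBar : ℕ
    quinvBar = sumℕ 1 (lam 1) (λ c → sumℕ 1 (lam 1) (λ d → count 1 (conj d) (λ r →
      (c <ᵇ d) ∧ (conj d <ᵇ conj c) ∧ not (Q (σ (suc r) c) (σ r c) (σ r d)))))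

    module _ (N : ℕ) where

      ν : ℕ → ℕ → ℕ → ℕ
      ν i j k = count 1 (lam j) (λ c → inSigma j c ∧ (suc N ∸ k ≤ᵇ E i c))

      s : ℕ → ℕ → ℕ → ℕ → ℕ
      s i j m h = count 1 (lam j) (λ c →
        inSigma j c ∧ (E (suc i) c ≡ᵇ suc N ∸ h) ∧ (suc N ∸ m ≤ᵇ E i c))

-- Every side of the three formulas is a count over columns, or pairs of columns, of σ_j,
-- and so is every coefficient ν and s.  Writing all counts as sums of 0/1-indicators 𝟙 and
-- exchanging the order of summation, each formula becomes a sum over (pairs of) columns of
-- an indicator polynomial in the few entries involved, read in the reversed alphabet
-- β = N+1−entry; the sums over the letter k then collapse on Kronecker deltas [k = β].
-- What remains are identities between indicator polynomials in at most five numbers.  Such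
-- an identity depends only on the relative order of its arguments, so it suffices to check
-- it on arguments below the number of variables, which is done by evaluation.
-- Canonicity enters only in (b): for a canonical pair of columns c < d, the indicator of
-- ¬Q_{S₂} splits as [equal bottom entries] + pairDefect(c,d) + pairDefect(d,c), where the
-- first term comes from the binomial sum and the three terms of pairDefect from the other
-- three sums.  In (c), a quinv-triple lies in a column c of some σ_j paired with a shorter
-- column d, and ¬Q(a,b,c) = [b<a] + [c≤b] − [c<a] splits it into a descent of column c,
-- counted (λ_i − λ_j) times, and a comparison between c and d.

module Submission where

open import Defs
open import Data.Bool using (Bool; true; false; T; _∧_; _∨_; not; if_then_else_)
import Data.Bool.Properties as BP
open import Data.Empty using (⊥; ⊥-elim)
open import Data.Fin using (Fin; zero; suc)
open import Data.Integer as Z using (ℤ; +_; _+_; _-_; _*_; -_)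
import Data.Integer.Properties as ZP
open import Data.Integer.Tactic.RingSolver using (solve-∀)
open import Data.List using (List; []; _∷_; map; applyUpTo; foldr)
open import Data.Nat using (ℕ; zero; suc; _≤ᵇ_; _<ᵇ_; _≡ᵇ_; z≤n; s≤s; _≤_; _<_; _∸_) renaming (_+_ to _+ℕ_)
import Data.Nat.Properties as NP
open import Data.Nat.Combinatorics using (_C_; nCk+nC[k+1]≡[n+1]C[k+1]; nC1≡n)
open import Data.Product using (_×_; _,_; proj₁; proj₂)
open import Algebra.Properties.CommutativeSemigroup ZP.*-commutativeSemigroup using (x∙yz≈y∙xz)
open import Data.Sum using (inj₁; inj₂)
open import Data.Unit using (tt)
open import Relation.Binary.Definitions using (tri<; tri≈; tri>)
open import Relation.Binary.PropositionalEquality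
open import Relation.Nullary using (yes; no)
open import Relation.Nullary.Decidable using (⌊_⌋; toWitness)

𝟙 : Bool → ℤ
𝟙 true = + 1
𝟙 false = + 0

𝟙ℕ : Bool → ℕ
𝟙ℕ true = 1
𝟙ℕ false = 0

𝟙-∧ : ∀ x y → 𝟙 (x ∧ y) ≡ 𝟙 x * 𝟙 y
𝟙-∧ true y = sym (ZP.*-identityˡ _)
𝟙-∧ false y = refl

*-zeroʳ² : ∀ x y → x * (y * + 0) ≡ + 0
*-zeroʳ² x y = trans (cong (x *_) (ZP.*-zeroʳ y)) (ZP.*-zeroʳ x)

∧-true : ∀ {x y} → (x ∧ y) ≡ true → (x ≡ true) × (y ≡ true)
∧-true {true} {true} _ = refl , refl

T⇒≡true : ∀ {b} → T b → b ≡ true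
T⇒≡true {true} _ = refl

≡true⇒T : ∀ {b} → b ≡ true → T b
≡true⇒T refl = tt

¬T⇒≡false : ∀ {b} → (T b → ⊥) → b ≡ false
¬T⇒≡false {false} _ = refl
¬T⇒≡false {true} ¬t = ⊥-elim (¬t tt)

≤ᵇ-true : ∀ {m n} → m ≤ n → (m ≤ᵇ n) ≡ true
≤ᵇ-true p = T⇒≡true (NP.≤⇒≤ᵇ p)

<ᵇ-true : ∀ {m n} → m < n → (m <ᵇ n) ≡ true
<ᵇ-true p = T⇒≡true (NP.<⇒<ᵇ p)

≡ᵇ-refl : ∀ {m} → (m ≡ᵇ m) ≡ true
≡ᵇ-refl {m} = T⇒≡true (NP.≡⇒≡ᵇ m m refl)

≤ᵇ-sound : ∀ {m n} → (m ≤ᵇ n) ≡ true → m ≤ n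
≤ᵇ-sound {m} {n} e = NP.≤ᵇ⇒≤ m n (≡true⇒T e)

<ᵇ-sound : ∀ {m n} → (m <ᵇ n) ≡ true → m < n
<ᵇ-sound {m} {n} e = NP.<ᵇ⇒< m n (≡true⇒T e)

≡ᵇ-sound : ∀ {m n} → (m ≡ᵇ n) ≡ true → m ≡ n
≡ᵇ-sound {m} {n} e = NP.≡ᵇ⇒≡ m n (≡true⇒T e)

≤ᵇ-false : ∀ {m n} → n < m → (m ≤ᵇ n) ≡ false
≤ᵇ-false n<m = ¬T⇒≡false (λ t → NP.<⇒≱ n<m (NP.≤ᵇ⇒≤ _ _ t))

<ᵇ-false : ∀ {m n} → n ≤ m → (m <ᵇ n) ≡ false
<ᵇ-false n≤m = ¬T⇒≡false (λ t → NP.≤⇒≯ n≤m (NP.<ᵇ⇒< _ _ t))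

≡ᵇ-false : ∀ {m n} → m ≢ n → (m ≡ᵇ n) ≡ false
≡ᵇ-false m≢n = ¬T⇒≡false (λ t → m≢n (NP.≡ᵇ⇒≡ _ _ t))

true≢false : true ≢ false
true≢false ()

≤ᵇ-false-sound : ∀ {m n} → (m ≤ᵇ n) ≡ false → n < m
≤ᵇ-false-sound e = NP.≰⇒> (λ p → true≢false (trans (sym (≤ᵇ-true p)) e))

<ᵇ-false-sound : ∀ {m n} → (m <ᵇ n) ≡ false → n ≤ m
<ᵇ-false-sound e = NP.≮⇒≥ (λ p → true≢false (trans (sym (<ᵇ-true p)) e))

≡ᵇ-false-sound : ∀ {m n} → (m ≡ᵇ n) ≡ false → m ≢ n
≡ᵇ-false-sound {m} e refl = true≢false (trans (sym (≡ᵇ-refl {m})) e)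

≡ᵇ-sym : ∀ a b → (a ≡ᵇ b) ≡ (b ≡ᵇ a)
≡ᵇ-sym zero zero = refl
≡ᵇ-sym zero (suc b) = refl
≡ᵇ-sym (suc a) zero = refl
≡ᵇ-sym (suc a) (suc b) = ≡ᵇ-sym a b

<ᵇ-suc : ∀ x y → (x <ᵇ suc y) ≡ (x ≤ᵇ y)
<ᵇ-suc zero y = refl
<ᵇ-suc (suc x) zero = refl
<ᵇ-suc (suc x) (suc y) = refl

<ᵇ≡not-≤ᵇ : ∀ a b → (a <ᵇ b) ≡ not (b ≤ᵇ a)
<ᵇ≡not-≤ᵇ a b with a <ᵇ b in e
... | true = sym (cong not (≤ᵇ-false (<ᵇ-sound {a} {b} e)))
... | false = sym (cong not (≤ᵇ-true (<ᵇ-false-sound {a} {b} e)))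

≤ᵇ∧not-suc≤ᵇ≡≡ᵇ : ∀ j m → (not (suc j ≤ᵇ m) ∧ (j ≤ᵇ m)) ≡ (j ≡ᵇ m)
≤ᵇ∧not-suc≤ᵇ≡≡ᵇ zero zero = refl
≤ᵇ∧not-suc≤ᵇ≡≡ᵇ zero (suc m) = refl
≤ᵇ∧not-suc≤ᵇ≡≡ᵇ (suc j) zero = refl
≤ᵇ∧not-suc≤ᵇ≡≡ᵇ (suc j) (suc m) =
  trans (cong₂ (λ x y → not x ∧ y) (<ᵇ-suc (suc j) m) (<ᵇ-suc j m)) (≤ᵇ∧not-suc≤ᵇ≡≡ᵇ j m)

𝟙-≤ᵇ-step : ∀ p k → 𝟙 (suc p ≤ᵇ suc k) - 𝟙 (suc p ≤ᵇ k) ≡ 𝟙 (k ≡ᵇ p)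
𝟙-≤ᵇ-step zero zero = refl
𝟙-≤ᵇ-step zero (suc k) = refl
𝟙-≤ᵇ-step (suc p) zero = refl
𝟙-≤ᵇ-step (suc p) (suc k) = 𝟙-≤ᵇ-step p k

𝟙-≤ᵇ-pred : ∀ β k → 1 ≤ β → 𝟙 (β ≤ᵇ k) ≡ 𝟙 (β ≤ᵇ k ∸ 1) + 𝟙 (β ≡ᵇ k)
𝟙-≤ᵇ-pred (suc p) zero _ = refl
𝟙-≤ᵇ-pred (suc p) (suc k) _ =
  trans (a≡b+[a-b] (𝟙 (suc p ≤ᵇ suc k)) (𝟙 (suc p ≤ᵇ k)))
    (cong (λ z → 𝟙 (suc p ≤ᵇ k) + z) (trans (𝟙-≤ᵇ-step p k) (cong 𝟙 (≡ᵇ-sym k p))))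
  where
  a≡b+[a-b] : ∀ a b → a ≡ b + (a - b)
  a≡b+[a-b] = solve-∀

∸≤ᵇ : ∀ x b k → (x ∸ b ≤ᵇ k) ≡ (x ≤ᵇ b +ℕ k)
∸≤ᵇ zero zero k = refl
∸≤ᵇ zero (suc b) k = refl
∸≤ᵇ (suc x) zero k = refl
∸≤ᵇ (suc x) (suc b) k = trans (∸≤ᵇ x b k) (sym (<ᵇ-suc x (b +ℕ k)))

∸≤ᵇ-comm : ∀ x k b → (x ∸ k ≤ᵇ b) ≡ (x ∸ b ≤ᵇ k)
∸≤ᵇ-comm x k b = trans (∸≤ᵇ x k b) (trans (cong (x ≤ᵇ_) (NP.+-comm k b)) (sym (∸≤ᵇ x b k)))

≡ᵇ∸-comm : ∀ {t h x} → t ≤ x → h ≤ x → (t ≡ᵇ x ∸ h) ≡ (h ≡ᵇ x ∸ t)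
≡ᵇ∸-comm {t} {h} {x} t≤x h≤x with t ≡ᵇ x ∸ h in e
... | true = sym (subst (λ z → (h ≡ᵇ x ∸ z) ≡ true) (sym (≡ᵇ-sound {t} e))
               (subst (λ z → (h ≡ᵇ z) ≡ true) (sym (NP.m∸[m∸n]≡n h≤x)) (≡ᵇ-refl {h})))
... | false = sym (≡ᵇ-false {h} {x ∸ t} λ q → ≡ᵇ-false-sound {t} {x ∸ h} e
                (trans (sym (NP.m∸[m∸n]≡n t≤x)) (cong (x ∸_) (sym q))))

∸-reverses-≤ᵇ : ∀ {x y K} → x ≤ K → y ≤ K → (K ∸ x ≤ᵇ K ∸ y) ≡ (y ≤ᵇ x)
∸-reverses-≤ᵇ {x} {y} {K} x≤K y≤K with y ≤ᵇ x in e
... | true = ≤ᵇ-true (NP.∸-monoʳ-≤ K (≤ᵇ-sound {y} {x} e))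
... | false = ≤ᵇ-false (NP.∸-monoʳ-< (≤ᵇ-false-sound {y} {x} e) y≤K)

∸-reverses-<ᵇ : ∀ {x y K} → x ≤ K → y ≤ K → (K ∸ x <ᵇ K ∸ y) ≡ (y <ᵇ x)
∸-reverses-<ᵇ {x} {y} {K} x≤K y≤K with y <ᵇ x in e
... | true = <ᵇ-true (NP.∸-monoʳ-< (<ᵇ-sound {y} {x} e) x≤K)
... | false = <ᵇ-false (NP.∸-monoʳ-≤ K (<ᵇ-false-sound {y} {x} e))

∸-injective-≡ᵇ : ∀ {x y K} → x ≤ K → y ≤ K → (K ∸ x ≡ᵇ K ∸ y) ≡ (x ≡ᵇ y)
∸-injective-≡ᵇ {x} {y} {K} x≤K y≤K with x ≡ᵇ y in e
... | true rewrite ≡ᵇ-sound {x} {y} e = ≡ᵇ-refl {K ∸ y}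
... | false = ≡ᵇ-false (λ q → ≡ᵇ-false-sound {x} e (NP.∸-cancelˡ-≡ x≤K y≤K q))

∑ : ℕ → (ℕ → ℤ) → ℤ
∑ zero f = + 0
∑ (suc m) f = f 0 + ∑ m (λ k → f (suc k))

∑-cong : ∀ m {f g : ℕ → ℤ} → (∀ k → k < m → f k ≡ g k) → ∑ m f ≡ ∑ m g
∑-cong zero h = refl
∑-cong (suc m) h = cong₂ _+_ (h 0 (s≤s z≤n)) (∑-cong m (λ k k<m → h (suc k) (s≤s k<m)))

∑-+ : ∀ m (f g : ℕ → ℤ) → ∑ m (λ k → f k + g k) ≡ ∑ m f + ∑ m g
∑-+ zero f g = refl
∑-+ (suc m) f g rewrite ∑-+ m (λ k → f (suc k)) (λ k → g (suc k)) =
  interchange (f 0) (g 0) (∑ m (λ k → f (suc k))) (∑ m (λ k → g (suc k)))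
  where
  interchange : ∀ a b c d → a + b + (c + d) ≡ a + c + (b + d)
  interchange = solve-∀

∑-*ˡ : ∀ m x (f : ℕ → ℤ) → ∑ m (λ k → x * f k) ≡ x * ∑ m f
∑-*ˡ zero x f = sym (ZP.*-zeroʳ x)
∑-*ˡ (suc m) x f rewrite ∑-*ˡ m x (λ k → f (suc k)) = sym (ZP.*-distribˡ-+ x (f 0) _)

∑-*ʳ : ∀ m x (f : ℕ → ℤ) → ∑ m (λ k → f k * x) ≡ ∑ m f * x
∑-*ʳ m x f = trans (∑-cong m (λ k _ → ZP.*-comm (f k) x)) (trans (∑-*ˡ m x f) (ZP.*-comm x _))

∑-0 : ∀ m → ∑ m (λ _ → + 0) ≡ + 0
∑-0 zero = refl
∑-0 (suc m) rewrite ∑-0 m = refl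

∑-neg : ∀ m (f : ℕ → ℤ) → ∑ m (λ k → - f k) ≡ - ∑ m f
∑-neg zero f = refl
∑-neg (suc m) f rewrite ∑-neg m (λ k → f (suc k)) = sym (ZP.neg-distrib-+ (f 0) _)

∑-sub : ∀ m (f g : ℕ → ℤ) → ∑ m (λ k → f k - g k) ≡ ∑ m f - ∑ m g
∑-sub m f g = trans (∑-+ m f (λ k → - g k)) (cong (λ z → ∑ m f + z) (∑-neg m g))

∑-comm : ∀ m n (f : ℕ → ℕ → ℤ) → ∑ m (λ a → ∑ n (λ b → f a b)) ≡ ∑ n (λ b → ∑ m (λ a → f a b))
∑-comm zero n f = sym (∑-0 n)
∑-comm (suc m) n f rewrite ∑-comm m n (λ a b → f (suc a) b) =
  sym (∑-+ n (λ b → f 0 b) (λ b → ∑ m (λ a → f (suc a) b)))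

∑-split : ∀ a b (f : ℕ → ℤ) → ∑ (a +ℕ b) f ≡ ∑ a f + ∑ b (λ k → f (a +ℕ k))
∑-split zero b f = sym (ZP.+-identityˡ _)
∑-split (suc a) b f rewrite ∑-split a b (λ k → f (suc k)) = sym (ZP.+-assoc (f 0) _ _)

∑-vanish : ∀ m (f : ℕ → ℤ) → (∀ k → k < m → f k ≡ + 0) → ∑ m f ≡ + 0
∑-vanish m f h = trans (∑-cong m h) (∑-0 m)

∑-𝟙≡ : ∀ m k0 (g : ℕ → ℤ) → ∑ m (λ k → 𝟙 (k ≡ᵇ k0) * g k) ≡ 𝟙 (k0 <ᵇ m) * g k0
∑-𝟙≡ zero k0 g = refl
∑-𝟙≡ (suc m) zero g = trans (cong (λ z → + 1 * g 0 + z) (∑-vanish m _ (λ k _ → refl))) (ZP.+-identityʳ _)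
∑-𝟙≡ (suc m) (suc k0) g = trans (ZP.+-identityˡ _) (∑-𝟙≡ m k0 (λ k → g (suc k)))

private
  foldr≡∑ : ∀ (f : ℕ → ℤ) (φ : ℕ → ℕ) (h : ℕ → ℕ) m →
    foldr (λ k acc → f k + acc) (+ 0) (map φ (applyUpTo h m)) ≡ ∑ m (λ k → f (φ (h k)))
  foldr≡∑ f φ h zero = refl
  foldr≡∑ f φ h (suc m) = cong (λ z → f (φ (h 0)) + z) (foldr≡∑ f φ (λ k → h (suc k)) m)

sumℤ≡∑ : ∀ a b f → sumℤ a b f ≡ ∑ (suc b ∸ a) (λ k → f (a +ℕ k))
sumℤ≡∑ a b f = foldr≡∑ f (a +ℕ_) (λ k → k) (suc b ∸ a)

inRange : ℕ → ℕ → ℕ → Bool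
inRange a b k = (a ≤ᵇ k) ∧ (k ≤ᵇ b)

inRange-1-pred : ∀ N k → inRange 1 (N ∸ 1) k ≡ ((1 ≤ᵇ k) ∧ (k <ᵇ N))
inRange-1-pred N zero = refl
inRange-1-pred zero (suc k) = refl
inRange-1-pred (suc N) (suc k) = refl

sumℤ≡∑𝟙 : ∀ a b M f → b < M → sumℤ a b f ≡ ∑ M (λ k → 𝟙 (inRange a b k) * f k)
sumℤ≡∑𝟙 a b M f b<M with NP.≤-<-connex a b
... | inj₂ b<a = trans (sumℤ≡∑ a b f) (trans (cong (λ z → ∑ z (λ k → f (a +ℕ k))) (NP.m≤n⇒m∸n≡0 b<a))
        (sym (∑-vanish M _ (λ k _ → outside k))))
  where
  outside : ∀ k → 𝟙 (inRange a b k) * f k ≡ + 0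
  outside k with a ≤ᵇ k in e1 | k ≤ᵇ b in e2
  ... | false | _ = refl
  ... | true | false = refl
  ... | true | true = ⊥-elim (NP.<-irrefl refl (NP.<-≤-trans b<a (NP.≤-trans (≤ᵇ-sound e1) (≤ᵇ-sound e2))))
... | inj₁ a≤b = trans (sumℤ≡∑ a b f) (sym restrict)
  where
  len r : ℕ
  len = suc b ∸ a
  r = M ∸ (a +ℕ len)
  a+len≡1+b : a +ℕ len ≡ suc b
  a+len≡1+b = NP.m+[n∸m]≡n (NP.≤-trans a≤b (NP.n≤1+n b))
  M≡a+len+r : M ≡ a +ℕ (len +ℕ r)
  M≡a+len+r = trans (sym (NP.m+[n∸m]≡n (subst (_≤ M) (sym a+len≡1+b) b<M))) (NP.+-assoc a len r)
  g : ℕ → ℤ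
  g k = 𝟙 (inRange a b k) * f k
  before : ∑ a g ≡ + 0
  before = ∑-vanish a g (λ k k<a → cong (λ z → 𝟙 (z ∧ (k ≤ᵇ b)) * f k) (≤ᵇ-false k<a))
  within : ∑ len (λ k → g (a +ℕ k)) ≡ ∑ len (λ k → f (a +ℕ k))
  within = ∑-cong len (λ k k<len → trans (cong₂ (λ x y → 𝟙 (x ∧ y) * f (a +ℕ k))
         (≤ᵇ-true (NP.m≤m+n a k))
         (≤ᵇ-true (NP.≤-pred (subst (a +ℕ k <_) a+len≡1+b (NP.+-monoʳ-< a k<len)))))
         (ZP.*-identityˡ _))
  after : ∑ r (λ k → g (a +ℕ (len +ℕ k))) ≡ + 0
  after = ∑-vanish r _ (λ k _ → trans (cong (λ z → 𝟙 ((a ≤ᵇ (a +ℕ (len +ℕ k))) ∧ z) * f (a +ℕ (len +ℕ k)))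
         (≤ᵇ-false (subst (_≤ a +ℕ (len +ℕ k)) a+len≡1+b
            (subst (a +ℕ len ≤_) (NP.+-assoc a len k) (NP.m≤m+n (a +ℕ len) k)))))
         (cong (λ b → 𝟙 b * f (a +ℕ (len +ℕ k))) (BP.∧-zeroʳ (a ≤ᵇ (a +ℕ (len +ℕ k))))))
  restrict : ∑ M g ≡ ∑ len (λ k → f (a +ℕ k))
  restrict = begin
      ∑ M g ≡⟨ cong (λ z → ∑ z g) M≡a+len+r ⟩
      ∑ (a +ℕ (len +ℕ r)) g ≡⟨ ∑-split a (len +ℕ r) g ⟩
      ∑ a g + ∑ (len +ℕ r) (λ k → g (a +ℕ k)) ≡⟨ cong₂ _+_ before (∑-split len r (λ k → g (a +ℕ k))) ⟩
      + 0 + (∑ len (λ k → g (a +ℕ k)) + ∑ r (λ k → g (a +ℕ (len +ℕ k)))) ≡⟨ cong (λ z → + 0 + (∑ len (λ k → g (a +ℕ k)) + z)) after ⟩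
      + 0 + (∑ len (λ k → g (a +ℕ k)) + + 0) ≡⟨ trans (ZP.+-identityˡ _) (ZP.+-identityʳ _) ⟩
      ∑ len (λ k → g (a +ℕ k)) ≡⟨ within ⟩
      ∑ len (λ k → f (a +ℕ k)) ∎
    where open ≡-Reasoning

private
  foldr-+ : ∀ (f : ℕ → ℕ) (l : List ℕ) → + foldr (λ k acc → f k +ℕ acc) 0 l ≡ foldr (λ k acc → + f k + acc) (+ 0) l
  foldr-+ f [] = refl
  foldr-+ f (x ∷ l) = cong (λ z → + f x + z) (foldr-+ f l)

+sumℕ≡sumℤ : ∀ a b f → + sumℕ a b f ≡ sumℤ a b (λ k → + f k)
+sumℕ≡sumℤ a b f = foldr-+ f (range a b)

sumℕ≡∑𝟙 : ∀ a b M f → b < M → + sumℕ a b f ≡ ∑ M (λ k → 𝟙 (inRange a b k) * + f k)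
sumℕ≡∑𝟙 a b M f b<M = trans (+sumℕ≡sumℤ a b f) (sumℤ≡∑𝟙 a b M _ b<M)

if≡𝟙 : ∀ (x : Bool) → + (if x then 1 else 0) ≡ 𝟙 x
if≡𝟙 true = refl
if≡𝟙 false = refl

count≡∑𝟙 : ∀ a b M P → b < M → + count a b P ≡ ∑ M (λ k → 𝟙 (inRange a b k) * 𝟙 (P k))
count≡∑𝟙 a b M P b<M = trans (sumℕ≡∑𝟙 a b M _ b<M) (∑-cong M (λ k _ → cong (𝟙 (inRange a b k) *_) (if≡𝟙 (P k))))

∑*∑ : ∀ m n (f g : ℕ → ℤ) → ∑ m f * ∑ n g ≡ ∑ m (λ c → ∑ n (λ d → f c * g d))
∑*∑ m n f g = trans (sym (∑-*ʳ m (∑ n g) f)) (∑-cong m (λ c _ → sym (∑-*ˡ n (f c) g)))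

∑-1 : ∀ m → ∑ m (λ _ → + 1) ≡ + m
∑-1 zero = refl
∑-1 (suc m) rewrite ∑-1 m = refl

countBelow : ℕ → (ℕ → Bool) → ℕ
countBelow zero p = 0
countBelow (suc M) p = 𝟙ℕ (p 0) +ℕ countBelow M (λ c → p (suc c))

countBelow≡∑𝟙 : ∀ M p → + countBelow M p ≡ ∑ M (λ c → 𝟙 (p c))
countBelow≡∑𝟙 zero p = refl
countBelow≡∑𝟙 (suc M) p with p 0
... | true = cong (λ z → + 1 + z) (countBelow≡∑𝟙 M (λ c → p (suc c)))
... | false = trans (countBelow≡∑𝟙 M (λ c → p (suc c))) (sym (ZP.+-identityˡ _))

countBelow-C2 : ∀ M p → + (countBelow M p C 2) ≡ ∑ M (λ c → ∑ M (λ d → 𝟙 (c <ᵇ d) * (𝟙 (p c) * 𝟙 (p d))))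
countBelow-C2 zero p = refl
countBelow-C2 (suc M) p = trans lhs (sym rhs)
  where
  r : ℕ
  r = countBelow M (λ c → p (suc c))
  row0 : ∑ (suc M) (λ d → 𝟙 (0 <ᵇ d) * (𝟙 (p 0) * 𝟙 (p d))) ≡ 𝟙 (p 0) * + r
  row0 = trans (ZP.+-identityˡ _) (trans (∑-cong M (λ d _ → ZP.*-identityˡ (𝟙 (p 0) * 𝟙 (p (suc d)))))
           (trans (∑-*ˡ M (𝟙 (p 0)) (λ d → 𝟙 (p (suc d)))) (cong (𝟙 (p 0) *_) (sym (countBelow≡∑𝟙 M (λ c → p (suc c)))))))
  rowS : ∀ c → ∑ (suc M) (λ d → 𝟙 (suc c <ᵇ d) * (𝟙 (p (suc c)) * 𝟙 (p d))) ≡ ∑ M (λ d → 𝟙 (c <ᵇ d) * (𝟙 (p (suc c)) * 𝟙 (p (suc d))))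
  rowS c = ZP.+-identityˡ _
  rhs : ∑ (suc M) (λ c → ∑ (suc M) (λ d → 𝟙 (c <ᵇ d) * (𝟙 (p c) * 𝟙 (p d)))) ≡ 𝟙 (p 0) * + r + + (r C 2)
  rhs = cong₂ _+_ row0 (trans (∑-cong M (λ c _ → rowS c)) (sym (countBelow-C2 M (λ c → p (suc c)))))
  lhs : + ((𝟙ℕ (p 0) +ℕ r) C 2) ≡ 𝟙 (p 0) * + r + + (r C 2)
  lhs with p 0
  ... | false = refl
  ... | true = trans (cong +_ (trans (sym (nCk+nC[k+1]≡[n+1]C[k+1] r 1)) (cong (_+ℕ (r C 2)) (nC1≡n r))))
                 (cong (_+ + (r C 2)) (sym (ZP.*-identityˡ (+ r))))

∑∑-symmetrize : ∀ M (Kf : ℕ → ℕ → ℤ) → ∑ M (λ c → ∑ M (λ d → Kf c d)) ≡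
  ∑ M (λ c → ∑ M (λ d → 𝟙 (c <ᵇ d) * (Kf c d + Kf d c))) + ∑ M (λ c → Kf c c)
∑∑-symmetrize M Kf = begin
    ∑ M (λ c → ∑ M (λ d → Kf c d))
  ≡⟨ ∑-cong M (λ c _ → ∑-cong M (λ d _ → split c d)) ⟩
    ∑ M (λ c → ∑ M (λ d → (A c d + B c d) + Cc c d))
  ≡⟨ ∑-cong M (λ c _ → trans (∑-+ M (λ d → A c d + B c d) (Cc c)) (cong (λ z → z + ∑ M (Cc c)) (∑-+ M (A c) (B c)))) ⟩
    ∑ M (λ c → (∑ M (A c) + ∑ M (B c)) + ∑ M (Cc c))
  ≡⟨ trans (∑-+ M (λ c → ∑ M (A c) + ∑ M (B c)) (λ c → ∑ M (Cc c))) (cong (λ z → z + ∑ M (λ c → ∑ M (Cc c))) (∑-+ M (λ c → ∑ M (A c)) (λ c → ∑ M (B c)))) ⟩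
    (∑ M (λ c → ∑ M (A c)) + ∑ M (λ c → ∑ M (B c))) + ∑ M (λ c → ∑ M (Cc c))
  ≡⟨ cong₂ _+_ (cong (λ z → ∑ M (λ c → ∑ M (A c)) + z) (∑-comm M M B)) (∑-cong M (λ c _ → ∑-𝟙≡ M c (Kf c))) ⟩
    (∑ M (λ c → ∑ M (A c)) + ∑ M (λ d → ∑ M (λ c → B c d))) + ∑ M (λ c → 𝟙 (c <ᵇ M) * Kf c c)
  ≡⟨ cong₂ _+_ (sym (trans (∑-cong M (λ c _ → ∑-+ M (A c) (λ d → 𝟙 (c <ᵇ d) * Kf d c)))
                   (∑-+ M (λ c → ∑ M (A c)) (λ c → ∑ M (λ d → 𝟙 (c <ᵇ d) * Kf d c)))))
               (∑-cong M (λ c c<M → trans (cong (λ z → 𝟙 z * Kf c c) (<ᵇ-true c<M)) (ZP.*-identityˡ (Kf c c)))) ⟩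
    ∑ M (λ c → ∑ M (λ d → A c d + 𝟙 (c <ᵇ d) * Kf d c)) + ∑ M (λ c → Kf c c)
  ≡⟨ cong (_+ ∑ M (λ c → Kf c c)) (∑-cong M (λ c _ → ∑-cong M (λ d _ → sym (ZP.*-distribˡ-+ (𝟙 (c <ᵇ d)) (Kf c d) (Kf d c))))) ⟩
    ∑ M (λ c → ∑ M (λ d → 𝟙 (c <ᵇ d) * (Kf c d + Kf d c))) + ∑ M (λ c → Kf c c) ∎
  where
  open ≡-Reasoning
  A B Cc : ℕ → ℕ → ℤ
  A c d = 𝟙 (c <ᵇ d) * Kf c d
  B c d = 𝟙 (d <ᵇ c) * Kf c d
  Cc c d = 𝟙 (d ≡ᵇ c) * Kf c d
  split : ∀ c d → Kf c d ≡ (A c d + B c d) + Cc c d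
  split c d with NP.<-cmp c d
  ... | tri< a _ _ rewrite <ᵇ-true a | <ᵇ-false (NP.<⇒≤ a) | ≡ᵇ-false (λ q → NP.<⇒≢ a (sym q)) =
        sym (trans (ZP.+-identityʳ (+ 1 * Kf c d + + 0)) (trans (ZP.+-identityʳ (+ 1 * Kf c d)) (ZP.*-identityˡ (Kf c d))))
  ... | tri≈ _ refl _ rewrite <ᵇ-false (NP.≤-refl {c}) | ≡ᵇ-refl {c} = sym (trans (ZP.+-identityˡ (+ 1 * Kf c c)) (ZP.*-identityˡ (Kf c c)))
  ... | tri> _ _ a rewrite <ᵇ-true a | <ᵇ-false (NP.<⇒≤ a) | ≡ᵇ-false (NP.<⇒≢ a) =
        sym (trans (ZP.+-identityʳ (+ 0 + + 1 * Kf c d)) (trans (ZP.+-identityˡ (+ 1 * Kf c d)) (ZP.*-identityˡ (Kf c d))))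

∑-extend : ∀ L M (f : ℕ → ℤ) → L ≤ M → (∀ k → L ≤ k → k < M → f k ≡ + 0) → ∑ L f ≡ ∑ M f
∑-extend L M f L≤M h = trans (sym (ZP.+-identityʳ (∑ L f)))
  (trans (cong (λ z → ∑ L f + z) (sym (∑-vanish (M ∸ L) (λ k → f (L +ℕ k))
      (λ k k<r → h (L +ℕ k) (NP.m≤m+n L k) (subst (L +ℕ k <_) (NP.m+[n∸m]≡n L≤M) (NP.+-monoʳ-< L k<r))))))
    (trans (sym (∑-split L (M ∸ L) f)) (cong (λ z → ∑ z f) (NP.m+[n∸m]≡n L≤M))))

∑∑-𝟙≡ : ∀ m k0 h0 (G : ℕ → ℕ → ℤ) → ∑ m (λ k → ∑ m (λ h → 𝟙 (k ≡ᵇ k0) * (𝟙 (h ≡ᵇ h0) * G k h)))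
  ≡ 𝟙 (k0 <ᵇ m) * (𝟙 (h0 <ᵇ m) * G k0 h0)
∑∑-𝟙≡ m k0 h0 G = trans (∑-cong m (λ k _ → trans (∑-*ˡ m (𝟙 (k ≡ᵇ k0)) (λ h → 𝟙 (h ≡ᵇ h0) * G k h))
    (cong (𝟙 (k ≡ᵇ k0) *_) (∑-𝟙≡ m h0 (G k)))))
  (∑-𝟙≡ m k0 (λ k → 𝟙 (h0 <ᵇ m) * G k h0))

∑∑-*ˡ : ∀ A B a (f : ℕ → ℕ → ℤ) → a * ∑ A (λ c → ∑ B (λ d → f c d)) ≡ ∑ A (λ c → ∑ B (λ d → a * f c d))
∑∑-*ˡ A B a f = trans (sym (∑-*ˡ A a (λ c → ∑ B (λ d → f c d)))) (∑-cong A (λ c _ → sym (∑-*ˡ B a (f c))))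

∑∑-+ : ∀ A (f g : ℕ → ℕ → ℤ) →
  ∑ A (λ c → ∑ A (λ d → f c d + g c d)) ≡ ∑ A (λ c → ∑ A (f c)) + ∑ A (λ c → ∑ A (g c))
∑∑-+ A f g = trans (∑-cong A (λ c _ → ∑-+ A (f c) (g c))) (∑-+ A (λ c → ∑ A (f c)) (λ c → ∑ A (g c)))

∑⁴-comm : ∀ A A' B (g : ℕ → ℕ → ℕ → ℕ → ℤ) → ∑ A (λ k → ∑ A' (λ h → ∑ B (λ c → ∑ B (λ d → g k h c d))))
  ≡ ∑ B (λ c → ∑ B (λ d → ∑ A (λ k → ∑ A' (λ h → g k h c d))))
∑⁴-comm A A' B g =
  trans (∑-cong A (λ k _ → trans (∑-comm A' B (λ h c → ∑ B (λ d → g k h c d)))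
                             (∑-cong B (λ c _ → ∑-comm A' B (λ h d → g k h c d)))))
    (trans (∑-comm A B (λ k c → ∑ B (λ d → ∑ A' (λ h → g k h c d))))
      (∑-cong B (λ c _ → ∑-comm A B (λ k d → ∑ A' (λ h → g k h c d)))))

*-distribˡ-sub : ∀ a x y → a * x - a * y ≡ a * (x - y)
*-distribˡ-sub = solve-∀

module OrderTypes where

  data BoolExpr (V : ℕ) : Set where
    LE LT EQ : Fin V → Fin V → BoolExpr V
    AND OR : BoolExpr V → BoolExpr V → BoolExpr V
    NOT : BoolExpr V → BoolExpr V
    TT FF : BoolExpr V

  data IntExpr (V : ℕ) : Set where
    IND : BoolExpr V → IntExpr V
    ADD SUB MUL : IntExpr V → IntExpr V → IntExpr V

  module _ {V : ℕ} where
    evalᵇ : (Fin V → ℕ) → BoolExpr V → Bool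
    evalᵇ ρ (LE x y) = ρ x ≤ᵇ ρ y
    evalᵇ ρ (LT x y) = ρ x <ᵇ ρ y
    evalᵇ ρ (EQ x y) = ρ x ≡ᵇ ρ y
    evalᵇ ρ (AND a b) = evalᵇ ρ a ∧ evalᵇ ρ b
    evalᵇ ρ (OR a b) = evalᵇ ρ a ∨ evalᵇ ρ b
    evalᵇ ρ (NOT a) = not (evalᵇ ρ a)
    evalᵇ ρ TT = true
    evalᵇ ρ FF = false

    evalℤ : (Fin V → ℕ) → IntExpr V → ℤ
    evalℤ ρ (IND b) = 𝟙 (evalᵇ ρ b)
    evalℤ ρ (ADD a b) = evalℤ ρ a + evalℤ ρ b
    evalℤ ρ (SUB a b) = evalℤ ρ a - evalℤ ρ b
    evalℤ ρ (MUL a b) = evalℤ ρ a * evalℤ ρ b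

    module Invariance (ρ σ : Fin V → ℕ)
      (pl : ∀ x y → (ρ x ≤ᵇ ρ y) ≡ (σ x ≤ᵇ σ y))
      (pt : ∀ x y → (ρ x <ᵇ ρ y) ≡ (σ x <ᵇ σ y))
      (pe : ∀ x y → (ρ x ≡ᵇ ρ y) ≡ (σ x ≡ᵇ σ y)) where
      evalᵇ-invariant : ∀ e → evalᵇ ρ e ≡ evalᵇ σ e
      evalᵇ-invariant (LE x y) = pl x y
      evalᵇ-invariant (LT x y) = pt x y
      evalᵇ-invariant (EQ x y) = pe x y
      evalᵇ-invariant (AND a b) = cong₂ _∧_ (evalᵇ-invariant a) (evalᵇ-invariant b)
      evalᵇ-invariant (OR a b) = cong₂ _∨_ (evalᵇ-invariant a) (evalᵇ-invariant b)
      evalᵇ-invariant (NOT a) = cong not (evalᵇ-invariant a)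
      evalᵇ-invariant TT = refl
      evalᵇ-invariant FF = refl
      evalℤ-invariant : ∀ e → evalℤ ρ e ≡ evalℤ σ e
      evalℤ-invariant (IND b) = cong 𝟙 (evalᵇ-invariant b)
      evalℤ-invariant (ADD a b) = cong₂ _+_ (evalℤ-invariant a) (evalℤ-invariant b)
      evalℤ-invariant (SUB a b) = cong₂ _-_ (evalℤ-invariant a) (evalℤ-invariant b)
      evalℤ-invariant (MUL a b) = cong₂ _*_ (evalℤ-invariant a) (evalℤ-invariant b)

  ∑Fin : ∀ V → (Fin V → ℕ) → ℕ
  ∑Fin zero f = 0
  ∑Fin (suc V) f = f zero +ℕ ∑Fin V (λ x → f (suc x))

  ∑Fin-mono : ∀ V (f g : Fin V → ℕ) → (∀ x → f x ≤ g x) → ∑Fin V f ≤ ∑Fin V g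
  ∑Fin-mono zero f g h = z≤n
  ∑Fin-mono (suc V) f g h = NP.+-mono-≤ (h zero) (∑Fin-mono V _ _ (λ x → h (suc x)))

  ∑Fin-strict : ∀ V (f g : Fin V → ℕ) → (∀ x → f x ≤ g x) → ∀ z → f z < g z → ∑Fin V f < ∑Fin V g
  ∑Fin-strict (suc V) f g h zero lt = NP.+-mono-<-≤ lt (∑Fin-mono V _ _ (λ x → h (suc x)))
  ∑Fin-strict (suc V) f g h (suc z) lt = NP.+-mono-≤-< (h zero) (∑Fin-strict V _ _ (λ x → h (suc x)) z lt)

  ∑Fin-bound : ∀ V (f : Fin V → ℕ) → (∀ x → f x ≤ 1) → ∀ z → f z ≡ 0 → ∑Fin V f < V
  ∑Fin-bound (suc V) f h zero e rewrite e = s≤s (∑Fin≤V V (λ x → f (suc x)) (λ x → h (suc x)))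
    where
    ∑Fin≤V : ∀ V (f : Fin V → ℕ) → (∀ x → f x ≤ 1) → ∑Fin V f ≤ V
    ∑Fin≤V zero f h = z≤n
    ∑Fin≤V (suc V) f h = NP.+-mono-≤ (h zero) (∑Fin≤V V _ (λ x → h (suc x)))
  ∑Fin-bound (suc V) f h (suc z) e = NP.+-mono-≤-< (h zero) (∑Fin-bound V (λ x → f (suc x)) (λ x → h (suc x)) z e)

  module Rank {V : ℕ} (ρ : Fin V → ℕ) where
    rank : Fin V → ℕ
    rank x = ∑Fin V (λ y → 𝟙ℕ (ρ y <ᵇ ρ x))

    𝟙ℕ≤1 : ∀ b → 𝟙ℕ b ≤ 1
    𝟙ℕ≤1 true = s≤s z≤n
    𝟙ℕ≤1 false = z≤n

    rank<V : ∀ x → rank x < V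
    rank<V x = ∑Fin-bound V _ (λ y → 𝟙ℕ≤1 _) x (cong 𝟙ℕ (<ᵇ-false {ρ x} {ρ x} NP.≤-refl))

    rank-strict : ∀ x y → ρ x < ρ y → rank x < rank y
    rank-strict x y lt = ∑Fin-strict V _ _ monotone x (subst₂ _<_ (sym (cong 𝟙ℕ (<ᵇ-false {ρ x} {ρ x} NP.≤-refl))) (sym (cong 𝟙ℕ (<ᵇ-true lt))) (s≤s z≤n))
      where
      monotone : ∀ z → 𝟙ℕ (ρ z <ᵇ ρ x) ≤ 𝟙ℕ (ρ z <ᵇ ρ y)
      monotone z with ρ z <ᵇ ρ x in e
      ... | false = z≤n
      ... | true rewrite <ᵇ-true (NP.<-trans (<ᵇ-sound e) lt) = s≤s z≤n

    rank-cong : ∀ x y → ρ x ≡ ρ y → rank x ≡ rank y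
    rank-cong x y e = cong (λ v → ∑Fin V (λ z → 𝟙ℕ (ρ z <ᵇ v))) e

    rank-comparisons : ∀ x y → ((ρ x ≤ᵇ ρ y) ≡ (rank x ≤ᵇ rank y)) × ((ρ x <ᵇ ρ y) ≡ (rank x <ᵇ rank y)) × ((ρ x ≡ᵇ ρ y) ≡ (rank x ≡ᵇ rank y))
    rank-comparisons x y with NP.<-cmp (ρ x) (ρ y)
    ... | tri< a _ _ = let r = rank-strict x y a in
          trans (≤ᵇ-true (NP.<⇒≤ a)) (sym (≤ᵇ-true (NP.<⇒≤ r))) ,
          trans (<ᵇ-true a) (sym (<ᵇ-true r)) ,
          trans (≡ᵇ-false (NP.<⇒≢ a)) (sym (≡ᵇ-false (NP.<⇒≢ r)))
    ... | tri≈ _ b _ = let r = rank-cong x y b in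
          trans (≤ᵇ-true (NP.≤-reflexive b)) (sym (≤ᵇ-true (NP.≤-reflexive r))) ,
          trans (<ᵇ-false (NP.≤-reflexive (sym b))) (sym (<ᵇ-false (NP.≤-reflexive (sym r)))) ,
          trans (subst (λ v → (ρ x ≡ᵇ v) ≡ true) b (≡ᵇ-refl {ρ x})) (sym (subst (λ v → (rank x ≡ᵇ v) ≡ true) r (≡ᵇ-refl {rank x})))
    ... | tri> _ _ c = let r = rank-strict y x c in
          trans (≤ᵇ-false c) (sym (≤ᵇ-false r)) ,
          trans (<ᵇ-false (NP.<⇒≤ c)) (sym (<ᵇ-false (NP.<⇒≤ r))) ,
          trans (≡ᵇ-false (λ q → NP.<⇒≢ c (sym q))) (sym (≡ᵇ-false (λ q → NP.<⇒≢ r (sym q))))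
    module RankInvariance = Invariance ρ rank (λ x y → proj₁ (rank-comparisons x y)) (λ x y → proj₁ (proj₂ (rank-comparisons x y))) (λ x y → proj₂ (proj₂ (rank-comparisons x y)))

  allBelow : ℕ → (ℕ → Bool) → Bool
  allBelow zero Q = true
  allBelow (suc B) Q = allBelow B Q ∧ Q B

  allBelow-sound : ∀ B Q → allBelow B Q ≡ true → ∀ a → a < B → Q a ≡ true
  allBelow-sound (suc B) Q e a a<B with allBelow B Q in e1 | Q B in e2
  allBelow-sound (suc B) Q () a a<B | false | _
  allBelow-sound (suc B) Q () a a<B | true | false
  ... | true | true with NP.m≤n⇒m<n∨m≡n (NP.≤-pred a<B)
  ... | inj₁ lt = allBelow-sound B Q e1 a lt
  ... | inj₂ refl = e2

  extend : ∀ {V} → ℕ → (Fin V → ℕ) → Fin (suc V) → ℕ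
  extend a f zero = a
  extend a f (suc x) = f x

  allAssignments : ∀ V → ℕ → ((Fin V → ℕ) → Bool) → Bool
  allAssignments zero B P = P (λ ())
  allAssignments (suc V) B P = allBelow B (λ a → allAssignments V B (λ f → P (extend a f)))

  allAssignments-sound : ∀ V B (P : (Fin V → ℕ) → Bool) → (∀ f g → (∀ x → f x ≡ g x) → P f ≡ P g) →
    allAssignments V B P ≡ true → ∀ ρ → (∀ x → ρ x < B) → P ρ ≡ true
  allAssignments-sound zero B P resp e ρ h = trans (resp ρ (λ ()) (λ ())) e
  allAssignments-sound (suc V) B P resp e ρ h =
    trans (resp ρ (extend (ρ zero) (λ x → ρ (suc x))) (λ { zero → refl ; (suc x) → refl }))
      (allAssignments-sound V B (λ f → P (extend (ρ zero) f))
        (λ f g fg → resp _ _ (λ { zero → refl ; (suc x) → fg x }))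
        (allBelow-sound B _ e (ρ zero) (h zero)) (λ x → ρ (suc x)) (λ x → h (suc x)))

  module _ {V : ℕ} where
    evalᵇ-cong : ∀ e (f g : Fin V → ℕ) → (∀ x → f x ≡ g x) → evalᵇ f e ≡ evalᵇ g e
    evalᵇ-cong (LE x y) f g h = cong₂ _≤ᵇ_ (h x) (h y)
    evalᵇ-cong (LT x y) f g h = cong₂ _<ᵇ_ (h x) (h y)
    evalᵇ-cong (EQ x y) f g h = cong₂ _≡ᵇ_ (h x) (h y)
    evalᵇ-cong (AND a b) f g h = cong₂ _∧_ (evalᵇ-cong a f g h) (evalᵇ-cong b f g h)
    evalᵇ-cong (OR a b) f g h = cong₂ _∨_ (evalᵇ-cong a f g h) (evalᵇ-cong b f g h)
    evalᵇ-cong (NOT a) f g h = cong not (evalᵇ-cong a f g h)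
    evalᵇ-cong TT f g h = refl
    evalᵇ-cong FF f g h = refl

    evalℤ-cong : ∀ e (f g : Fin V → ℕ) → (∀ x → f x ≡ g x) → evalℤ f e ≡ evalℤ g e
    evalℤ-cong (IND b) f g h = cong 𝟙 (evalᵇ-cong b f g h)
    evalℤ-cong (ADD a b) f g h = cong₂ _+_ (evalℤ-cong a f g h) (evalℤ-cong b f g h)
    evalℤ-cong (SUB a b) f g h = cong₂ _-_ (evalℤ-cong a f g h) (evalℤ-cong b f g h)
    evalℤ-cong (MUL a b) f g h = cong₂ _*_ (evalℤ-cong a f g h) (evalℤ-cong b f g h)

    holdsAt : BoolExpr V → IntExpr V → IntExpr V → (Fin V → ℕ) → Bool
    holdsAt hyp l r ρ = not (evalᵇ ρ hyp) ∨ ⌊ evalℤ ρ l Z.≟ evalℤ ρ r ⌋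

    -- Values below V suffice: ranks of V numbers are below V and have the same order type.
    check : BoolExpr V → IntExpr V → IntExpr V → Bool
    check hyp l r = allAssignments V V (holdsAt hyp l r)

    check-sound : ∀ hyp l r → check hyp l r ≡ true → ∀ ρ → evalᵇ ρ hyp ≡ true → evalℤ ρ l ≡ evalℤ ρ r
    check-sound hyp l r c ρ h =
      trans (RankInvariance.evalℤ-invariant l) (trans (toWitness (≡true⇒T decided)) (sym (RankInvariance.evalℤ-invariant r)))
      where
      open Rank ρ
      holds : holdsAt hyp l r rank ≡ true
      holds = allAssignments-sound V V (holdsAt hyp l r)
        (λ f g fg → cong₂ (λ a b → not a ∨ b) (evalᵇ-cong hyp f g fg)
           (cong₂ (λ a b → ⌊ a Z.≟ b ⌋) (evalℤ-cong l f g fg) (evalℤ-cong r f g fg)))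
        c rank rank<V
      hyp-at-rank : evalᵇ rank hyp ≡ true
      hyp-at-rank = trans (sym (RankInvariance.evalᵇ-invariant hyp)) h
      decided : ⌊ evalℤ rank l Z.≟ evalℤ rank r ⌋ ≡ true
      decided = subst (λ z → not z ∨ ⌊ evalℤ rank l Z.≟ evalℤ rank r ⌋ ≡ true) hyp-at-rank holds

module QIdentity where
  open OrderTypes

  private
    a b c : Fin 3
    a = zero
    b = suc zero
    c = suc (suc zero)

    values : ℕ → ℕ → ℕ → Fin 3 → ℕ
    values x y z zero = x
    values x y z (suc zero) = y
    values x y z (suc (suc zero)) = z

    Q-expr : BoolExpr 3
    Q-expr = OR (AND (LT a b) (LT b c)) (OR (AND (LT b c) (LT c a))
               (OR (AND (LT c a) (LT a b)) (AND (EQ a b) (NOT (EQ b c)))))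

    lhs rhs : IntExpr 3
    lhs = IND (NOT Q-expr)
    rhs = ADD (IND (LT b a)) (SUB (IND (LE c b)) (IND (LT c a)))

    split : check TT lhs rhs ≡ true
    split = refl

  -- Q does not depend on the diagram or the filling it is declared for.
  ¬Q-split : ∀ x y z → 𝟙 (not (Q 0 (λ _ → 0) (λ _ _ → 0) x y z)) ≡ 𝟙 (y <ᵇ x) + (𝟙 (z ≤ᵇ y) - 𝟙 (z <ᵇ x))
  ¬Q-split x y z = check-sound TT lhs rhs split (values x y z) refl

module QS2Identity where
  open OrderTypes

  private
    tc td bc bd : Fin 4
    tc = zero
    td = suc zero
    bc = suc (suc zero)
    bd = suc (suc (suc zero))

    values : ℕ → ℕ → ℕ → ℕ → Fin 4 → ℕ
    values x y z w zero = x
    values x y z w (suc zero) = y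
    values x y z w (suc (suc zero)) = z
    values x y z w (suc (suc (suc zero))) = w

    IMP : ∀ {V} → BoolExpr V → BoolExpr V → BoolExpr V
    IMP p q = OR (NOT p) q

    S*-expr six-expr QS2-expr : ∀ {V} → Fin V → Fin V → Fin V → Fin V → BoolExpr V
    S*-expr z w u v = OR (AND (EQ z w) (AND (LT v w) (LT u v)))
                        (OR (AND (LE z u) (AND (EQ z w) (LT v w))) (AND (LT u v) (AND (LE z u) (EQ z w))))
    six-expr z w u v =
      OR (AND (LT v z) (AND (LE w v) (LT u w))) (
      OR (AND (LE z u) (AND (LT v z) (LE w v))) (
      OR (AND (LT w z) (AND (LT v w) (LT u v))) (
      OR (AND (LT u v) (AND (LE z u) (LT w z))) (
      OR (AND (LT u z) (AND (LT v u) (LE w v)))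
         (AND (LE z v) (AND (LT w z) (LT u w)))))))
    QS2-expr z w u v = OR (S*-expr z w u v) (OR (six-expr z w u v) (six-expr w z v u))

    condI-expr : ∀ {V} → Fin V → Fin V → Fin V → BoolExpr V
    condI-expr x y z = OR (AND (LT y x) (LE z y)) (OR (AND (LE x z) (LT y x)) (AND (LE z y) (LE x z)))

    condII-expr : ∀ {V} → Fin V → Fin V → Fin V → Fin V → BoolExpr V
    condII-expr x z y w = IMP (AND (LE x z) (LE y w)) (AND (IMP (LE y x) (LE w z)) (IMP (LT x y) (LE z w)))

    canonical-expr : BoolExpr 4
    canonical-expr = AND (IMP (EQ tc td) (condI-expr tc bc bd)) (condII-expr tc bc td bd)

    pairDefect-expr : Fin 4 → Fin 4 → Fin 4 → Fin 4 → IntExpr 4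
    pairDefect-expr t b t' b' =
      ADD (ADD (MUL (IND (LT b t)) (MUL (IND (LT b b')) (IND (NOT (AND (LE t' t) (LT b t'))))))
               (MUL (IND (LT b t)) (MUL (IND (LT b b')) (IND (EQ t' t)))))
          (MUL (IND (LE t b)) (MUL (IND (LT b b')) (IND (LE t' b))))

    lhs rhs : IntExpr 4
    lhs = IND (NOT (QS2-expr tc td bc bd))
    rhs = ADD (IND (EQ bc bd)) (ADD (pairDefect-expr tc bc td bd) (pairDefect-expr td bd tc bc))

    split : check canonical-expr lhs rhs ≡ true
    split = refl

  canonicalᵇ : ℕ → ℕ → ℕ → ℕ → Bool
  canonicalᵇ t t' b b' = evalᵇ (values t t' b b') canonical-expr

  pairDefect : ℕ → ℕ → ℕ → ℕ → ℤ
  pairDefect t b t' b' = 𝟙 (b <ᵇ t) * (𝟙 (b <ᵇ b') * 𝟙 (not ((t' ≤ᵇ t) ∧ (b <ᵇ t'))))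
    + 𝟙 (b <ᵇ t) * (𝟙 (b <ᵇ b') * 𝟙 (t' ≡ᵇ t))
    + 𝟙 (t ≤ᵇ b) * (𝟙 (b <ᵇ b') * 𝟙 (t' ≤ᵇ b))

  ¬QS2-split : ∀ t t' b b' → canonicalᵇ t t' b b' ≡ true →
    𝟙 (not (QS2 0 (λ _ → 0) (λ _ _ → 0) t t' b b')) ≡ 𝟙 (b ≡ᵇ b') + (pairDefect t b t' b' + pairDefect t' b' t b)
  ¬QS2-split t t' b b' = check-sound canonical-expr lhs rhs split (values t t' b b')

module FourthTermIdentity where
  open OrderTypes

  private
    p τc βd τd one : Fin 5
    p = zero
    τc = suc zero
    βd = suc (suc zero)
    τd = suc (suc (suc zero))
    one = suc (suc (suc (suc zero)))

    values : ℕ → ℕ → ℕ → ℕ → Fin 5 → ℕ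
    values x y z w zero = x
    values x y z w (suc zero) = y
    values x y z w (suc (suc zero)) = z
    values x y z w (suc (suc (suc zero))) = w
    values x y z w (suc (suc (suc (suc zero)))) = 1

    positive : BoolExpr 5
    positive = AND (LE one τc) (AND (LE one βd) (LE one τd))

    lhs rhs : IntExpr 5
    lhs = MUL (IND (LE one p)) (MUL (SUB (IND TT) (IND (AND (LE one τc) (LE τc p))))
            (SUB (IND (LE βd p)) (MUL (IND (AND (LE one τd) (LE τd p))) (IND (LE βd p)))))
    rhs = MUL (IND (LT p τc)) (MUL (IND (LE βd p)) (IND (LT p τd)))

    collapse : check positive lhs rhs ≡ true
    collapse = refl

  fourth-term-collapse : ∀ k τc βd τd → 1 ≤ τc → 1 ≤ βd → 1 ≤ τd →
    𝟙 (1 ≤ᵇ k) * ((+ 1 - 𝟙 (inRange 1 k τc)) * (𝟙 (βd ≤ᵇ k) - 𝟙 (inRange 1 k τd) * 𝟙 (βd ≤ᵇ k)))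
    ≡ 𝟙 (suc k ≤ᵇ τc) * (𝟙 (βd ≤ᵇ k) * 𝟙 (suc k ≤ᵇ τd))
  fourth-term-collapse k τc' βd' τd' h₁ h₂ h₃ = check-sound positive lhs rhs collapse (values k τc' βd' τd') hyp
    where
    hyp : evalᵇ (values k τc' βd' τd') positive ≡ true
    hyp rewrite ≤ᵇ-true h₁ | ≤ᵇ-true h₂ | ≤ᵇ-true h₃ = refl

count-all : ∀ m → count 1 m (λ _ → true) ≡ m
count-all m = ZP.+-injective (trans (+sumℕ≡sumℤ 1 m (λ _ → 1)) (trans (sumℤ≡∑ 1 m (λ _ → + 1)) (∑-1 m)))

count-initial-segment : ∀ n m (P : ℕ → Bool) → m ≤ n → (∀ i → 1 ≤ i → i ≤ n → P i ≡ (i ≤ᵇ m)) →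
  count 1 n P ≡ m
count-initial-segment n m P m≤n h = ZP.+-injective (begin
    + count 1 n P                                     ≡⟨ count≡∑𝟙 1 n (suc n) P NP.≤-refl ⟩
    ∑ (suc n) (λ k → 𝟙 (inRange 1 n k) * 𝟙 (P k))     ≡⟨ ∑-cong (suc n) (λ k _ → P≡≤m k) ⟩
    ∑ (suc n) (λ k → 𝟙 (inRange 1 m k) * 𝟙 true)      ≡⟨ count≡∑𝟙 1 m (suc n) (λ _ → true) (s≤s m≤n) ⟨
    + count 1 m (λ _ → true)                          ≡⟨ cong +_ (count-all m) ⟩
    + m                                               ∎)
  where
  open ≡-Reasoning
  P≡≤m : ∀ k → 𝟙 (inRange 1 n k) * 𝟙 (P k) ≡ 𝟙 (inRange 1 m k) * 𝟙 true
  P≡≤m k with 1 ≤ᵇ k in e₁ | k ≤ᵇ n in e₂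
  ... | false | _ = refl
  ... | true | false rewrite ≤ᵇ-false {k} {m} (NP.≤-<-trans m≤n (≤ᵇ-false-sound e₂)) = refl
  ... | true | true rewrite h k (≤ᵇ-sound e₁) (≤ᵇ-sound e₂) with k ≤ᵇ m
  ...   | false = refl
  ...   | true = refl

module Partition (n : ℕ) (lam : ℕ → ℕ) (isPartition : IsPartition n lam) where
  open IsPartition isPartition

  lam-antitone : ∀ a b → 1 ≤ a → a ≤ b → lam b ≤ lam a
  lam-antitone a b 1≤a a≤b with NP.m≤n⇒m<n∨m≡n a≤b
  ... | inj₂ refl = NP.≤-refl
  ... | inj₁ a<b with b
  ... | suc b' = NP.≤-trans (decreasing b' (NP.≤-trans 1≤a (NP.≤-pred a<b))) (lam-antitone a b' 1≤a (NP.≤-pred a<b))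

  module Column (c : ℕ) (1≤c : 1 ≤ c) where
    lastRowReaching : ℕ → ℕ
    lastRowReaching zero = zero
    lastRowReaching (suc k) = if c ≤ᵇ lam (suc k) then suc k else lastRowReaching k

    lastRowReaching≤ : ∀ k → lastRowReaching k ≤ k
    lastRowReaching≤ zero = z≤n
    lastRowReaching≤ (suc k) with c ≤ᵇ lam (suc k)
    ... | true = NP.≤-refl
    ... | false = NP.≤-trans (lastRowReaching≤ k) (NP.n≤1+n k)

    reaches⇔≤lastRowReaching : ∀ k i → 1 ≤ i → i ≤ k → (c ≤ᵇ lam i) ≡ (i ≤ᵇ lastRowReaching k)
    reaches⇔≤lastRowReaching zero zero () _
    reaches⇔≤lastRowReaching zero (suc i) _ ()
    reaches⇔≤lastRowReaching (suc k) i 1≤i i≤k with c ≤ᵇ lam (suc k) in e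
    ... | true = trans (≤ᵇ-true (NP.≤-trans (≤ᵇ-sound {c} e) (lam-antitone i (suc k) 1≤i i≤k))) (sym (≤ᵇ-true i≤k))
    ... | false with NP.m≤n⇒m<n∨m≡n i≤k
    ...   | inj₁ i<sk = reaches⇔≤lastRowReaching k i 1≤i (NP.≤-pred i<sk)
    ...   | inj₂ refl = trans e (sym (≤ᵇ-false (s≤s (lastRowReaching≤ k))))

    reaches⇔≤height : ∀ i → 1 ≤ i → (c ≤ᵇ lam i) ≡ (i ≤ᵇ lastRowReaching n)
    reaches⇔≤height i 1≤i with i Data.Nat.≤? n
    ... | yes i≤n = reaches⇔≤lastRowReaching n i 1≤i i≤n
    ... | no i≰n = trans (cong (c ≤ᵇ_) (vanishing i (NP.≰⇒> i≰n)))
            (trans (≤ᵇ-false 1≤c) (sym (≤ᵇ-false (NP.≤-<-trans (lastRowReaching≤ n) (NP.≰⇒> i≰n)))))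

    conj≡lastRowReaching : conj n lam c ≡ lastRowReaching n
    conj≡lastRowReaching = count-initial-segment n (lastRowReaching n) (λ i → c ≤ᵇ lam i)
      (lastRowReaching≤ n) (λ i 1≤i _ → reaches⇔≤height i 1≤i)

  conj-duality : ∀ c i → 1 ≤ c → 1 ≤ i → (c ≤ᵇ lam i) ≡ (i ≤ᵇ conj n lam c)
  conj-duality c i 1≤c 1≤i =
    trans (Column.reaches⇔≤height c 1≤c i 1≤i) (cong (i ≤ᵇ_) (sym (Column.conj≡lastRowReaching c 1≤c)))

  conj≤n : ∀ c → conj n lam c ≤ n
  conj≤n zero = NP.≤-reflexive (count-all n)
  conj≤n (suc c) = subst (_≤ n) (sym (Column.conj≡lastRowReaching (suc c) (s≤s z≤n)))
                     (Column.lastRowReaching≤ (suc c) (s≤s z≤n) n)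

  conj-antitone : ∀ c d → 1 ≤ d → d ≤ c → conj n lam c ≤ conj n lam d
  conj-antitone c d 1≤d d≤c with conj n lam c in eh
  ... | zero = z≤n
  ... | suc m = ≤ᵇ-sound (trans (sym (conj-duality d (suc m) 1≤d (s≤s z≤n)))
      (≤ᵇ-true (NP.≤-trans d≤c (≤ᵇ-sound (trans (conj-duality c (suc m) (NP.≤-trans 1≤d d≤c) (s≤s z≤n))
        (trans (cong (suc m ≤ᵇ_) eh) (≤ᵇ-true (NP.≤-refl {suc m}))))))))

  inSigma≡conj : ∀ j c → 1 ≤ j → 1 ≤ c → inSigma n lam j c ≡ (j ≡ᵇ conj n lam c)
  inSigma≡conj j c 1≤j 1≤c =
    trans (cong₂ _∧_ (trans (<ᵇ≡not-≤ᵇ (lam (suc j)) c) (cong not (conj-duality c (suc j) 1≤c (s≤s z≤n))))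
                     (conj-duality c j 1≤c 1≤j))
      (≤ᵇ∧not-suc≤ᵇ≡≡ᵇ j (conj n lam c))

  inSigma-bounds : ∀ j c → inSigma n lam j c ≡ true → (1 ≤ c) × (c ≤ lam j)
  inSigma-bounds j c e with ∧-true {lam (suc j) <ᵇ c} e
  ... | e₁ , e₂ = NP.≤-trans (s≤s z≤n) (<ᵇ-sound {lam (suc j)} e₁) , ≤ᵇ-sound {c} e₂

  inSigma⇒conj≡ : ∀ j c → 1 ≤ j → inSigma n lam j c ≡ true → conj n lam c ≡ j
  inSigma⇒conj≡ j c 1≤j e = sym (≡ᵇ-sound {j} (trans (sym (inSigma≡conj j c 1≤j (proj₁ (inSigma-bounds j c e)))) e))

  lam≤lam1 : ∀ x → 1 ≤ x → lam x ≤ lam 1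
  lam≤lam1 x 1≤x = lam-antitone 1 x (s≤s z≤n) 1≤x

  inSigma-beyond : ∀ j c → lam j < c → inSigma n lam j c ≡ false
  inSigma-beyond j c lt rewrite ≤ᵇ-false lt = BP.∧-zeroʳ (lam (suc j) <ᵇ c)

module PairTerms (N : ℕ) where
  open FourthTermIdentity using (fourth-term-collapse)

  K : ℕ
  K = suc N

  inK : ℕ → Bool
  inK k = inRange 1 (N ∸ 1) k

  δsum : ℕ → ℕ → ℕ → ℤ → ℤ
  δsum h k τ x = ∑ K (λ a → 𝟙 (inRange h k a) * (𝟙 (a ≡ᵇ τ) * x))

  δsum≡ : ∀ h k τ x → δsum h k τ x ≡ 𝟙 (τ <ᵇ K) * (𝟙 (inRange h k τ) * x)
  δsum≡ h k τ x = trans (∑-cong K (λ a _ → x∙yz≈y∙xz (𝟙 (inRange h k a)) (𝟙 (a ≡ᵇ τ)) x)) (∑-𝟙≡ K τ (λ a → 𝟙 (inRange h k a) * x))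

  -- Contributions of one column, with reversed entries β below τ, to s_{k+1}^h − s_k^h,
  -- to ν^k − s_k^{h,k} and to s_k^h.
  Δs-col : ℕ → ℕ → ℕ → ℕ → ℤ
  Δs-col βc τc k h = 𝟙 (h ≡ᵇ τc) * (𝟙 (βc ≤ᵇ suc k) - 𝟙 (βc ≤ᵇ k))

  νs-col : ℕ → ℕ → ℕ → ℕ → ℤ
  νs-col βd τd k h = 𝟙 (βd ≤ᵇ k) - δsum h k τd (𝟙 (βd ≤ᵇ k))

  s-col : ℕ → ℕ → ℕ → ℕ → ℤ
  s-col βd τd k h = 𝟙 (h ≡ᵇ τd) * 𝟙 (βd ≤ᵇ k)

  ∑hk : ℕ → ℕ → (ℕ → ℕ → ℤ) → ℤ
  ∑hk βc τc Y = ∑ K (λ k → ∑ K (λ h → 𝟙 (inK k) * (𝟙 (inRange 1 k h) * (Δs-col βc τc k h * Y k h))))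

  ∑hk-δ : ∀ p τc Y → ∑hk (suc p) τc Y ≡ 𝟙 (p <ᵇ K) * (𝟙 (τc <ᵇ K) * (𝟙 (inK p) * (𝟙 (inRange 1 p τc) * Y p τc)))
  ∑hk-δ p τc Y = trans (∑-cong K (λ k _ → ∑-cong K (λ h _ → pull-δ k h))) (∑∑-𝟙≡ K p τc (λ k h → 𝟙 (inK k) * (𝟙 (inRange 1 k h) * Y k h)))
    where
    pull-deltas : ∀ r i e d y → r * (i * ((e * d) * y)) ≡ d * (e * (r * (i * y)))
    pull-deltas = solve-∀
    pull-δ : ∀ k h → 𝟙 (inK k) * (𝟙 (inRange 1 k h) * (Δs-col (suc p) τc k h * Y k h)) ≡ 𝟙 (k ≡ᵇ p) * (𝟙 (h ≡ᵇ τc) * (𝟙 (inK k) * (𝟙 (inRange 1 k h) * Y k h)))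
    pull-δ k h = trans (cong (λ z → 𝟙 (inK k) * (𝟙 (inRange 1 k h) * ((𝟙 (h ≡ᵇ τc) * z) * Y k h))) (𝟙-≤ᵇ-step p k))
                     (pull-deltas (𝟙 (inK k)) (𝟙 (inRange 1 k h)) (𝟙 (h ≡ᵇ τc)) (𝟙 (k ≡ᵇ p)) (Y k h))

  first-weight third-weight fourth-weight : ℕ → ℕ → ℕ → ℕ → ℤ
  first-weight βc τc βd τd = 𝟙 (τc <ᵇ βc) * (𝟙 (βd <ᵇ βc) * 𝟙 (not ((τc ≤ᵇ τd) ∧ (τd <ᵇ βc))))
  third-weight βc τc βd τd = 𝟙 (τc <ᵇ βc) * (𝟙 (βd <ᵇ βc) * 𝟙 (τd ≡ᵇ τc))
  fourth-weight βc τc βd τd = 𝟙 (βc ≤ᵇ τc) * (𝟙 (βd <ᵇ βc) * 𝟙 (βc ≤ᵇ τd))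

  ∑hk-at : ∀ p τc (Z W : ℤ) → suc p ≤ N → 1 ≤ τc → Z ≡ W →
    𝟙 (p <ᵇ K) * (𝟙 (τc <ᵇ K) * (𝟙 (inK p) * (𝟙 (inRange 1 p τc) * Z))) ≡ 𝟙 (τc <ᵇ suc p) * W
  ∑hk-at zero (suc τ') Z W p<N (s≤s _) Z≡W = *-zeroʳ² (𝟙 (zero <ᵇ K)) (𝟙 (suc τ' <ᵇ K))
  ∑hk-at (suc p) (suc τ') Z W p<N (s≤s _) Z≡W rewrite <ᵇ-true {suc p} {K} (NP.≤-trans p<N (NP.n≤1+n N)) | <ᵇ-suc (suc τ') (suc p) with suc τ' ≤ᵇ suc p in e
  ... | false = trans (cong (+ 1 *_) (*-zeroʳ² (𝟙 (suc τ' <ᵇ K)) (𝟙 (inK (suc p))))) refl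
  ... | true rewrite <ᵇ-true {suc τ'} {K} (s≤s (NP.≤-trans (≤ᵇ-sound {suc τ'} {suc p} e) (NP.≤-trans (NP.n≤1+n (suc p)) p<N)))
      | inRange-1-pred N (suc p) | <ᵇ-true {suc p} {N} p<N =
      cong (+ 1 *_) (trans (ZP.*-identityˡ (+ 1 * (+ 1 * Z))) (trans (ZP.*-identityˡ (+ 1 * Z)) (trans (ZP.*-identityˡ Z) Z≡W)))

  first-weight-collapse : ∀ βc τc βd τd → 1 ≤ βc → βc ≤ N → 1 ≤ τc → ∑hk βc τc (νs-col βd τd) ≡ first-weight βc τc βd τd
  first-weight-collapse (suc p) τc βd τd _ p<N 1≤τc = trans (∑hk-δ p τc (νs-col βd τd))
      (∑hk-at p τc (νs-col βd τd p τc) _ p<N 1≤τc νs-at)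
    where
    νs-at : νs-col βd τd p τc ≡ 𝟙 (βd <ᵇ suc p) * 𝟙 (not ((τc ≤ᵇ τd) ∧ (τd <ᵇ suc p)))
    νs-at rewrite δsum≡ τc p τd (𝟙 (βd ≤ᵇ p)) | <ᵇ-suc βd p | <ᵇ-suc τd p with βd ≤ᵇ p
    ... | false = cong (λ z → + 0 - z) (*-zeroʳ² (𝟙 (τd <ᵇ K)) (𝟙 ((τc ≤ᵇ τd) ∧ (τd ≤ᵇ p))))
    ... | true with τc ≤ᵇ τd | τd ≤ᵇ p in e
    ...   | false | _ = cong (λ z → + 1 - z) (ZP.*-zeroʳ (𝟙 (τd <ᵇ K)))
    ...   | true | false = cong (λ z → + 1 - z) (ZP.*-zeroʳ (𝟙 (τd <ᵇ K)))
    ...   | true | true rewrite <ᵇ-true {τd} {K} (s≤s (NP.≤-trans (≤ᵇ-sound {τd} {p} e) (NP.≤-trans (NP.n≤1+n p) p<N))) = refl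

  third-weight-collapse : ∀ βc τc βd τd → 1 ≤ βc → βc ≤ N → 1 ≤ τc → ∑hk βc τc (s-col βd τd) ≡ third-weight βc τc βd τd
  third-weight-collapse (suc p) τc βd τd _ p<N 1≤τc = trans (∑hk-δ p τc (s-col βd τd))
      (∑hk-at p τc (s-col βd τd p τc) _ p<N 1≤τc s-at)
    where
    s-at : s-col βd τd p τc ≡ 𝟙 (βd <ᵇ suc p) * 𝟙 (τd ≡ᵇ τc)
    s-at rewrite <ᵇ-suc βd p | ≡ᵇ-sym τd τc = ZP.*-comm (𝟙 (τc ≡ᵇ τd)) (𝟙 (βd ≤ᵇ p))

  <ᵇK-absorb : ∀ x y → y < K → 𝟙 (x <ᵇ K) * 𝟙 (inRange 1 y x) ≡ 𝟙 (inRange 1 y x)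
  <ᵇK-absorb x y y<K with inRange 1 y x in e
  ... | false = ZP.*-zeroʳ (𝟙 (x <ᵇ K))
  ... | true rewrite <ᵇ-true {x} {K} (NP.≤-<-trans (≤ᵇ-sound {x} {y} (proj₂ (∧-true {1 ≤ᵇ x} e))) y<K) = refl

  Δνs-col : ℕ → ℕ → ℕ → ℤ
  Δνs-col βc τc k = ((𝟙 (βc ≤ᵇ suc k) - δsum 1 k τc (𝟙 (βc ≤ᵇ suc k))) - 𝟙 (βc ≤ᵇ k)) + δsum 1 k τc (𝟙 (βc ≤ᵇ k))

  ∑k-fourth : ℕ → ℕ → ℕ → ℕ → ℤ
  ∑k-fourth βc τc βd τd = ∑ K (λ k → 𝟙 (inK k) * (Δνs-col βc τc k * νs-col βd τd k 1))

  fourth-weight-collapse : ∀ βc τc βd τd → 1 ≤ βc → βc ≤ N → 1 ≤ τc → 1 ≤ βd → 1 ≤ τd → ∑k-fourth βc τc βd τd ≡ fourth-weight βc τc βd τd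
  fourth-weight-collapse (suc p) τc βd τd _ p<N 1≤τc 1≤βd 1≤τd =
    trans (∑-cong K (λ k _ → pull-δ k)) (trans (∑-𝟙≡ K p (λ k → 𝟙 (inK k) * ((+ 1 - 𝟙 (τc <ᵇ K) * 𝟙 (inRange 1 k τc)) * νs-col βd τd k 1))) (at-δ p p<N 1≤τc 1≤βd 1≤τd))
    where
    factor-difference : ∀ u v T i → ((u - T * (i * u)) - v) + T * (i * v) ≡ (u - v) * (+ 1 - T * i)
    factor-difference = solve-∀
    pull-delta : ∀ r d x y → r * ((d * x) * y) ≡ d * (r * (x * y))
    pull-delta = solve-∀
    pull-δ : ∀ k → 𝟙 (inK k) * (Δνs-col (suc p) τc k * νs-col βd τd k 1) ≡ 𝟙 (k ≡ᵇ p) * (𝟙 (inK k) * ((+ 1 - 𝟙 (τc <ᵇ K) * 𝟙 (inRange 1 k τc)) * νs-col βd τd k 1))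
    pull-δ k rewrite δsum≡ 1 k τc (𝟙 (suc p ≤ᵇ suc k)) | δsum≡ 1 k τc (𝟙 (suc p ≤ᵇ k))
      | factor-difference (𝟙 (suc p ≤ᵇ suc k)) (𝟙 (suc p ≤ᵇ k)) (𝟙 (τc <ᵇ K)) (𝟙 (inRange 1 k τc)) | 𝟙-≤ᵇ-step p k
      = pull-delta (𝟙 (inK k)) (𝟙 (k ≡ᵇ p)) (+ 1 - 𝟙 (τc <ᵇ K) * 𝟙 (inRange 1 k τc)) (νs-col βd τd k 1)
    at-δ : ∀ p → suc p ≤ N → 1 ≤ τc → 1 ≤ βd → 1 ≤ τd →
      𝟙 (p <ᵇ K) * (𝟙 (inK p) * ((+ 1 - 𝟙 (τc <ᵇ K) * 𝟙 (inRange 1 p τc)) * νs-col βd τd p 1)) ≡ fourth-weight (suc p) τc βd τd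
    at-δ p p<N h1 h2 h3 rewrite δsum≡ 1 p τd (𝟙 (βd ≤ᵇ p))
      | sym (ZP.*-assoc (𝟙 (τd <ᵇ K)) (𝟙 (inRange 1 p τd)) (𝟙 (βd ≤ᵇ p)))
      | <ᵇK-absorb τc p (NP.≤-trans p<N (NP.n≤1+n N)) | <ᵇK-absorb τd p (NP.≤-trans p<N (NP.n≤1+n N))
      | <ᵇ-true {p} {K} (NP.≤-trans p<N (NP.n≤1+n N)) | inRange-1-pred N p | <ᵇ-true {p} {N} p<N | BP.∧-identityʳ (1 ≤ᵇ p)
      | <ᵇ-suc βd p
      = trans (ZP.*-identityˡ _) (fourth-term-collapse p τc βd τd h1 h2 h3)

  second-weight-collapse : ∀ βc βd → 1 ≤ βc → βc ≤ N → ∑ K (λ k → 𝟙 (inRange 1 N k) * (𝟙 (βc ≡ᵇ k) * 𝟙 (βd ≡ᵇ k))) ≡ 𝟙 (βc ≡ᵇ βd)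
  second-weight-collapse βc βd h1 h2 = trans (∑-cong K (λ k _ → pull-δ k)) (trans (∑-𝟙≡ K βc (λ k → 𝟙 (inRange 1 N k) * 𝟙 (βd ≡ᵇ k))) at-δ)
    where
    pull-δ : ∀ k → 𝟙 (inRange 1 N k) * (𝟙 (βc ≡ᵇ k) * 𝟙 (βd ≡ᵇ k)) ≡ 𝟙 (k ≡ᵇ βc) * (𝟙 (inRange 1 N k) * 𝟙 (βd ≡ᵇ k))
    pull-δ k rewrite ≡ᵇ-sym βc k = x∙yz≈y∙xz (𝟙 (inRange 1 N k)) (𝟙 (k ≡ᵇ βc)) (𝟙 (βd ≡ᵇ k))
    at-δ : 𝟙 (βc <ᵇ K) * (𝟙 (inRange 1 N βc) * 𝟙 (βd ≡ᵇ βc)) ≡ 𝟙 (βc ≡ᵇ βd)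
    at-δ rewrite <ᵇ-true {βc} {K} (s≤s h2) | ≤ᵇ-true h1 | ≤ᵇ-true h2 | ≡ᵇ-sym βd βc = trans (ZP.*-identityˡ _) (ZP.*-identityˡ _)

  quinv-weight-collapse : ∀ βC τC βD → 1 ≤ βD → βD ≤ N →
    ∑ K (λ k → 𝟙 (inRange 1 N k) * (𝟙 (βD ≡ᵇ k) * (𝟙 (βC ≤ᵇ k) - 𝟙 (τC ≤ᵇ k ∸ 1)))) ≡ 𝟙 (βC ≤ᵇ βD) - 𝟙 (τC <ᵇ βD)
  quinv-weight-collapse βC τC (suc p) h1 h2 = trans (∑-cong K (λ k _ → pull-δ k))
      (trans (∑-𝟙≡ K (suc p) (λ k → 𝟙 (inRange 1 N k) * (𝟙 (βC ≤ᵇ k) - 𝟙 (τC ≤ᵇ k ∸ 1)))) at-δ)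
    where
    pull-δ : ∀ k → 𝟙 (inRange 1 N k) * (𝟙 (suc p ≡ᵇ k) * (𝟙 (βC ≤ᵇ k) - 𝟙 (τC ≤ᵇ k ∸ 1))) ≡ 𝟙 (k ≡ᵇ suc p) * (𝟙 (inRange 1 N k) * (𝟙 (βC ≤ᵇ k) - 𝟙 (τC ≤ᵇ k ∸ 1)))
    pull-δ k rewrite ≡ᵇ-sym (suc p) k = x∙yz≈y∙xz (𝟙 (inRange 1 N k)) (𝟙 (k ≡ᵇ suc p)) _
    at-δ : 𝟙 (suc p <ᵇ K) * (𝟙 (inRange 1 N (suc p)) * (𝟙 (βC ≤ᵇ suc p) - 𝟙 (τC ≤ᵇ p))) ≡ 𝟙 (βC ≤ᵇ suc p) - 𝟙 (τC <ᵇ suc p)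
    at-δ rewrite <ᵇ-true {suc p} {K} (s≤s h2) | <ᵇ-suc τC p = trans (ZP.*-identityˡ _) (ZP.*-identityˡ _)



-- Two rows of σ_j: b c = σ(i,c) lies below t c = σ(i+1,c), for the columns c with inS c.
-- β and τ read these entries in the reversed alphabet N+1−x, in which ν and s count
-- entries below a threshold.
module Row (N L : ℕ) (inS : ℕ → Bool) (t b : ℕ → ℕ)
  (inS-bounds : ∀ c → inS c ≡ true → (1 ≤ c) × (c ≤ L))
  (1≤b : ∀ c → inS c ≡ true → 1 ≤ b c)
  (b≤N : ∀ c → b c ≤ N) (t≤N : ∀ c → t c ≤ N) where
  open PairTerms N hiding (K)
  open QS2Identity using (canonicalᵇ; pairDefect; ¬QS2-split)

  M K : ℕ
  M = suc L
  K = suc N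
  𝟙S : ℕ → ℤ
  𝟙S c = 𝟙 (inS c)
  β τ : ℕ → ℕ
  β c = suc N ∸ b c
  τ c = suc N ∸ t c

  νR : ℕ → ℕ
  νR k = count 1 L (λ c → inS c ∧ (suc N ∸ k ≤ᵇ b c))
  sR : ℕ → ℕ → ℕ
  sR m h = count 1 L (λ c → inS c ∧ (t c ≡ᵇ suc N ∸ h) ∧ (suc N ∸ m ≤ᵇ b c))

  β≤N : ∀ c → inS c ≡ true → β c ≤ N
  β≤N c e with b c | 1≤b c e
  ... | suc b' | _ = NP.m∸n≤m N b'
  1≤β : ∀ c → inS c ≡ true → 1 ≤ β c
  1≤β c e = NP.m<n⇒0<n∸m (s≤s (b≤N c))
  1≤τ : ∀ c → 1 ≤ τ c
  1≤τ c = NP.m<n⇒0<n∸m (s≤s (t≤N c))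
  b≤K : ∀ c → b c ≤ K
  b≤K c = NP.m≤n⇒m≤1+n (b≤N c)
  t≤K : ∀ c → t c ≤ K
  t≤K c = NP.m≤n⇒m≤1+n (t≤N c)

  count-S≡∑ : ∀ (X : ℕ → Bool) → + count 1 L (λ c → inS c ∧ X c) ≡ ∑ M (λ c → 𝟙S c * 𝟙 (X c))
  count-S≡∑ X = trans (count≡∑𝟙 1 L M (λ c → inS c ∧ X c) NP.≤-refl) (∑-cong M (λ c _ → pointwise c))
    where
    pointwise : ∀ c → 𝟙 (inRange 1 L c) * 𝟙 (inS c ∧ X c) ≡ 𝟙S c * 𝟙 (X c)
    pointwise c with inS c in e
    ... | false = ZP.*-zeroʳ (𝟙 (inRange 1 L c))
    ... | true rewrite ≤ᵇ-true (proj₁ (inS-bounds c e)) | ≤ᵇ-true (proj₂ (inS-bounds c e)) = refl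

  νR≡∑ : ∀ k → + νR k ≡ ∑ M (λ c → 𝟙S c * 𝟙 (β c ≤ᵇ k))
  νR≡∑ k = trans (count-S≡∑ (λ c → suc N ∸ k ≤ᵇ b c)) (∑-cong M (λ c _ → cong (λ z → 𝟙S c * 𝟙 z) (∸≤ᵇ-comm (suc N) k (b c))))

  sR≡∑ : ∀ m h → h ≤ K → + sR m h ≡ ∑ M (λ c → 𝟙S c * (𝟙 (h ≡ᵇ τ c) * 𝟙 (β c ≤ᵇ m)))
  sR≡∑ m h h≤K = trans (count-S≡∑ (λ c → (t c ≡ᵇ suc N ∸ h) ∧ (suc N ∸ m ≤ᵇ b c))) (∑-cong M (λ c _ → pointwise c))
    where
    pointwise : ∀ c → 𝟙S c * 𝟙 ((t c ≡ᵇ suc N ∸ h) ∧ (suc N ∸ m ≤ᵇ b c)) ≡ 𝟙S c * (𝟙 (h ≡ᵇ τ c) * 𝟙 (β c ≤ᵇ m))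
    pointwise c with inS c in e
    ... | false = refl
    ... | true rewrite ≡ᵇ∸-comm {t c} {h} {suc N} (t≤K c) h≤K | ∸≤ᵇ-comm (suc N) m (b c) = cong (+ 1 *_) (𝟙-∧ (h ≡ᵇ suc N ∸ t c) (suc N ∸ b c ≤ᵇ m))

  descents : ℤ
  descents = ∑ M (λ c → 𝟙S c * 𝟙 (b c <ᵇ t c))

  descents≡∑s : sumℤ 1 (N ∸ 1) (λ k → + sR N k - + sR k k) ≡ descents
  descents≡∑s = begin
      sumℤ 1 (N ∸ 1) (λ k → + sR N k - + sR k k)
    ≡⟨ sumℤ≡∑𝟙 1 (N ∸ 1) K (λ k → + sR N k - + sR k k) (s≤s (NP.m∸n≤m N 1)) ⟩
      ∑ K (λ k → 𝟙 (inRange 1 (N ∸ 1) k) * (+ sR N k - + sR k k))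
    ≡⟨ ∑-cong K (λ k k<K → expand k (NP.<⇒≤ k<K)) ⟩
      ∑ K (λ k → ∑ M (λ c → 𝟙 (inRange 1 (N ∸ 1) k) * (𝟙S c * (𝟙 (k ≡ᵇ τ c) * 𝟙 (β c ≤ᵇ N)) - 𝟙S c * (𝟙 (k ≡ᵇ τ c) * 𝟙 (β c ≤ᵇ k)))))
    ≡⟨ ∑-comm K M F ⟩
      ∑ M (λ c → ∑ K (λ k → 𝟙 (inRange 1 (N ∸ 1) k) * (𝟙S c * (𝟙 (k ≡ᵇ τ c) * 𝟙 (β c ≤ᵇ N)) - 𝟙S c * (𝟙 (k ≡ᵇ τ c) * 𝟙 (β c ≤ᵇ k)))))
    ≡⟨ ∑-cong M (λ c _ → column-descent c) ⟩
      descents ∎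
    where
    open ≡-Reasoning
    F : ℕ → ℕ → ℤ
    F k c = 𝟙 (inRange 1 (N ∸ 1) k) * (𝟙S c * (𝟙 (k ≡ᵇ τ c) * 𝟙 (β c ≤ᵇ N)) - 𝟙S c * (𝟙 (k ≡ᵇ τ c) * 𝟙 (β c ≤ᵇ k)))
    expand : ∀ k → k ≤ K → 𝟙 (inRange 1 (N ∸ 1) k) * (+ sR N k - + sR k k) ≡
      ∑ M (λ c → 𝟙 (inRange 1 (N ∸ 1) k) * (𝟙S c * (𝟙 (k ≡ᵇ τ c) * 𝟙 (β c ≤ᵇ N)) - 𝟙S c * (𝟙 (k ≡ᵇ τ c) * 𝟙 (β c ≤ᵇ k))))
    expand k k≤K rewrite sR≡∑ N k k≤K | sR≡∑ k k k≤K =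
      trans (cong (𝟙 (inRange 1 (N ∸ 1) k) *_) (sym (∑-sub M (λ c → 𝟙S c * (𝟙 (k ≡ᵇ τ c) * 𝟙 (β c ≤ᵇ N))) (λ c → 𝟙S c * (𝟙 (k ≡ᵇ τ c) * 𝟙 (β c ≤ᵇ k)))))) (sym (∑-*ˡ M (𝟙 (inRange 1 (N ∸ 1) k)) (λ c → 𝟙S c * (𝟙 (k ≡ᵇ τ c) * 𝟙 (β c ≤ᵇ N)) - 𝟙S c * (𝟙 (k ≡ᵇ τ c) * 𝟙 (β c ≤ᵇ k)))))
    δ-outside : ∀ a i e p q → a * (i * (e * p) - i * (e * q)) ≡ e * (a * (i * (p - q)))
    δ-outside = solve-∀
    column-descent : ∀ c → ∑ K (λ k → 𝟙 (inRange 1 (N ∸ 1) k) * (𝟙S c * (𝟙 (k ≡ᵇ τ c) * 𝟙 (β c ≤ᵇ N)) - 𝟙S c * (𝟙 (k ≡ᵇ τ c) * 𝟙 (β c ≤ᵇ k))))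
               ≡ 𝟙S c * 𝟙 (b c <ᵇ t c)
    column-descent c = trans (∑-cong K (λ k _ → δ-outside (𝟙 (inRange 1 (N ∸ 1) k)) (𝟙S c) (𝟙 (k ≡ᵇ τ c)) (𝟙 (β c ≤ᵇ N)) (𝟙 (β c ≤ᵇ k))))
      (trans (∑-𝟙≡ K (τ c) (λ k → 𝟙 (inRange 1 (N ∸ 1) k) * (𝟙S c * (𝟙 (β c ≤ᵇ N) - 𝟙 (β c ≤ᵇ k))))) (at-δ c))
      where
      at-δ : ∀ c → 𝟙 (τ c <ᵇ K) * (𝟙 (inRange 1 (N ∸ 1) (τ c)) * (𝟙S c * (𝟙 (β c ≤ᵇ N) - 𝟙 (β c ≤ᵇ τ c)))) ≡ 𝟙S c * 𝟙 (b c <ᵇ t c)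
      at-δ c with inS c in e
      ... | false = *-zeroʳ² (𝟙 (τ c <ᵇ K)) (𝟙 (inRange 1 (N ∸ 1) (τ c)))
      ... | true rewrite ≤ᵇ-true (β≤N c e) with b c <ᵇ t c in e2
      ...   | false rewrite trans (∸-reverses-≤ᵇ {b c} {t c} {K} (b≤K c) (t≤K c)) (≤ᵇ-true (<ᵇ-false-sound {b c} {t c} e2))
              = *-zeroʳ² (𝟙 (τ c <ᵇ K)) (𝟙 (inRange 1 (N ∸ 1) (τ c)))
      ...   | true = goal
        where
        τ<β : τ c < β c
        τ<β = <ᵇ-sound (trans (∸-reverses-<ᵇ (t≤K c) (b≤K c)) e2)
        goal : 𝟙 (τ c <ᵇ K) * (𝟙 (inRange 1 (N ∸ 1) (τ c)) * (+ 1 * (+ 1 - 𝟙 (β c ≤ᵇ τ c)))) ≡ + 1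
        goal rewrite ≤ᵇ-false τ<β | <ᵇ-true (NP.<-≤-trans τ<β (NP.≤-trans (β≤N c e) (NP.n≤1+n N)))
           | inRange-1-pred N (τ c) | ≤ᵇ-true (1≤τ c) | <ᵇ-true (NP.<-≤-trans τ<β (β≤N c e)) = refl


  Δs≡∑ : ∀ k h → h ≤ K → + sR (suc k) h - + sR k h ≡ ∑ M (λ c → 𝟙S c * Δs-col (β c) (τ c) k h)
  Δs≡∑ k h h≤K rewrite sR≡∑ (suc k) h h≤K | sR≡∑ k h h≤K =
    trans (sym (∑-sub M (λ c → 𝟙S c * (𝟙 (h ≡ᵇ τ c) * 𝟙 (β c ≤ᵇ suc k))) (λ c → 𝟙S c * (𝟙 (h ≡ᵇ τ c) * 𝟙 (β c ≤ᵇ k)))))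
      (∑-cong M (λ c _ → factor-indicators (𝟙S c) (𝟙 (h ≡ᵇ τ c)) (𝟙 (β c ≤ᵇ suc k)) (𝟙 (β c ≤ᵇ k))))
    where
    factor-indicators : ∀ i e u v → i * (e * u) - i * (e * v) ≡ i * (e * (u - v))
    factor-indicators = solve-∀

  srange≡∑ : ∀ m h k → k < K → sumℤ h k (λ a → + sR m a) ≡ ∑ M (λ d → 𝟙S d * δsum h k (τ d) (𝟙 (β d ≤ᵇ m)))
  srange≡∑ m h k k<K = begin
      sumℤ h k (λ a → + sR m a)
    ≡⟨ sumℤ≡∑𝟙 h k K (λ a → + sR m a) k<K ⟩
      ∑ K (λ a → 𝟙 (inRange h k a) * + sR m a)
    ≡⟨ ∑-cong K (λ a a<K → trans (cong (𝟙 (inRange h k a) *_) (sR≡∑ m a (NP.<⇒≤ a<K)))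
          (sym (∑-*ˡ M (𝟙 (inRange h k a)) (λ d → 𝟙S d * (𝟙 (a ≡ᵇ τ d) * 𝟙 (β d ≤ᵇ m)))))) ⟩
      ∑ K (λ a → ∑ M (λ d → 𝟙 (inRange h k a) * (𝟙S d * (𝟙 (a ≡ᵇ τ d) * 𝟙 (β d ≤ᵇ m)))))
    ≡⟨ ∑-comm K M (λ a d → 𝟙 (inRange h k a) * (𝟙S d * (𝟙 (a ≡ᵇ τ d) * 𝟙 (β d ≤ᵇ m)))) ⟩
      ∑ M (λ d → ∑ K (λ a → 𝟙 (inRange h k a) * (𝟙S d * (𝟙 (a ≡ᵇ τ d) * 𝟙 (β d ≤ᵇ m)))))
    ≡⟨ ∑-cong M (λ d _ → trans (∑-cong K (λ a _ → x∙yz≈y∙xz (𝟙 (inRange h k a)) (𝟙S d) (𝟙 (a ≡ᵇ τ d) * 𝟙 (β d ≤ᵇ m))))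
          (∑-*ˡ K (𝟙S d) (λ a → 𝟙 (inRange h k a) * (𝟙 (a ≡ᵇ τ d) * 𝟙 (β d ≤ᵇ m))))) ⟩
      ∑ M (λ d → 𝟙S d * δsum h k (τ d) (𝟙 (β d ≤ᵇ m))) ∎
    where
    open ≡-Reasoning

  νs≡∑ : ∀ k h → k < K → + νR k - sumℤ h k (λ a → + sR k a) ≡ ∑ M (λ d → 𝟙S d * νs-col (β d) (τ d) k h)
  νs≡∑ k h k<K rewrite νR≡∑ k | srange≡∑ k h k k<K =
    trans (sym (∑-sub M (λ d → 𝟙S d * 𝟙 (β d ≤ᵇ k)) (λ d → 𝟙S d * δsum h k (τ d) (𝟙 (β d ≤ᵇ k)))))
      (∑-cong M (λ d _ → *-distribˡ-sub (𝟙S d) (𝟙 (β d ≤ᵇ k)) (δsum h k (τ d) (𝟙 (β d ≤ᵇ k)))))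

  Δνs≡∑ : ∀ k → k < K → (+ νR (suc k) - sumℤ 1 k (λ a → + sR (suc k) a) - + νR k + sumℤ 1 k (λ a → + sR k a))
    ≡ ∑ M (λ c → 𝟙S c * Δνs-col (β c) (τ c) k)
  Δνs≡∑ k k<K rewrite νR≡∑ (suc k) | srange≡∑ (suc k) 1 k k<K | νR≡∑ k | srange≡∑ k 1 k k<K =
    trans (cong₂ _+_ (trans (cong (_- ∑ M Cf) (sym (∑-sub M Af Bf))) (sym (∑-sub M (λ c → Af c - Bf c) Cf))) refl)
      (trans (sym (∑-+ M (λ c → (Af c - Bf c) - Cf c) Df))
        (∑-cong M (λ c _ → factor-𝟙S (𝟙S c) (𝟙 (β c ≤ᵇ suc k)) (δsum 1 k (τ c) (𝟙 (β c ≤ᵇ suc k))) (𝟙 (β c ≤ᵇ k)) (δsum 1 k (τ c) (𝟙 (β c ≤ᵇ k))))))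
    where
    Af Bf Cf Df : ℕ → ℤ
    Af c = 𝟙S c * 𝟙 (β c ≤ᵇ suc k)
    Bf c = 𝟙S c * δsum 1 k (τ c) (𝟙 (β c ≤ᵇ suc k))
    Cf c = 𝟙S c * 𝟙 (β c ≤ᵇ k)
    Df c = 𝟙S c * δsum 1 k (τ c) (𝟙 (β c ≤ᵇ k))
    factor-𝟙S : ∀ i a b c d → ((i * a - i * b) - i * c) + i * d ≡ i * (((a - b) - c) + d)
    factor-𝟙S = solve-∀

  ∑hk-product : ∀ (P : ℕ → ℕ → ℤ) (X Y : ℕ → ℕ → ℕ → ℤ) →
    (∀ k h → k < K → h < K → P k h ≡ ∑ M (λ c → 𝟙S c * X c k h) * ∑ M (λ d → 𝟙S d * Y d k h)) →
    sumℤ 1 (N ∸ 1) (λ k → sumℤ 1 k (λ h → P k h)) ≡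
    ∑ M (λ c → ∑ M (λ d → 𝟙S c * (𝟙S d * ∑ K (λ k → ∑ K (λ h → 𝟙 (inK k) * (𝟙 (inRange 1 k h) * (X c k h * Y d k h)))))))
  ∑hk-product P X Y hyp = begin
      sumℤ 1 (N ∸ 1) (λ k → sumℤ 1 k (λ h → P k h))
    ≡⟨ sumℤ≡∑𝟙 1 (N ∸ 1) K (λ k → sumℤ 1 k (λ h → P k h)) (s≤s (NP.m∸n≤m N 1)) ⟩
      ∑ K (λ k → 𝟙 (inK k) * sumℤ 1 k (λ h → P k h))
    ≡⟨ ∑-cong K (λ k k<K → trans (cong (𝟙 (inK k) *_) (sumℤ≡∑𝟙 1 k K (P k) k<K))
         (trans (sym (∑-*ˡ K (𝟙 (inK k)) (λ h → 𝟙 (inRange 1 k h) * P k h)))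
           (∑-cong K (λ h h<K → inner k h k<K h<K)))) ⟩
      ∑ K (λ k → ∑ K (λ h → ∑ M (λ c → ∑ M (λ d → g k h c d))))
    ≡⟨ ∑⁴-comm K K M g ⟩
      ∑ M (λ c → ∑ M (λ d → ∑ K (λ k → ∑ K (λ h → g k h c d))))
    ≡⟨ ∑-cong M (λ c _ → ∑-cong M (λ d _ → trans (sym (∑∑-*ˡ K K (𝟙S c) (λ k h → 𝟙S d * W c d k h)))
          (cong (𝟙S c *_) (sym (∑∑-*ˡ K K (𝟙S d) (W c d)))))) ⟩
      ∑ M (λ c → ∑ M (λ d → 𝟙S c * (𝟙S d * ∑ K (λ k → ∑ K (λ h → W c d k h))))) ∎
    where
    open ≡-Reasoning
    W : ℕ → ℕ → ℕ → ℕ → ℤ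
    W c d k h = 𝟙 (inK k) * (𝟙 (inRange 1 k h) * (X c k h * Y d k h))
    g : ℕ → ℕ → ℕ → ℕ → ℤ
    g k h c d = 𝟙S c * (𝟙S d * W c d k h)
    regroup : ∀ r u i x j y → r * (u * ((i * x) * (j * y))) ≡ i * (j * (r * (u * (x * y))))
    regroup = solve-∀
    inner : ∀ k h → k < K → h < K → 𝟙 (inK k) * (𝟙 (inRange 1 k h) * P k h) ≡ ∑ M (λ c → ∑ M (λ d → g k h c d))
    inner k h k<K h<K rewrite hyp k h k<K h<K
      | ∑*∑ M M (λ c → 𝟙S c * X c k h) (λ d → 𝟙S d * Y d k h)
      | ∑∑-*ˡ M M (𝟙 (inRange 1 k h)) (λ c d → (𝟙S c * X c k h) * (𝟙S d * Y d k h))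
      | ∑∑-*ˡ M M (𝟙 (inK k)) (λ c d → 𝟙 (inRange 1 k h) * ((𝟙S c * X c k h) * (𝟙S d * Y d k h)))
      = ∑-cong M (λ c _ → ∑-cong M (λ d _ → regroup (𝟙 (inK k)) (𝟙 (inRange 1 k h)) (𝟙S c) (X c k h) (𝟙S d) (Y d k h)))

  ∑k-product : ∀ (P : ℕ → ℤ) (X Y : ℕ → ℕ → ℤ) →
    (∀ k → k < K → P k ≡ ∑ M (λ c → 𝟙S c * X c k) * ∑ M (λ d → 𝟙S d * Y d k)) →
    sumℤ 1 (N ∸ 1) P ≡ ∑ M (λ c → ∑ M (λ d → 𝟙S c * (𝟙S d * ∑ K (λ k → 𝟙 (inK k) * (X c k * Y d k)))))
  ∑k-product P X Y hyp = begin
      sumℤ 1 (N ∸ 1) P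
    ≡⟨ sumℤ≡∑𝟙 1 (N ∸ 1) K P (s≤s (NP.m∸n≤m N 1)) ⟩
      ∑ K (λ k → 𝟙 (inK k) * P k)
    ≡⟨ ∑-cong K (λ k k<K → inner k k<K) ⟩
      ∑ K (λ k → ∑ M (λ c → ∑ M (λ d → g k c d)))
    ≡⟨ ∑-comm K M (λ k c → ∑ M (λ d → g k c d)) ⟩
      ∑ M (λ c → ∑ K (λ k → ∑ M (λ d → g k c d)))
    ≡⟨ ∑-cong M (λ c _ → trans (∑-comm K M (λ k d → g k c d)) (∑-cong M (λ d _ →
          trans (∑-*ˡ K (𝟙S c) (λ k → 𝟙S d * W c d k)) (cong (𝟙S c *_) (∑-*ˡ K (𝟙S d) (W c d)))))) ⟩
      ∑ M (λ c → ∑ M (λ d → 𝟙S c * (𝟙S d * ∑ K (λ k → W c d k)))) ∎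
    where
    open ≡-Reasoning
    W : ℕ → ℕ → ℕ → ℤ
    W c d k = 𝟙 (inK k) * (X c k * Y d k)
    g : ℕ → ℕ → ℕ → ℤ
    g k c d = 𝟙S c * (𝟙S d * W c d k)
    regroup : ∀ r i x j y → r * ((i * x) * (j * y)) ≡ i * (j * (r * (x * y)))
    regroup = solve-∀
    inner : ∀ k → k < K → 𝟙 (inK k) * P k ≡ ∑ M (λ c → ∑ M (λ d → g k c d))
    inner k k<K rewrite hyp k k<K
      | ∑*∑ M M (λ c → 𝟙S c * X c k) (λ d → 𝟙S d * Y d k)
      | ∑∑-*ˡ M M (𝟙 (inK k)) (λ c d → (𝟙S c * X c k) * (𝟙S d * Y d k))
      = ∑-cong M (λ c _ → ∑-cong M (λ d _ → regroup (𝟙 (inK k)) (𝟙S c) (X c k) (𝟙S d) (Y d k)))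

  ∑∑-on-S : ∀ (S F : ℕ → ℕ → ℤ) → (∀ c d → inS c ≡ true → inS d ≡ true → S c d ≡ F c d) →
    ∑ M (λ c → ∑ M (λ d → 𝟙S c * (𝟙S d * S c d))) ≡ ∑ M (λ c → ∑ M (λ d → 𝟙S c * (𝟙S d * F c d)))
  ∑∑-on-S S F h = ∑-cong M (λ c _ → ∑-cong M (λ d _ → pointwise c d))
    where
    pointwise : ∀ c d → 𝟙S c * (𝟙S d * S c d) ≡ 𝟙S c * (𝟙S d * F c d)
    pointwise c d with inS c in e1 | inS d in e2
    ... | false | _ = refl
    ... | true | false = refl
    ... | true | true = cong (λ z → + 1 * (+ 1 * z)) (h c d e1 e2)

  onPair : (ℕ → ℕ → ℕ → ℕ → ℤ) → ℕ → ℕ → ℤ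
  onPair F c d = 𝟙S c * (𝟙S d * F (β c) (τ c) (β d) (τ d))

  first-sum≡ : sumℤ 1 (N ∸ 1) (λ k → sumℤ 1 k (λ h → (+ sR (suc k) h - + sR k h) * (+ νR k - sumℤ h k (λ a → + sR k a))))
     ≡ ∑ M (λ c → ∑ M (λ d → onPair first-weight c d))
  first-sum≡ = trans (∑hk-product _ (λ c k h → Δs-col (β c) (τ c) k h) (λ d k h → νs-col (β d) (τ d) k h)
              (λ k h k<K h<K → cong₂ _*_ (Δs≡∑ k h (NP.<⇒≤ h<K)) (νs≡∑ k h k<K)))
         (∑∑-on-S (λ c d → ∑hk (β c) (τ c) (νs-col (β d) (τ d))) (λ c d → first-weight (β c) (τ c) (β d) (τ d))
              (λ c d e1 e2 → first-weight-collapse (β c) (τ c) (β d) (τ d) (1≤β c e1) (β≤N c e1) (1≤τ c)))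

  third-sum≡ : sumℤ 1 (N ∸ 1) (λ k → sumℤ 1 k (λ h → (+ sR (suc k) h - + sR k h) * + sR k h))
     ≡ ∑ M (λ c → ∑ M (λ d → onPair third-weight c d))
  third-sum≡ = trans (∑hk-product _ (λ c k h → Δs-col (β c) (τ c) k h) (λ d k h → s-col (β d) (τ d) k h)
              (λ k h k<K h<K → cong₂ _*_ (Δs≡∑ k h (NP.<⇒≤ h<K)) (sR≡∑ k h (NP.<⇒≤ h<K))))
         (∑∑-on-S (λ c d → ∑hk (β c) (τ c) (s-col (β d) (τ d))) (λ c d → third-weight (β c) (τ c) (β d) (τ d))
              (λ c d e1 e2 → third-weight-collapse (β c) (τ c) (β d) (τ d) (1≤β c e1) (β≤N c e1) (1≤τ c)))

  fourth-sum≡ : sumℤ 1 (N ∸ 1) (λ k → (+ νR (suc k) - sumℤ 1 k (λ a → + sR (suc k) a) - + νR k + sumℤ 1 k (λ a → + sR k a))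
                            * (+ νR k - sumℤ 1 k (λ a → + sR k a)))
     ≡ ∑ M (λ c → ∑ M (λ d → onPair fourth-weight c d))
  fourth-sum≡ = trans (∑k-product _ (λ c k → Δνs-col (β c) (τ c) k) (λ d k → νs-col (β d) (τ d) k 1)
              (λ k k<K → cong₂ _*_ (Δνs≡∑ k k<K) (νs≡∑ k 1 k<K)))
         (∑∑-on-S (λ c d → ∑k-fourth (β c) (τ c) (β d) (τ d)) (λ c d → fourth-weight (β c) (τ c) (β d) (τ d))
              (λ c d e1 e2 → fourth-weight-collapse (β c) (τ c) (β d) (τ d) (1≤β c e1) (β≤N c e1) (1≤τ c) (1≤β d e2) (1≤τ d)))

  hasβ : ℕ → ℕ → Bool
  hasβ k c = inS c ∧ (β c ≡ᵇ k)

  νR-step : ∀ k → νR k ∸ νR (k ∸ 1) ≡ countBelow M (hasβ k)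
  νR-step k = trans (cong (_∸ νR (k ∸ 1)) νR-splitℕ) (NP.m+n∸m≡n (νR (k ∸ 1)) (countBelow M (hasβ k)))
    where
    pointwise : ∀ c → 𝟙S c * 𝟙 (β c ≤ᵇ k) ≡ 𝟙S c * 𝟙 (β c ≤ᵇ k ∸ 1) + 𝟙 (hasβ k c)
    pointwise c with inS c in e
    ... | false = refl
    ... | true = trans (ZP.*-identityˡ (𝟙 (β c ≤ᵇ k))) (trans (𝟙-≤ᵇ-pred (β c) k (1≤β c e)) (cong (_+ 𝟙 (β c ≡ᵇ k)) (sym (ZP.*-identityˡ (𝟙 (β c ≤ᵇ k ∸ 1))))))
    νR-split : + νR k ≡ + νR (k ∸ 1) + + countBelow M (hasβ k)
    νR-split = begin
        + νR k ≡⟨ νR≡∑ k ⟩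
        ∑ M (λ c → 𝟙S c * 𝟙 (β c ≤ᵇ k)) ≡⟨ ∑-cong M (λ c _ → pointwise c) ⟩
        ∑ M (λ c → 𝟙S c * 𝟙 (β c ≤ᵇ k ∸ 1) + 𝟙 (hasβ k c)) ≡⟨ ∑-+ M (λ c → 𝟙S c * 𝟙 (β c ≤ᵇ k ∸ 1)) (λ c → 𝟙 (hasβ k c)) ⟩
        ∑ M (λ c → 𝟙S c * 𝟙 (β c ≤ᵇ k ∸ 1)) + ∑ M (λ c → 𝟙 (hasβ k c)) ≡⟨ cong₂ _+_ (sym (νR≡∑ (k ∸ 1))) (sym (countBelow≡∑𝟙 M (hasβ k))) ⟩
        + νR (k ∸ 1) + + countBelow M (hasβ k) ∎
      where open ≡-Reasoning
    νR-splitℕ : νR k ≡ νR (k ∸ 1) +ℕ countBelow M (hasβ k)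
    νR-splitℕ = ZP.+-injective νR-split

  second-sum≡ : sumℤ 1 N (λ k → + ((νR k ∸ νR (k ∸ 1)) C 2))
     ≡ ∑ M (λ c → ∑ M (λ d → 𝟙 (c <ᵇ d) * (𝟙S c * (𝟙S d * 𝟙 (β c ≡ᵇ β d)))))
  second-sum≡ = begin
      sumℤ 1 N (λ k → + ((νR k ∸ νR (k ∸ 1)) C 2))
    ≡⟨ sumℤ≡∑𝟙 1 N K (λ k → + ((νR k ∸ νR (k ∸ 1)) C 2)) NP.≤-refl ⟩
      ∑ K (λ k → 𝟙 (inRange 1 N k) * + ((νR k ∸ νR (k ∸ 1)) C 2))
    ≡⟨ ∑-cong K (λ k _ → trans (cong (λ z → 𝟙 (inRange 1 N k) * + (z C 2)) (νR-step k))
          (trans (cong (𝟙 (inRange 1 N k) *_) (countBelow-C2 M (hasβ k)))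
            (∑∑-*ˡ M M (𝟙 (inRange 1 N k)) (λ c d → 𝟙 (c <ᵇ d) * (𝟙 (hasβ k c) * 𝟙 (hasβ k d)))))) ⟩
      ∑ K (λ k → ∑ M (λ c → ∑ M (λ d → 𝟙 (inRange 1 N k) * (𝟙 (c <ᵇ d) * (𝟙 (hasβ k c) * 𝟙 (hasβ k d))))))
    ≡⟨ trans (∑-comm K M (λ k c → ∑ M (λ d → 𝟙 (inRange 1 N k) * (𝟙 (c <ᵇ d) * (𝟙 (hasβ k c) * 𝟙 (hasβ k d))))))
         (∑-cong M (λ c _ → ∑-comm K M (λ k d → 𝟙 (inRange 1 N k) * (𝟙 (c <ᵇ d) * (𝟙 (hasβ k c) * 𝟙 (hasβ k d)))))) ⟩
      ∑ M (λ c → ∑ M (λ d → ∑ K (λ k → 𝟙 (inRange 1 N k) * (𝟙 (c <ᵇ d) * (𝟙 (hasβ k c) * 𝟙 (hasβ k d))))))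
    ≡⟨ ∑-cong M (λ c _ → ∑-cong M (λ d _ → pointwise c d)) ⟩
      ∑ M (λ c → ∑ M (λ d → 𝟙 (c <ᵇ d) * (𝟙S c * (𝟙S d * 𝟙 (β c ≡ᵇ β d))))) ∎
    where
    open ≡-Reasoning
    pointwise : ∀ c d → ∑ K (λ k → 𝟙 (inRange 1 N k) * (𝟙 (c <ᵇ d) * (𝟙 (hasβ k c) * 𝟙 (hasβ k d)))) ≡ 𝟙 (c <ᵇ d) * (𝟙S c * (𝟙S d * 𝟙 (β c ≡ᵇ β d)))
    pointwise c d with inS c in e1 | inS d in e2
    ... | false | _ = trans (∑-vanish K _ (λ k _ → *-zeroʳ² (𝟙 (inRange 1 N k)) (𝟙 (c <ᵇ d)))) (sym (ZP.*-zeroʳ (𝟙 (c <ᵇ d))))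
    ... | true | false = trans (∑-vanish K _ (λ k _ → trans (cong (λ z → 𝟙 (inRange 1 N k) * (𝟙 (c <ᵇ d) * z)) (ZP.*-zeroʳ (𝟙 (β c ≡ᵇ k))))
                               (*-zeroʳ² (𝟙 (inRange 1 N k)) (𝟙 (c <ᵇ d))))) (sym (ZP.*-zeroʳ (𝟙 (c <ᵇ d))))
    ... | true | true = trans (∑-cong K (λ k _ → x∙yz≈y∙xz (𝟙 (inRange 1 N k)) (𝟙 (c <ᵇ d)) (𝟙 (β c ≡ᵇ k) * 𝟙 (β d ≡ᵇ k))))
          (trans (∑-*ˡ K (𝟙 (c <ᵇ d)) (λ k → 𝟙 (inRange 1 N k) * (𝟙 (β c ≡ᵇ k) * 𝟙 (β d ≡ᵇ k))))
            (cong (𝟙 (c <ᵇ d) *_) (trans (second-weight-collapse (β c) (β d) (1≤β c e1) (β≤N c e1))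
               (sym (trans (ZP.*-identityˡ (+ 1 * 𝟙 (β c ≡ᵇ β d))) (ZP.*-identityˡ (𝟙 (β c ≡ᵇ β d))))))))

  ∑∑ : (ℕ → ℕ → ℤ) → ℤ
  ∑∑ f = ∑ M (λ c → ∑ M (λ d → f c d))

  pairWeight : ℕ → ℕ → ℤ
  pairWeight c d = (onPair first-weight c d + onPair third-weight c d) + onPair fourth-weight c d

  equalBottoms : ℕ → ℕ → ℤ
  equalBottoms c d = 𝟙 (c <ᵇ d) * (𝟙S c * (𝟙S d * 𝟙 (β c ≡ᵇ β d)))

  pairWeight-diag : ∀ c → pairWeight c c ≡ + 0
  pairWeight-diag c rewrite <ᵇ-false (NP.≤-refl {β c}) =
    cong₂ _+_ (cong₂ _+_ (*-zeroʳ³ (𝟙S c) (𝟙S c) (𝟙 (τ c <ᵇ β c))) (*-zeroʳ³ (𝟙S c) (𝟙S c) (𝟙 (τ c <ᵇ β c)))) (*-zeroʳ³ (𝟙S c) (𝟙S c) (𝟙 (β c ≤ᵇ τ c)))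
    where
    *-zeroʳ³ : ∀ x y z → x * (y * (z * + 0)) ≡ + 0
    *-zeroʳ³ x y z = trans (cong (x *_) (*-zeroʳ² y z)) (ZP.*-zeroʳ x)

  rhs-symmetrized : ((∑∑ (onPair first-weight) + ∑∑ equalBottoms) + ∑∑ (onPair third-weight)) + ∑∑ (onPair fourth-weight) ≡ ∑∑ (λ c d → equalBottoms c d + 𝟙 (c <ᵇ d) * (pairWeight c d + pairWeight d c))
  rhs-symmetrized = begin
      ((∑∑ (onPair first-weight) + ∑∑ equalBottoms) + ∑∑ (onPair third-weight)) + ∑∑ (onPair fourth-weight)
    ≡⟨ move-equalBottoms-first (∑∑ (onPair first-weight)) (∑∑ equalBottoms) (∑∑ (onPair third-weight)) (∑∑ (onPair fourth-weight)) ⟩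
      ∑∑ equalBottoms + ((∑∑ (onPair first-weight) + ∑∑ (onPair third-weight)) + ∑∑ (onPair fourth-weight))
    ≡⟨ cong (λ z → ∑∑ equalBottoms + z) (sym (trans (∑∑-+ M (λ c d → onPair first-weight c d + onPair third-weight c d) (onPair fourth-weight)) (cong (_+ ∑∑ (onPair fourth-weight)) (∑∑-+ M (onPair first-weight) (onPair third-weight))))) ⟩
      ∑∑ equalBottoms + ∑∑ pairWeight
    ≡⟨ cong (λ z → ∑∑ equalBottoms + z) (trans (∑∑-symmetrize M pairWeight) (trans (cong (λ z → ∑∑ (λ c d → 𝟙 (c <ᵇ d) * (pairWeight c d + pairWeight d c)) + z) (∑-vanish M (λ c → pairWeight c c) (λ c _ → pairWeight-diag c))) (ZP.+-identityʳ _))) ⟩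
      ∑∑ equalBottoms + ∑∑ (λ c d → 𝟙 (c <ᵇ d) * (pairWeight c d + pairWeight d c))
    ≡⟨ sym (∑∑-+ M equalBottoms (λ c d → 𝟙 (c <ᵇ d) * (pairWeight c d + pairWeight d c))) ⟩
      ∑∑ (λ c d → equalBottoms c d + 𝟙 (c <ᵇ d) * (pairWeight c d + pairWeight d c)) ∎
    where
    open ≡-Reasoning
    move-equalBottoms-first : ∀ a e b c → ((a + e) + b) + c ≡ e + ((a + b) + c)
    move-equalBottoms-first = solve-∀

  QS2₀ : ℕ → ℕ → ℕ → ℕ → Bool
  QS2₀ = QS2 0 (λ _ → 0) (λ _ _ → 0)

  ηbarR : ℕ
  ηbarR = sumℕ 1 L (λ c → count 1 L (λ d → inS c ∧ inS d ∧ (c <ᵇ d) ∧ not (QS2₀ (t c) (t d) (b c) (b d))))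

  ¬QS2𝟙 : ℕ → ℕ → ℤ
  ¬QS2𝟙 c d = 𝟙 (not (QS2₀ (t c) (t d) (b c) (b d)))

  ηbarR≡∑∑ : + ηbarR ≡ ∑∑ (λ c d → 𝟙 (c <ᵇ d) * (𝟙S c * (𝟙S d * ¬QS2𝟙 c d)))
  ηbarR≡∑∑ = trans (sumℕ≡∑𝟙 1 L M (λ c → count 1 L (λ d → inS c ∧ inS d ∧ (c <ᵇ d) ∧ not (QS2₀ (t c) (t d) (b c) (b d)))) NP.≤-refl) (∑-cong M (λ c _ →
      trans (cong (𝟙 (inRange 1 L c) *_) (count≡∑𝟙 1 L M (λ d → inS c ∧ inS d ∧ (c <ᵇ d) ∧ not (QS2₀ (t c) (t d) (b c) (b d))) NP.≤-refl))
      (trans (sym (∑-*ˡ M (𝟙 (inRange 1 L c)) (λ d → 𝟙 (inRange 1 L d) * 𝟙 (inS c ∧ inS d ∧ (c <ᵇ d) ∧ not (QS2₀ (t c) (t d) (b c) (b d)))))) (∑-cong M (λ d _ → pointwise c d)))))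
    where
    pointwise : ∀ c d → 𝟙 (inRange 1 L c) * (𝟙 (inRange 1 L d) * 𝟙 (inS c ∧ inS d ∧ (c <ᵇ d) ∧ not (QS2₀ (t c) (t d) (b c) (b d))))
                 ≡ 𝟙 (c <ᵇ d) * (𝟙S c * (𝟙S d * ¬QS2𝟙 c d))
    pointwise c d with inS c in e1 | inS d in e2
    ... | false | _ = trans (*-zeroʳ² (𝟙 (inRange 1 L c)) (𝟙 (inRange 1 L d))) (sym (ZP.*-zeroʳ (𝟙 (c <ᵇ d))))
    ... | true | false = trans (*-zeroʳ² (𝟙 (inRange 1 L c)) (𝟙 (inRange 1 L d))) (sym (ZP.*-zeroʳ (𝟙 (c <ᵇ d))))
    ... | true | true rewrite ≤ᵇ-true (proj₁ (inS-bounds c e1)) | ≤ᵇ-true (proj₂ (inS-bounds c e1))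
                            | ≤ᵇ-true (proj₁ (inS-bounds d e2)) | ≤ᵇ-true (proj₂ (inS-bounds d e2)) =
      trans (ZP.*-identityˡ (+ 1 * 𝟙 ((c <ᵇ d) ∧ not (QS2₀ (t c) (t d) (b c) (b d)))))
       (trans (ZP.*-identityˡ (𝟙 ((c <ᵇ d) ∧ not (QS2₀ (t c) (t d) (b c) (b d)))))
        (trans (𝟙-∧ (c <ᵇ d) (not (QS2₀ (t c) (t d) (b c) (b d))))
          (cong (𝟙 (c <ᵇ d) *_) (sym (trans (ZP.*-identityˡ (+ 1 * ¬QS2𝟙 c d)) (ZP.*-identityˡ (¬QS2𝟙 c d)))))))

  module UnderCanonicity (canon : ∀ c d → inS c ≡ true → inS d ≡ true → c < d → canonicalᵇ (t c) (t d) (b c) (b d) ≡ true) where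

    onPair-S : ∀ (F : ℕ → ℕ → ℕ → ℕ → ℤ) c d → inS c ≡ true → inS d ≡ true → onPair F c d ≡ F (β c) (τ c) (β d) (τ d)
    onPair-S F c d e1 e2 rewrite e1 | e2 = trans (ZP.*-identityˡ (+ 1 * F (β c) (τ c) (β d) (τ d))) (ZP.*-identityˡ (F (β c) (τ c) (β d) (τ d)))

    pairWeight≡pairDefect : ∀ c d → inS c ≡ true → inS d ≡ true → pairWeight c d ≡ pairDefect (t c) (b c) (t d) (b d)
    pairWeight≡pairDefect c d e1 e2 rewrite onPair-S first-weight c d e1 e2 | onPair-S third-weight c d e1 e2 | onPair-S fourth-weight c d e1 e2
      | ∸-reverses-<ᵇ {t c} {b c} {K} (t≤K c) (b≤K c) | ∸-reverses-<ᵇ {b d} {b c} {K} (b≤K d) (b≤K c)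
      | ∸-reverses-≤ᵇ {t c} {t d} {K} (t≤K c) (t≤K d) | ∸-reverses-<ᵇ {t d} {b c} {K} (t≤K d) (b≤K c)
      | ∸-injective-≡ᵇ {t d} {t c} {K} (t≤K d) (t≤K c)
      | ∸-reverses-≤ᵇ {b c} {t c} {K} (b≤K c) (t≤K c) | ∸-reverses-≤ᵇ {b c} {t d} {K} (b≤K c) (t≤K d) = refl

    pairWeight-off : ∀ c d → inS c ≡ false → (pairWeight c d ≡ + 0) × (pairWeight d c ≡ + 0)
    pairWeight-off c d e rewrite e = refl , cong₂ _+_ (cong₂ _+_ (ZP.*-zeroʳ (𝟙S d)) (ZP.*-zeroʳ (𝟙S d))) (ZP.*-zeroʳ (𝟙S d))

    𝟙S-off : ∀ c X → inS c ≡ false → 𝟙S c * X ≡ + 0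
    𝟙S-off c X e rewrite e = refl

    ¬QS2-pointwise : ∀ c d → 𝟙 (c <ᵇ d) * (𝟙S c * (𝟙S d * ¬QS2𝟙 c d)) ≡ equalBottoms c d + 𝟙 (c <ᵇ d) * (pairWeight c d + pairWeight d c)
    ¬QS2-pointwise c d with c <ᵇ d in ec
    ... | false = refl
    ... | true = go (inS c) refl (inS d) refl
      where
      Goal : Set
      Goal = + 1 * (𝟙S c * (𝟙S d * ¬QS2𝟙 c d)) ≡ + 1 * (𝟙S c * (𝟙S d * 𝟙 (β c ≡ᵇ β d))) + + 1 * (pairWeight c d + pairWeight d c)
      all-vanish : + 1 * (𝟙S c * (𝟙S d * ¬QS2𝟙 c d)) ≡ + 0 → + 1 * (𝟙S c * (𝟙S d * 𝟙 (β c ≡ᵇ β d))) ≡ + 0 →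
        pairWeight c d ≡ + 0 → pairWeight d c ≡ + 0 → Goal
      all-vanish h₁ h₂ h₃ h₄ rewrite h₁ | h₂ | h₃ | h₄ = refl
      go : ∀ x → inS c ≡ x → ∀ y → inS d ≡ y → Goal
      go false e1 _ _ = all-vanish (cong (+ 1 *_) (𝟙S-off c (𝟙S d * ¬QS2𝟙 c d) e1)) (cong (+ 1 *_) (𝟙S-off c (𝟙S d * 𝟙 (β c ≡ᵇ β d)) e1))
        (proj₁ (pairWeight-off c d e1)) (proj₂ (pairWeight-off c d e1))
      go true e1 false e2 = all-vanish (trans (cong (λ z → + 1 * (𝟙S c * z)) (𝟙S-off d (¬QS2𝟙 c d) e2)) (*-zeroʳ² (+ 1) (𝟙S c)))
        (trans (cong (λ z → + 1 * (𝟙S c * z)) (𝟙S-off d (𝟙 (β c ≡ᵇ β d)) e2)) (*-zeroʳ² (+ 1) (𝟙S c)))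
        (proj₂ (pairWeight-off d c e2)) (proj₁ (pairWeight-off d c e2))
      go true e1 true e2 = trans (cong (+ 1 *_) (on-S ¬QS2𝟙))
          (trans (ZP.*-identityˡ (¬QS2𝟙 c d))
          (trans (¬QS2-split (t c) (t d) (b c) (b d) (canon c d e1 e2 (<ᵇ-sound {c} {d} ec)))
           (sym (cong₂ _+_
              (trans (cong (+ 1 *_) (on-S (λ c d → 𝟙 (β c ≡ᵇ β d)))) (trans (ZP.*-identityˡ (𝟙 (β c ≡ᵇ β d)))
                (cong 𝟙 (∸-injective-≡ᵇ {b c} {b d} {K} (b≤K c) (b≤K d)))))
              (trans (ZP.*-identityˡ (pairWeight c d + pairWeight d c)) (cong₂ _+_ (pairWeight≡pairDefect c d e1 e2) (pairWeight≡pairDefect d c e2 e1)))))))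
        where
        on-S : ∀ (f : ℕ → ℕ → ℤ) → 𝟙S c * (𝟙S d * f c d) ≡ f c d
        on-S f rewrite e1 | e2 = trans (ZP.*-identityˡ (+ 1 * f c d)) (ZP.*-identityˡ (f c d))

    ηbarR-formula : + ηbarR ≡ ((∑∑ (onPair first-weight) + ∑∑ equalBottoms) + ∑∑ (onPair third-weight)) + ∑∑ (onPair fourth-weight)
    ηbarR-formula = trans ηbarR≡∑∑ (trans (∑-cong M (λ c _ → ∑-cong M (λ d _ → ¬QS2-pointwise c d))) (sym rhs-symmetrized))

  νT : ℕ → ℕ
  νT k = count 1 L (λ c → inS c ∧ (suc N ∸ k ≤ᵇ t c))

  νT≡∑ : ∀ k → + νT k ≡ ∑ M (λ c → 𝟙S c * 𝟙 (τ c ≤ᵇ k))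
  νT≡∑ k = trans (count-S≡∑ (λ c → suc N ∸ k ≤ᵇ t c)) (∑-cong M (λ c _ → cong (λ z → 𝟙S c * 𝟙 z) (∸≤ᵇ-comm (suc N) k (t c))))

  νR-diff≡∑ : ∀ k → + νR k - + νR (k ∸ 1) ≡ ∑ M (λ c → 𝟙S c * 𝟙 (β c ≡ᵇ k))
  νR-diff≡∑ k rewrite νR≡∑ k | νR≡∑ (k ∸ 1) = trans (sym (∑-sub M (λ c → 𝟙S c * 𝟙 (β c ≤ᵇ k)) (λ c → 𝟙S c * 𝟙 (β c ≤ᵇ k ∸ 1))))
    (∑-cong M (λ c _ → pointwise c))
    where
    a≡b+e⇒a-b≡e : ∀ {a} b e → a ≡ b + e → a - b ≡ e
    a≡b+e⇒a-b≡e b e refl = [b+e]-b≡e b e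
      where
      [b+e]-b≡e : ∀ b e → (b + e) - b ≡ e
      [b+e]-b≡e = solve-∀
    pointwise : ∀ c → 𝟙S c * 𝟙 (β c ≤ᵇ k) - 𝟙S c * 𝟙 (β c ≤ᵇ k ∸ 1) ≡ 𝟙S c * 𝟙 (β c ≡ᵇ k)
    pointwise c with inS c in e
    ... | false = refl
    ... | true = trans (*-distribˡ-sub (+ 1) (𝟙 (β c ≤ᵇ k)) (𝟙 (β c ≤ᵇ k ∸ 1)))
      (cong (+ 1 *_) (a≡b+e⇒a-b≡e (𝟙 (β c ≤ᵇ k ∸ 1)) (𝟙 (β c ≡ᵇ k)) (𝟙-≤ᵇ-pred (β c) k (1≤β c e))))



module Filling (n : ℕ) (lam : ℕ → ℕ) (σ : ℕ → ℕ → ℕ) (N : ℕ) (isPartition : IsPartition n lam)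
  (isFilling : IsFilling n lam σ) (largest : LargestEntry n lam σ N) where
  open Partition n lam isPartition public
  open QS2Identity using (canonicalᵇ)

  entry : ℕ → ℕ → ℕ
  entry = E n lam σ

  entry≤N : ∀ r c → entry r c ≤ N
  entry≤N r c with isCell n lam r c in e
  ... | false = z≤n
  ... | true with ∧-true {1 ≤ᵇ r} e
  ...   | e₁ , e₂₃ with ∧-true {r ≤ᵇ conj n lam c} e₂₃
  ...     | e₂ , e₃ = proj₁ largest r c (≤ᵇ-sound e₁) (≤ᵇ-sound e₃) (≤ᵇ-sound e₂)

  entry-cell : ∀ r c → 1 ≤ r → r ≤ conj n lam c → 1 ≤ c → entry r c ≡ σ r c
  entry-cell r c h₁ h₂ h₃ rewrite ≤ᵇ-true h₁ | ≤ᵇ-true h₂ | ≤ᵇ-true h₃ = refl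

  canonicalᵇ-intro : ∀ t t' b b' → (t ≡ t' → CondI n lam σ t b b') → CondII n lam σ t b t' b' →
    canonicalᵇ t t' b b' ≡ true
  canonicalᵇ-intro t t' b b' condI condII = cong₂ _∧_ condIᵇ condIIᵇ
    where
    condIᵇ : (not (t ≡ᵇ t') ∨ (((b <ᵇ t) ∧ (b' ≤ᵇ b)) ∨ (((t ≤ᵇ b') ∧ (b <ᵇ t)) ∨ ((b' ≤ᵇ b) ∧ (t ≤ᵇ b'))))) ≡ true
    condIᵇ with t ≡ᵇ t' in e
    ... | false = refl
    ... | true with condI (≡ᵇ-sound e)
    ...   | inj₁ (p , q) rewrite <ᵇ-true p | ≤ᵇ-true q = refl
    ...   | inj₂ (inj₁ (p , q)) rewrite ≤ᵇ-true p | <ᵇ-true q = BP.∨-zeroʳ (b' ≤ᵇ b)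
    ...   | inj₂ (inj₂ (p , q)) rewrite ≤ᵇ-true p | ≤ᵇ-true q =
            trans (cong ((b <ᵇ t) ∧ true ∨_) (BP.∨-zeroʳ (b <ᵇ t))) (BP.∨-zeroʳ ((b <ᵇ t) ∧ true))
    condIIᵇ : (not ((t ≤ᵇ b) ∧ (t' ≤ᵇ b')) ∨ ((not (t' ≤ᵇ t) ∨ (b' ≤ᵇ b)) ∧ (not (t <ᵇ t') ∨ (b ≤ᵇ b')))) ≡ true
    condIIᵇ with t ≤ᵇ b in e₁ | t' ≤ᵇ b' in e₂
    ... | false | _ = refl
    ... | true | false = refl
    ... | true | true with condII (≤ᵇ-sound e₁) (≤ᵇ-sound e₂)
    ...   | (q₁ , q₂) with t' ≤ᵇ t in e₃ | t <ᵇ t' in e₄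
    ...     | false | false = refl
    ...     | false | true rewrite ≤ᵇ-true (q₂ (<ᵇ-sound e₄)) = refl
    ...     | true | false rewrite ≤ᵇ-true (q₁ (≤ᵇ-sound e₃)) = refl
    ...     | true | true rewrite ≤ᵇ-true (q₁ (≤ᵇ-sound e₃)) | ≤ᵇ-true (q₂ (<ᵇ-sound e₄)) = refl

  module Strip (i j : ℕ) (1≤i : 1 ≤ i) (i≤j : i ≤ j) (j≤n : j ≤ n) where

    1≤entry : ∀ c → inSigma n lam j c ≡ true → 1 ≤ entry i c
    1≤entry c e = subst (1 ≤_) (sym (entry-cell i c 1≤i i≤conj 1≤c)) (isFilling i c 1≤i 1≤c i≤conj)
      where
      1≤c : 1 ≤ c
      1≤c = proj₁ (inSigma-bounds j c e)
      i≤conj : i ≤ conj n lam c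
      i≤conj = subst (i ≤_) (sym (inSigma⇒conj≡ j c (NP.≤-trans 1≤i i≤j) e)) i≤j

    open Row N (lam j) (inSigma n lam j) (entry (suc i)) (entry i) (inSigma-bounds j) 1≤entry
      (entry≤N i) (entry≤N (suc i)) public

    canonical-pairs : Canonical n lam σ → ∀ c d → inSigma n lam j c ≡ true → inSigma n lam j d ≡ true → c < d →
      canonicalᵇ (entry (suc i) c) (entry (suc i) d) (entry i c) (entry i d) ≡ true
    canonical-pairs canonical c d e₁ e₂ c<d = canonicalᵇ-intro _ _ _ _ (proj₁ conditions) (proj₂ conditions)
      where
      conditions : (E n lam σ (suc i) c ≡ E n lam σ (suc i) d → CondI n lam σ (entry (suc i) c) (entry i c) (entry i d))
                 × CondII n lam σ (entry (suc i) c) (entry i c) (entry (suc i) d) (entry i d)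
      conditions = canonical j (NP.≤-trans 1≤i i≤j) j≤n i 1≤i i≤j c d
        (<ᵇ-sound (proj₁ (∧-true {lam (suc j) <ᵇ c} e₁))) c<d (≤ᵇ-sound (proj₂ (∧-true {lam (suc j) <ᵇ d} e₂)))

    D≡height*descents : + D n lam σ i j ≡ + (j ∸ i) * descents
    D≡height*descents = trans (sumℕ≡∑𝟙 1 (lam j) M _ NP.≤-refl)
      (trans (∑-cong M (λ c _ → pointwise c)) (∑-*ˡ M (+ (j ∸ i)) (λ c → 𝟙S c * 𝟙 (entry i c <ᵇ entry (suc i) c))))
      where
      pointwise : ∀ c → 𝟙 (inRange 1 (lam j) c) * + (if inSigma n lam j c ∧ (entry i c <ᵇ entry (suc i) c) then conj n lam c ∸ i else 0)
                 ≡ + (j ∸ i) * (𝟙S c * 𝟙 (entry i c <ᵇ entry (suc i) c))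
      pointwise c with inSigma n lam j c in e | entry i c <ᵇ entry (suc i) c
      ... | false | _ = trans (ZP.*-zeroʳ (𝟙 (inRange 1 (lam j) c))) (sym (ZP.*-zeroʳ (+ (j ∸ i))))
      ... | true | false = trans (ZP.*-zeroʳ (𝟙 (inRange 1 (lam j) c))) (sym (ZP.*-zeroʳ (+ (j ∸ i))))
      ... | true | true rewrite ≤ᵇ-true (proj₁ (inSigma-bounds j c e)) | ≤ᵇ-true (proj₂ (inSigma-bounds j c e))
                              | inSigma⇒conj≡ j c (NP.≤-trans 1≤i i≤j) e
          = trans (ZP.*-identityˡ (+ (j ∸ i))) (sym (ZP.*-identityʳ (+ (j ∸ i))))

    descent-formula : + D n lam σ i j ≡ + (j ∸ i) * sumℤ 1 (N ∸ 1) (λ k → + s n lam σ N i j N k - + s n lam σ N i j k k)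
    descent-formula = trans D≡height*descents (sym (cong (+ (j ∸ i) *_) descents≡∑s))

    ηbar-formula : Canonical n lam σ → + ηbar n lam σ i j ≡
        sumℤ 1 (N ∸ 1) (λ k → sumℤ 1 k (λ h →
          (+ s n lam σ N i j (suc k) h - + s n lam σ N i j k h) * (+ ν n lam σ N i j k - sumℤ h k (λ a → + s n lam σ N i j k a))))
      + sumℤ 1 N (λ k → + ((ν n lam σ N i j k ∸ ν n lam σ N i j (k ∸ 1)) C 2))
      + sumℤ 1 (N ∸ 1) (λ k → sumℤ 1 k (λ h → (+ s n lam σ N i j (suc k) h - + s n lam σ N i j k h) * + s n lam σ N i j k h))
      + sumℤ 1 (N ∸ 1) (λ k →
          (+ ν n lam σ N i j (suc k) - sumℤ 1 k (λ a → + s n lam σ N i j (suc k) a) - + ν n lam σ N i j k + sumℤ 1 k (λ a → + s n lam σ N i j k a))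
          * (+ ν n lam σ N i j k - sumℤ 1 k (λ a → + s n lam σ N i j k a)))
    ηbar-formula canonical = trans (UnderCanonicity.ηbarR-formula (canonical-pairs canonical))
      (sym (cong₂ _+_ (cong₂ _+_ (cong₂ _+_ first-sum≡ second-sum≡) third-sum≡) fourth-sum≡))

module QuinvBar (n : ℕ) (lam : ℕ → ℕ) (σ : ℕ → ℕ → ℕ) (N : ℕ) (isPartition : IsPartition n lam)
  (isFilling : IsFilling n lam σ) (largest : LargestEntry n lam σ N) where
  open Filling n lam σ N isPartition isFilling largest

  W MC MI K : ℕ
  W = lam 1
  MC = suc W
  MI = suc n
  K = suc N

  height : ℕ → ℕ
  height c = conj n lam c

  𝟙col : ℕ → ℕ → ℤ
  𝟙col j c = 𝟙 (inSigma n lam j c)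

  descent : ℕ → ℕ → ℤ
  descent i c = 𝟙 (entry i c <ᵇ entry (suc i) c)

  comparison : ℕ → ℕ → ℕ → ℤ
  comparison i c d = 𝟙 (entry i d ≤ᵇ entry i c) - 𝟙 (entry i d <ᵇ entry (suc i) c)

  𝟙col≡ : ∀ j c → 1 ≤ j → 𝟙col j c ≡ 𝟙 (inRange 1 W c) * 𝟙 (j ≡ᵇ height c)
  𝟙col≡ j zero 1≤j = refl
  𝟙col≡ j (suc c') 1≤j with suc c' ≤ᵇ W in e
  ... | false rewrite BP.∧-zeroʳ (1 ≤ᵇ suc c') = cong 𝟙 (inSigma-beyond j (suc c') (NP.≤-<-trans (lam≤lam1 j 1≤j) (≤ᵇ-false-sound {suc c'} {W} e)))
  ... | true rewrite inSigma≡conj j (suc c') 1≤j (s≤s z≤n) = sym (ZP.*-identityˡ (𝟙 (j ≡ᵇ height (suc c'))))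

  lam≡∑ : ∀ x → 1 ≤ x → + lam x ≡ ∑ MC (λ d → 𝟙 (inRange 1 W d) * 𝟙 (x ≤ᵇ height d))
  lam≡∑ x 1≤x = trans (cong +_ (sym (count-all (lam x)))) (trans (count≡∑𝟙 1 (lam x) MC (λ _ → true) (s≤s (lam≤lam1 x 1≤x)))
      (∑-cong MC (λ d _ → pointwise d)))
    where
    pointwise : ∀ d → 𝟙 (inRange 1 (lam x) d) * 𝟙 true ≡ 𝟙 (inRange 1 W d) * 𝟙 (x ≤ᵇ height d)
    pointwise zero = refl
    pointwise (suc d') rewrite conj-duality (suc d') x (s≤s z≤n) 1≤x with suc d' ≤ᵇ lam x in e
    ... | false rewrite sym (conj-duality (suc d') x (s≤s z≤n) 1≤x) | e = sym (ZP.*-zeroʳ (𝟙 (suc d' ≤ᵇ W)))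
    ... | true rewrite sym (conj-duality (suc d') x (s≤s z≤n) 1≤x) | e | ≤ᵇ-true (NP.≤-trans (≤ᵇ-sound {suc d'} {lam x} e) (lam≤lam1 x 1≤x)) = refl

  lam-difference≡∑ : ∀ i j → 1 ≤ i → i ≤ j → + lam i - + lam j ≡ ∑ MC (λ d → 𝟙 (inRange 1 W d) * 𝟙 ((i ≤ᵇ height d) ∧ (height d <ᵇ j)))
  lam-difference≡∑ i j 1≤i i≤j rewrite lam≡∑ i 1≤i | lam≡∑ j (NP.≤-trans 1≤i i≤j) =
    trans (sym (∑-sub MC (λ d → 𝟙 (inRange 1 W d) * 𝟙 (i ≤ᵇ height d)) (λ d → 𝟙 (inRange 1 W d) * 𝟙 (j ≤ᵇ height d))))
      (∑-cong MC (λ d _ → trans (*-distribˡ-sub (𝟙 (inRange 1 W d)) (𝟙 (i ≤ᵇ height d)) (𝟙 (j ≤ᵇ height d))) (cong (𝟙 (inRange 1 W d) *_) (≤ᵇ-difference (height d)))))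
    where
    ≤ᵇ-difference : ∀ h → 𝟙 (i ≤ᵇ h) - 𝟙 (j ≤ᵇ h) ≡ 𝟙 ((i ≤ᵇ h) ∧ (h <ᵇ j))
    ≤ᵇ-difference h with j ≤ᵇ h in e
    ... | true rewrite ≤ᵇ-true (NP.≤-trans i≤j (≤ᵇ-sound {j} {h} e)) | <ᵇ-false (≤ᵇ-sound {j} {h} e) = refl
    ... | false rewrite <ᵇ-true (≤ᵇ-false-sound {j} {h} e) | BP.∧-identityʳ (i ≤ᵇ h) = ZP.+-identityʳ (𝟙 (i ≤ᵇ h))

  descentPart comparisonPart : ℕ → ℕ → ℕ → ℕ → ℤ
  descentPart i j c d = (𝟙 (inRange 1 W d) * 𝟙 ((i ≤ᵇ height d) ∧ (height d <ᵇ j))) * (𝟙col j c * descent i c)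
  comparisonPart i j c d = ∑ MI (λ l → 𝟙 (inRange (suc j) n l) * (𝟙col l c * (𝟙col j d * comparison i c d)))

  module _ (i j : ℕ) (1≤i : 1 ≤ i) (i≤j : i ≤ j) (j≤n : j ≤ n) where
    open Strip i j 1≤i i≤j j≤n using (descents; descents≡∑s) renaming (M to Mj)

    descents-extend : descents ≡ ∑ MC (λ c → 𝟙col j c * descent i c)
    descents-extend = ∑-extend Mj MC (λ c → 𝟙col j c * descent i c) (s≤s (lam≤lam1 j (NP.≤-trans 1≤i i≤j)))
      (λ c Mj≤C _ → cong (λ z → 𝟙 z * descent i c) (inSigma-beyond j c Mj≤C))

    descent-term≡∑∑ : (+ lam i - + lam j) * sumℤ 1 (N ∸ 1) (λ k → + s n lam σ N i j N k - + s n lam σ N i j k k) ≡ ∑ MC (λ c → ∑ MC (λ d → descentPart i j c d))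
    descent-term≡∑∑ = trans (cong₂ _*_ (lam-difference≡∑ i j 1≤i i≤j) (trans descents≡∑s descents-extend))
      (trans (∑*∑ MC MC (λ d → 𝟙 (inRange 1 W d) * 𝟙 ((i ≤ᵇ height d) ∧ (height d <ᵇ j))) (λ c → 𝟙col j c * descent i c))
        (∑-comm MC MC (λ d c → (𝟙 (inRange 1 W d) * 𝟙 ((i ≤ᵇ height d) ∧ (height d <ᵇ j))) * (𝟙col j c * descent i c))))

    βi τi : ℕ → ℕ
    βi c = suc N ∸ entry i c
    τi c = suc N ∸ entry (suc i) c

    Δν-col : ℕ → ℕ → ℤ
    Δν-col c k = 𝟙 (βi c ≤ᵇ k) - 𝟙 (τi c ≤ᵇ k ∸ 1)

    νR-step≡∑ : ∀ k → + ν n lam σ N i j k - + ν n lam σ N i j (k ∸ 1) ≡ ∑ MC (λ d → 𝟙col j d * 𝟙 (βi d ≡ᵇ k))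
    νR-step≡∑ k = trans (Strip.νR-diff≡∑ i j 1≤i i≤j j≤n k) (∑-extend (suc (lam j)) MC _ (s≤s (lam≤lam1 j (NP.≤-trans 1≤i i≤j)))
      (λ d beyond _ → cong (λ z → 𝟙 z * 𝟙 (βi d ≡ᵇ k)) (inSigma-beyond j d beyond)))

    ν-mixed-step≡∑ : ∀ k l → suc j ≤ l → l ≤ n → + ν n lam σ N i l k - + ν n lam σ N (suc i) l (k ∸ 1) ≡ ∑ MC (λ c → 𝟙col l c * Δν-col c k)
    ν-mixed-step≡∑ k l j<l l≤n = trans (cong₂ _-_ (Strip.νR≡∑ i l 1≤i i≤l l≤n k) (Strip.νT≡∑ i l 1≤i i≤l l≤n (k ∸ 1)))
        (trans (sym (∑-sub (suc (lam l)) (λ c → 𝟙col l c * 𝟙 (βi c ≤ᵇ k)) (λ c → 𝟙col l c * 𝟙 (τi c ≤ᵇ k ∸ 1))))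
          (trans (∑-cong (suc (lam l)) (λ c _ → *-distribˡ-sub (𝟙col l c) (𝟙 (βi c ≤ᵇ k)) (𝟙 (τi c ≤ᵇ k ∸ 1))))
            (∑-extend (suc (lam l)) MC _ (s≤s (lam≤lam1 l (NP.≤-trans 1≤i i≤l)))
              (λ c beyond _ → cong (λ z → 𝟙 z * Δν-col c k) (inSigma-beyond l c beyond)))))
      where
      i≤l : i ≤ l
      i≤l = NP.≤-trans i≤j (NP.≤-trans (NP.n≤1+n j) j<l)

    term : ℕ → ℕ → ℕ → ℕ → ℤ
    term k l c d = 𝟙 (inRange 1 N k) * (𝟙 (inRange (suc j) n l) * ((𝟙col j d * 𝟙 (βi d ≡ᵇ k)) * (𝟙col l c * Δν-col c k)))

    Δν : ℕ → ℤ
    Δν k = + ν n lam σ N i j k - + ν n lam σ N i j (k ∸ 1)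
    Δν-mixed : ℕ → ℕ → ℤ
    Δν-mixed k l = + ν n lam σ N i l k - + ν n lam σ N (suc i) l (k ∸ 1)

    expand : ∀ k l → 𝟙 (inRange 1 N k) * (𝟙 (inRange (suc j) n l) * (Δν k * Δν-mixed k l)) ≡ ∑ MC (λ c → ∑ MC (λ d → term k l c d))
    expand k l = go (inRange (suc j) n l) refl
      where
      go : ∀ x → inRange (suc j) n l ≡ x → 𝟙 (inRange 1 N k) * (𝟙 (inRange (suc j) n l) * (Δν k * Δν-mixed k l)) ≡ ∑ MC (λ c → ∑ MC (λ d → term k l c d))
      go false e = trans (cong (λ z → 𝟙 (inRange 1 N k) * (𝟙 z * (Δν k * Δν-mixed k l))) e) (trans (ZP.*-zeroʳ (𝟙 (inRange 1 N k)))
        (sym (∑-vanish MC _ (λ c _ → ∑-vanish MC _ (λ d _ →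
          trans (cong (λ z → 𝟙 (inRange 1 N k) * (𝟙 z * ((𝟙col j d * 𝟙 (βi d ≡ᵇ k)) * (𝟙col l c * Δν-col c k)))) e) (ZP.*-zeroʳ (𝟙 (inRange 1 N k))))))))
      go true e = begin
          𝟙 (inRange 1 N k) * (g * (Δν k * Δν-mixed k l))
        ≡⟨ cong (λ z → 𝟙 (inRange 1 N k) * (g * z)) (cong₂ _*_ (νR-step≡∑ k) (ν-mixed-step≡∑ k l j<l l≤n)) ⟩
          𝟙 (inRange 1 N k) * (g * (∑ MC (λ d → 𝟙col j d * 𝟙 (βi d ≡ᵇ k)) * ∑ MC (λ c → 𝟙col l c * Δν-col c k)))
        ≡⟨ cong (λ z → 𝟙 (inRange 1 N k) * (g * z)) (∑*∑ MC MC (λ d → 𝟙col j d * 𝟙 (βi d ≡ᵇ k)) (λ c → 𝟙col l c * Δν-col c k)) ⟩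
          𝟙 (inRange 1 N k) * (g * ∑ MC (λ d → ∑ MC (λ c → (𝟙col j d * 𝟙 (βi d ≡ᵇ k)) * (𝟙col l c * Δν-col c k))))
        ≡⟨ cong (𝟙 (inRange 1 N k) *_) (∑∑-*ˡ MC MC g (λ d c → (𝟙col j d * 𝟙 (βi d ≡ᵇ k)) * (𝟙col l c * Δν-col c k))) ⟩
          𝟙 (inRange 1 N k) * ∑ MC (λ d → ∑ MC (λ c → g * ((𝟙col j d * 𝟙 (βi d ≡ᵇ k)) * (𝟙col l c * Δν-col c k))))
        ≡⟨ ∑∑-*ˡ MC MC (𝟙 (inRange 1 N k)) (λ d c → g * ((𝟙col j d * 𝟙 (βi d ≡ᵇ k)) * (𝟙col l c * Δν-col c k))) ⟩
          ∑ MC (λ d → ∑ MC (λ c → term k l c d))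
        ≡⟨ ∑-comm MC MC (λ d c → term k l c d) ⟩
          ∑ MC (λ c → ∑ MC (λ d → term k l c d)) ∎
        where
        open ≡-Reasoning
        g : ℤ
        g = 𝟙 (inRange (suc j) n l)
        j<l : suc j ≤ l
        j<l = ≤ᵇ-sound {suc j} {l} (proj₁ (∧-true {suc j ≤ᵇ l} e))
        l≤n : l ≤ n
        l≤n = ≤ᵇ-sound {l} {n} (proj₂ (∧-true {suc j ≤ᵇ l} e))

    collapse-k : ∀ c d → 𝟙col j d * ∑ K (λ k → 𝟙 (inRange 1 N k) * (𝟙 (βi d ≡ᵇ k) * Δν-col c k)) ≡ 𝟙col j d * comparison i c d
    collapse-k c d = go (inSigma n lam j d) refl
      where
      go : ∀ x → inSigma n lam j d ≡ x → 𝟙col j d * ∑ K (λ k → 𝟙 (inRange 1 N k) * (𝟙 (βi d ≡ᵇ k) * Δν-col c k)) ≡ 𝟙col j d * comparison i c d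
      go false e = trans (cong (λ z → 𝟙 z * ∑ K (λ k → 𝟙 (inRange 1 N k) * (𝟙 (βi d ≡ᵇ k) * Δν-col c k))) e) (cong (λ z → 𝟙 z * comparison i c d) (sym e))
      go true e = cong (𝟙col j d *_) (trans (PairTerms.quinv-weight-collapse N (βi c) (τi c) (βi d) (Strip.1≤β i j 1≤i i≤j j≤n d e) (Strip.β≤N i j 1≤i i≤j j≤n d e))
        (cong₂ _-_ (cong 𝟙 (∸-reverses-≤ᵇ {entry i c} {entry i d} {K} (NP.m≤n⇒m≤1+n (entry≤N i c)) (NP.m≤n⇒m≤1+n (entry≤N i d))))
                   (cong 𝟙 (∸-reverses-<ᵇ {entry (suc i) c} {entry i d} {K} (NP.m≤n⇒m≤1+n (entry≤N (suc i) c)) (NP.m≤n⇒m≤1+n (entry≤N i d))))))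

    collapse-k-at : ∀ c d l → ∑ K (λ k → term k l c d) ≡ 𝟙 (inRange (suc j) n l) * (𝟙col l c * (𝟙col j d * comparison i c d))
    collapse-k-at c d l = begin
        ∑ K (λ k → term k l c d)
      ≡⟨ ∑-cong K (λ k _ → regroup (𝟙 (inRange 1 N k)) g (𝟙col j d) (𝟙 (βi d ≡ᵇ k)) (𝟙col l c) (Δν-col c k)) ⟩
        ∑ K (λ k → (g * (𝟙col l c * 𝟙col j d)) * (𝟙 (inRange 1 N k) * (𝟙 (βi d ≡ᵇ k) * Δν-col c k)))
      ≡⟨ ∑-*ˡ K (g * (𝟙col l c * 𝟙col j d)) (λ k → 𝟙 (inRange 1 N k) * (𝟙 (βi d ≡ᵇ k) * Δν-col c k)) ⟩
        (g * (𝟙col l c * 𝟙col j d)) * ∑ K (λ k → 𝟙 (inRange 1 N k) * (𝟙 (βi d ≡ᵇ k) * Δν-col c k))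
      ≡⟨ reassociate g (𝟙col l c) (𝟙col j d) _ ⟩
        g * (𝟙col l c * (𝟙col j d * ∑ K (λ k → 𝟙 (inRange 1 N k) * (𝟙 (βi d ≡ᵇ k) * Δν-col c k))))
      ≡⟨ cong (λ z → g * (𝟙col l c * z)) (collapse-k c d) ⟩
        g * (𝟙col l c * (𝟙col j d * comparison i c d)) ∎
      where
      open ≡-Reasoning
      g : ℤ
      g = 𝟙 (inRange (suc j) n l)
      regroup : ∀ r g a e b z → r * (g * ((a * e) * (b * z))) ≡ (g * (b * a)) * (r * (e * z))
      regroup = solve-∀
      reassociate : ∀ g b a S → (g * (b * a)) * S ≡ g * (b * (a * S))
      reassociate = solve-∀

    ν-product-term≡∑∑ : sumℤ 1 N (λ k → sumℤ (suc j) n (λ l → Δν k * Δν-mixed k l)) ≡ ∑ MC (λ c → ∑ MC (λ d → comparisonPart i j c d))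
    ν-product-term≡∑∑ = begin
        sumℤ 1 N (λ k → sumℤ (suc j) n (λ l → Δν k * Δν-mixed k l))
      ≡⟨ sumℤ≡∑𝟙 1 N K (λ k → sumℤ (suc j) n (λ l → Δν k * Δν-mixed k l)) NP.≤-refl ⟩
        ∑ K (λ k → 𝟙 (inRange 1 N k) * sumℤ (suc j) n (λ l → Δν k * Δν-mixed k l))
      ≡⟨ ∑-cong K (λ k _ → trans (cong (𝟙 (inRange 1 N k) *_) (sumℤ≡∑𝟙 (suc j) n MI (λ l → Δν k * Δν-mixed k l) NP.≤-refl))
            (trans (sym (∑-*ˡ MI (𝟙 (inRange 1 N k)) (λ l → 𝟙 (inRange (suc j) n l) * (Δν k * Δν-mixed k l))))
              (∑-cong MI (λ l _ → expand k l)))) ⟩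
        ∑ K (λ k → ∑ MI (λ l → ∑ MC (λ c → ∑ MC (λ d → term k l c d))))
      ≡⟨ ∑⁴-comm K MI MC term ⟩
        ∑ MC (λ c → ∑ MC (λ d → ∑ K (λ k → ∑ MI (λ l → term k l c d))))
      ≡⟨ ∑-cong MC (λ c _ → ∑-cong MC (λ d _ → trans (∑-comm K MI (λ k l → term k l c d)) (∑-cong MI (λ l _ → collapse-k-at c d l)))) ⟩
        ∑ MC (λ c → ∑ MC (λ d → comparisonPart i j c d)) ∎
      where open ≡-Reasoning

  guarded₂ : ∀ (a b : Bool) (X Y : ℤ) → (a ≡ true → b ≡ true → X ≡ Y) → 𝟙 a * (𝟙 b * X) ≡ 𝟙 a * (𝟙 b * Y)
  guarded₂ false b X Y h = refl
  guarded₂ true false X Y h = refl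
  guarded₂ true true X Y h = cong (λ z → + 1 * (+ 1 * z)) (h refl refl)

  at-true : ∀ x y z w → y ≡ true → z ≡ true → w ≡ true → 𝟙 (x ∧ y) * (𝟙 z * 𝟙 w) ≡ + 1 * 𝟙 (x ∧ true)
  at-true true .true .true .true refl refl refl = refl
  at-true false .true .true .true refl refl refl = refl

  descent-range : ∀ hc hd i → hd ≤ n → hc ≤ n →
    𝟙 (inRange 1 n i) * (𝟙 (inRange i n hc) * 𝟙 ((i ≤ᵇ hd) ∧ (hd <ᵇ hc))) ≡ 𝟙 (hd <ᵇ hc) * 𝟙 (inRange 1 hd i)
  descent-range hc hd i h1 h2 with i ≤ᵇ hd in a | hd <ᵇ hc in b
  ... | false | w rewrite BP.∧-zeroʳ (1 ≤ᵇ i) = trans (*-zeroʳ² (𝟙 (inRange 1 n i)) (𝟙 (inRange i n hc))) (sym (ZP.*-zeroʳ (𝟙 w)))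
  ... | true | false = *-zeroʳ² (𝟙 (inRange 1 n i)) (𝟙 (inRange i n hc))
  ... | true | true = at-true (1 ≤ᵇ i) (i ≤ᵇ n) ((i ≤ᵇ hc) ∧ (hc ≤ᵇ n)) true (≤ᵇ-true (NP.≤-trans (≤ᵇ-sound {i} {hd} a) h1))
         (cong₂ _∧_ (≤ᵇ-true (NP.≤-trans (≤ᵇ-sound {i} {hd} a) (NP.<⇒≤ (<ᵇ-sound {hd} {hc} b)))) (≤ᵇ-true h2)) refl

  comparison-range : ∀ hc hd i → hd ≤ n → hc ≤ n →
    𝟙 (inRange 1 n i) * (𝟙 (inRange i n hd) * 𝟙 (inRange (suc hd) n hc)) ≡ 𝟙 (hd <ᵇ hc) * 𝟙 (inRange 1 hd i)
  comparison-range hc hd i h1 h2 with i ≤ᵇ hd in a | hd <ᵇ hc in b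
  ... | false | w rewrite BP.∧-zeroʳ (1 ≤ᵇ i) = trans (*-zeroʳ² (𝟙 (inRange 1 n i)) (𝟙 false)) (sym (ZP.*-zeroʳ (𝟙 w)))
  ... | true | false = *-zeroʳ² (𝟙 (inRange 1 n i)) (𝟙 (hd ≤ᵇ n))
  ... | true | true = at-true (1 ≤ᵇ i) (i ≤ᵇ n) (hd ≤ᵇ n) (hc ≤ᵇ n) (≤ᵇ-true (NP.≤-trans (≤ᵇ-sound {i} {hd} a) h1)) (≤ᵇ-true h1) (≤ᵇ-true h2)

  summand : ℕ → ℕ → ℕ → ℕ → ℤ
  summand i j c d = 𝟙 (inRange 1 n i) * (𝟙 (inRange i n j) * (descentPart i j c d + comparisonPart i j c d))

  pairContribution : ℕ → ℕ → ℤ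
  pairContribution c d = 𝟙 (inRange 1 W c) * (𝟙 (inRange 1 W d) * (𝟙 (height d <ᵇ height c) * ∑ MI (λ i → 𝟙 (inRange 1 (height d) i) * (descent i c + comparison i c d))))

  guardedᵢⱼ : ∀ i j (X Y : ℤ) → (1 ≤ i → i ≤ j → X ≡ Y) → 𝟙 (inRange 1 n i) * (𝟙 (inRange i n j) * X) ≡ 𝟙 (inRange 1 n i) * (𝟙 (inRange i n j) * Y)
  guardedᵢⱼ i j X Y h = go (inRange 1 n i) refl (inRange i n j) refl
    where
    go : ∀ x → inRange 1 n i ≡ x → ∀ y → inRange i n j ≡ y → 𝟙 (inRange 1 n i) * (𝟙 (inRange i n j) * X) ≡ 𝟙 (inRange 1 n i) * (𝟙 (inRange i n j) * Y)
    go false e _ _ = trans (cong (λ z → 𝟙 z * (𝟙 (inRange i n j) * X)) e) (cong (λ z → 𝟙 z * (𝟙 (inRange i n j) * Y)) (sym e))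
    go true e false e' = trans (cong (λ z → 𝟙 (inRange 1 n i) * (𝟙 z * X)) e') (cong (λ z → 𝟙 (inRange 1 n i) * (𝟙 z * Y)) (sym e'))
    go true e true e' = cong (λ z → 𝟙 (inRange 1 n i) * (𝟙 (inRange i n j) * z))
      (h (≤ᵇ-sound {1} {i} (proj₁ (∧-true {1 ≤ᵇ i} e))) (≤ᵇ-sound {i} {j} (proj₁ (∧-true {i ≤ᵇ j} e'))))

  guardedₗ : ∀ j l (X Y : ℤ) → (1 ≤ l → X ≡ Y) → 𝟙 (inRange (suc j) n l) * X ≡ 𝟙 (inRange (suc j) n l) * Y
  guardedₗ j l X Y h = go (inRange (suc j) n l) refl
    where
    go : ∀ x → inRange (suc j) n l ≡ x → 𝟙 (inRange (suc j) n l) * X ≡ 𝟙 (inRange (suc j) n l) * Y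
    go false e = trans (cong (λ z → 𝟙 z * X) e) (cong (λ z → 𝟙 z * Y) (sym e))
    go true e = cong (𝟙 (inRange (suc j) n l) *_) (h (NP.≤-trans (s≤s z≤n) (≤ᵇ-sound {suc j} {l} (proj₁ (∧-true {suc j ≤ᵇ l} e)))))

  summands-vanish : ∀ c d → (∀ i j → 1 ≤ i → i ≤ j → descentPart i j c d + comparisonPart i j c d ≡ + 0) → ∑ MI (λ i → ∑ MI (λ j → summand i j c d)) ≡ + 0
  summands-vanish c d h = ∑-vanish MI _ (λ i _ → ∑-vanish MI _ (λ j _ →
     trans (guardedᵢⱼ i j _ (+ 0) (h i j)) (*-zeroʳ² (𝟙 (inRange 1 n i)) (𝟙 (inRange i n j)))))

  𝟙col-outside : ∀ j c → 1 ≤ j → inRange 1 W c ≡ false → 𝟙col j c ≡ + 0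
  𝟙col-outside j c 1≤j e = trans (𝟙col≡ j c 1≤j) (cong (λ z → 𝟙 z * 𝟙 (j ≡ᵇ height c)) e)

  outside-left : ∀ c d → inRange 1 W c ≡ false → ∀ i j → 1 ≤ i → i ≤ j → descentPart i j c d + comparisonPart i j c d ≡ + 0
  outside-left c d e i j 1≤i i≤j = cong₂ _+_ descent-zero comparison-zero
    where
    1≤j : 1 ≤ j
    1≤j = NP.≤-trans 1≤i i≤j
    descent-zero : descentPart i j c d ≡ + 0
    descent-zero = trans (cong (λ z → (𝟙 (inRange 1 W d) * 𝟙 ((i ≤ᵇ height d) ∧ (height d <ᵇ j))) * (z * descent i c)) (𝟙col-outside j c 1≤j e))
           (ZP.*-zeroʳ (𝟙 (inRange 1 W d) * 𝟙 ((i ≤ᵇ height d) ∧ (height d <ᵇ j))))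
    comparison-zero : comparisonPart i j c d ≡ + 0
    comparison-zero = ∑-vanish MI _ (λ l _ → trans (guardedₗ j l (𝟙col l c * (𝟙col j d * comparison i c d)) (+ 0)
           (λ 1≤l → cong (λ z → z * (𝟙col j d * comparison i c d)) (𝟙col-outside l c 1≤l e))) (ZP.*-zeroʳ (𝟙 (inRange (suc j) n l))))

  outside-right : ∀ c d → inRange 1 W d ≡ false → ∀ i j → 1 ≤ i → i ≤ j → descentPart i j c d + comparisonPart i j c d ≡ + 0
  outside-right c d e i j 1≤i i≤j = cong₂ _+_ descent-zero comparison-zero
    where
    1≤j : 1 ≤ j
    1≤j = NP.≤-trans 1≤i i≤j
    descent-zero : descentPart i j c d ≡ + 0
    descent-zero = cong (λ z → (𝟙 z * 𝟙 ((i ≤ᵇ height d) ∧ (height d <ᵇ j))) * (𝟙col j c * descent i c)) e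
    comparison-zero : comparisonPart i j c d ≡ + 0
    comparison-zero = ∑-vanish MI _ (λ l _ → trans (cong (λ z → 𝟙 (inRange (suc j) n l) * (𝟙col l c * (z * comparison i c d))) (𝟙col-outside j d 1≤j e))
           (*-zeroʳ² (𝟙 (inRange (suc j) n l)) (𝟙col l c)))

  module InsidePair (c d : ℕ) (c∈ : inRange 1 W c ≡ true) (d∈ : inRange 1 W d ≡ true) where
    hc hd : ℕ
    hc = height c
    hd = height d

    𝟙col-inside : ∀ j c → 1 ≤ j → inRange 1 W c ≡ true → 𝟙col j c ≡ 𝟙 (j ≡ᵇ height c)
    𝟙col-inside j c 1≤j e = trans (𝟙col≡ j c 1≤j) (trans (cong (λ z → 𝟙 z * 𝟙 (j ≡ᵇ height c)) e) (ZP.*-identityˡ (𝟙 (j ≡ᵇ height c))))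

    descentInside comparisonInside : ℕ → ℕ → ℤ
    descentInside i j = 𝟙 ((i ≤ᵇ hd) ∧ (hd <ᵇ j)) * (𝟙 (j ≡ᵇ hc) * descent i c)
    comparisonInside i j = ∑ MI (λ l → 𝟙 (inRange (suc j) n l) * (𝟙 (l ≡ᵇ hc) * (𝟙 (j ≡ᵇ hd) * comparison i c d)))

    inside-summand : ∀ i j → 1 ≤ i → i ≤ j → descentPart i j c d + comparisonPart i j c d ≡ descentInside i j + comparisonInside i j
    inside-summand i j 1≤i i≤j = cong₂ _+_ descent-part comparison-part
      where
      1≤j : 1 ≤ j
      1≤j = NP.≤-trans 1≤i i≤j
      descent-part : descentPart i j c d ≡ descentInside i j
      descent-part = cong₂ _*_ (trans (cong (λ z → 𝟙 z * 𝟙 ((i ≤ᵇ hd) ∧ (hd <ᵇ j))) d∈) (ZP.*-identityˡ (𝟙 ((i ≤ᵇ hd) ∧ (hd <ᵇ j)))))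
                     (cong (_* descent i c) (𝟙col-inside j c 1≤j c∈))
      comparison-part : comparisonPart i j c d ≡ comparisonInside i j
      comparison-part = ∑-cong MI (λ l _ → guardedₗ j l _ _ (λ 1≤l → cong₂ _*_ (𝟙col-inside l c 1≤l c∈) (cong (_* comparison i c d) (𝟙col-inside j d 1≤j d∈))))

    ∑j-descent : ∀ i → ∑ MI (λ j → 𝟙 (inRange i n j) * descentInside i j) ≡ 𝟙 (hc <ᵇ MI) * (𝟙 (inRange i n hc) * (𝟙 ((i ≤ᵇ hd) ∧ (hd <ᵇ hc)) * descent i c))
    ∑j-descent i = trans (∑-cong MI (λ j _ → pull-delta (𝟙 (inRange i n j)) (𝟙 ((i ≤ᵇ hd) ∧ (hd <ᵇ j))) (𝟙 (j ≡ᵇ hc)) (descent i c)))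
             (∑-𝟙≡ MI hc (λ j → 𝟙 (inRange i n j) * (𝟙 ((i ≤ᵇ hd) ∧ (hd <ᵇ j)) * descent i c)))
      where
      pull-delta : ∀ g a e d → g * (a * (e * d)) ≡ e * (g * (a * d))
      pull-delta = solve-∀

    ∑j-comparison : ∀ i → ∑ MI (λ j → 𝟙 (inRange i n j) * comparisonInside i j) ≡ 𝟙 (hd <ᵇ MI) * (𝟙 (hc <ᵇ MI) * (𝟙 (inRange i n hd) * (𝟙 (inRange (suc hd) n hc) * comparison i c d)))
    ∑j-comparison i = trans (∑-cong MI (λ j _ → trans (sym (∑-*ˡ MI (𝟙 (inRange i n j)) (λ l → 𝟙 (inRange (suc j) n l) * (𝟙 (l ≡ᵇ hc) * (𝟙 (j ≡ᵇ hd) * comparison i c d)))))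
                   (∑-cong MI (λ l _ → pull-deltas (𝟙 (inRange i n j)) (𝟙 (inRange (suc j) n l)) (𝟙 (l ≡ᵇ hc)) (𝟙 (j ≡ᵇ hd)) (comparison i c d)))))
             (∑∑-𝟙≡ MI hd hc (λ j l → 𝟙 (inRange i n j) * (𝟙 (inRange (suc j) n l) * comparison i c d)))
      where
      pull-deltas : ∀ g h a b x → g * (h * (a * (b * x))) ≡ b * (a * (g * (h * x)))
      pull-deltas = solve-∀

    hc≤n : hc ≤ n
    hc≤n = conj≤n c
    hd≤n : hd ≤ n
    hd≤n = conj≤n d

    per-row : ∀ i → 𝟙 (inRange 1 n i) * (𝟙 (hc <ᵇ MI) * (𝟙 (inRange i n hc) * (𝟙 ((i ≤ᵇ hd) ∧ (hd <ᵇ hc)) * descent i c))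
                  + 𝟙 (hd <ᵇ MI) * (𝟙 (hc <ᵇ MI) * (𝟙 (inRange i n hd) * (𝟙 (inRange (suc hd) n hc) * comparison i c d))))
             ≡ 𝟙 (hd <ᵇ hc) * (𝟙 (inRange 1 hd i) * (descent i c + comparison i c d))
    per-row i = begin
        𝟙 (inRange 1 n i) * (𝟙 (hc <ᵇ MI) * (𝟙 (inRange i n hc) * (𝟙 ((i ≤ᵇ hd) ∧ (hd <ᵇ hc)) * descent i c))
                  + 𝟙 (hd <ᵇ MI) * (𝟙 (hc <ᵇ MI) * (𝟙 (inRange i n hd) * (𝟙 (inRange (suc hd) n hc) * comparison i c d))))
      ≡⟨ cong₂ (λ u v → 𝟙 (inRange 1 n i) * (𝟙 u * (𝟙 (inRange i n hc) * (𝟙 ((i ≤ᵇ hd) ∧ (hd <ᵇ hc)) * descent i c))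
                  + 𝟙 v * (𝟙 u * (𝟙 (inRange i n hd) * (𝟙 (inRange (suc hd) n hc) * comparison i c d))))) (<ᵇ-true (s≤s hc≤n)) (<ᵇ-true (s≤s hd≤n)) ⟩
        𝟙 (inRange 1 n i) * (+ 1 * (𝟙 (inRange i n hc) * (𝟙 ((i ≤ᵇ hd) ∧ (hd <ᵇ hc)) * descent i c))
                  + + 1 * (+ 1 * (𝟙 (inRange i n hd) * (𝟙 (inRange (suc hd) n hc) * comparison i c d))))
      ≡⟨ expand-guards (𝟙 (inRange 1 n i)) (𝟙 (inRange i n hc)) (𝟙 ((i ≤ᵇ hd) ∧ (hd <ᵇ hc))) (descent i c) (𝟙 (inRange i n hd)) (𝟙 (inRange (suc hd) n hc)) (comparison i c d) ⟩
        (𝟙 (inRange 1 n i) * (𝟙 (inRange i n hc) * 𝟙 ((i ≤ᵇ hd) ∧ (hd <ᵇ hc)))) * descent i c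
          + (𝟙 (inRange 1 n i) * (𝟙 (inRange i n hd) * 𝟙 (inRange (suc hd) n hc))) * comparison i c d
      ≡⟨ cong₂ (λ u v → u * descent i c + v * comparison i c d) (descent-range hc hd i hd≤n hc≤n) (comparison-range hc hd i hd≤n hc≤n) ⟩
        (𝟙 (hd <ᵇ hc) * 𝟙 (inRange 1 hd i)) * descent i c + (𝟙 (hd <ᵇ hc) * 𝟙 (inRange 1 hd i)) * comparison i c d
      ≡⟨ factor-guards (𝟙 (hd <ᵇ hc)) (𝟙 (inRange 1 hd i)) (descent i c) (comparison i c d) ⟩
        𝟙 (hd <ᵇ hc) * (𝟙 (inRange 1 hd i) * (descent i c + comparison i c d)) ∎
      where
      open ≡-Reasoning
      expand-guards : ∀ r a b x c d y → r * (+ 1 * (a * (b * x)) + + 1 * (+ 1 * (c * (d * y)))) ≡ (r * (a * b)) * x + (r * (c * d)) * y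
      expand-guards = solve-∀
      factor-guards : ∀ h q x y → (h * q) * x + (h * q) * y ≡ h * (q * (x + y))
      factor-guards = solve-∀

    collapse : ∑ MI (λ i → ∑ MI (λ j → summand i j c d)) ≡ pairContribution c d
    collapse = begin
        ∑ MI (λ i → ∑ MI (λ j → summand i j c d))
      ≡⟨ ∑-cong MI (λ i _ → ∑-cong MI (λ j _ → guardedᵢⱼ i j _ _ (inside-summand i j))) ⟩
        ∑ MI (λ i → ∑ MI (λ j → 𝟙 (inRange 1 n i) * (𝟙 (inRange i n j) * (descentInside i j + comparisonInside i j))))
      ≡⟨ ∑-cong MI (λ i _ → trans (∑-*ˡ MI (𝟙 (inRange 1 n i)) (λ j → 𝟙 (inRange i n j) * (descentInside i j + comparisonInside i j)))
            (cong (𝟙 (inRange 1 n i) *_) (trans (∑-cong MI (λ j _ → ZP.*-distribˡ-+ (𝟙 (inRange i n j)) (descentInside i j) (comparisonInside i j)))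
              (trans (∑-+ MI (λ j → 𝟙 (inRange i n j) * descentInside i j) (λ j → 𝟙 (inRange i n j) * comparisonInside i j)) (cong₂ _+_ (∑j-descent i) (∑j-comparison i)))))) ⟩
        ∑ MI (λ i → 𝟙 (inRange 1 n i) * (𝟙 (hc <ᵇ MI) * (𝟙 (inRange i n hc) * (𝟙 ((i ≤ᵇ hd) ∧ (hd <ᵇ hc)) * descent i c))
                  + 𝟙 (hd <ᵇ MI) * (𝟙 (hc <ᵇ MI) * (𝟙 (inRange i n hd) * (𝟙 (inRange (suc hd) n hc) * comparison i c d)))))
      ≡⟨ ∑-cong MI (λ i _ → per-row i) ⟩
        ∑ MI (λ i → 𝟙 (hd <ᵇ hc) * (𝟙 (inRange 1 hd i) * (descent i c + comparison i c d)))
      ≡⟨ ∑-*ˡ MI (𝟙 (hd <ᵇ hc)) (λ i → 𝟙 (inRange 1 hd i) * (descent i c + comparison i c d)) ⟩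
        𝟙 (hd <ᵇ hc) * ∑ MI (λ i → 𝟙 (inRange 1 hd i) * (descent i c + comparison i c d))
      ≡⟨ sym (trans (cong₂ (λ u v → 𝟙 u * (𝟙 v * (𝟙 (hd <ᵇ hc) * ∑ MI (λ i → 𝟙 (inRange 1 hd i) * (descent i c + comparison i c d))))) c∈ d∈)
              (trans (ZP.*-identityˡ _) (ZP.*-identityˡ _))) ⟩
        pairContribution c d ∎
      where open ≡-Reasoning

  summands≡pairContribution : ∀ c d → ∑ MI (λ i → ∑ MI (λ j → summand i j c d)) ≡ pairContribution c d
  summands≡pairContribution c d = go (inRange 1 W c) refl (inRange 1 W d) refl
    where
    rhs : ℤ
    rhs = 𝟙 (height d <ᵇ height c) * ∑ MI (λ i → 𝟙 (inRange 1 (height d) i) * (descent i c + comparison i c d))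
    go : ∀ x → inRange 1 W c ≡ x → ∀ y → inRange 1 W d ≡ y → ∑ MI (λ i → ∑ MI (λ j → summand i j c d)) ≡ pairContribution c d
    go false e _ _ = trans (summands-vanish c d (outside-left c d e)) (sym (cong (λ z → 𝟙 z * (𝟙 (inRange 1 W d) * rhs)) e))
    go true e false e' = trans (summands-vanish c d (outside-right c d e')) (sym (trans (cong (λ z → 𝟙 (inRange 1 W c) * (𝟙 z * rhs)) e') (ZP.*-zeroʳ (𝟙 (inRange 1 W c)))))
    go true e true e' = InsidePair.collapse c d e e'

  guardedᵢⱼₙ : ∀ i j (X Y : ℤ) → (1 ≤ i → i ≤ j → j ≤ n → X ≡ Y) → 𝟙 (inRange 1 n i) * (𝟙 (inRange i n j) * X) ≡ 𝟙 (inRange 1 n i) * (𝟙 (inRange i n j) * Y)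
  guardedᵢⱼₙ i j X Y h = go (inRange i n j) refl
    where
    go : ∀ y → inRange i n j ≡ y → 𝟙 (inRange 1 n i) * (𝟙 (inRange i n j) * X) ≡ 𝟙 (inRange 1 n i) * (𝟙 (inRange i n j) * Y)
    go false e' = trans (cong (λ z → 𝟙 (inRange 1 n i) * (𝟙 z * X)) e') (cong (λ z → 𝟙 (inRange 1 n i) * (𝟙 z * Y)) (sym e'))
    go true e' = guardedᵢⱼ i j X Y (λ 1≤i i≤j → h 1≤i i≤j (≤ᵇ-sound {j} {n} (proj₂ (∧-true {i ≤ᵇ j} e'))))

  rhs≡∑∑ : sumℤ 1 n (λ i → sumℤ i n (λ j →
            (+ lam i - + lam j) * sumℤ 1 (N ∸ 1) (λ k → + s n lam σ N i j N k - + s n lam σ N i j k k)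
          + sumℤ 1 N (λ k → sumℤ (suc j) n (λ l →
              (+ ν n lam σ N i j k - + ν n lam σ N i j (k ∸ 1))
                * (+ ν n lam σ N i l k - + ν n lam σ N (suc i) l (k ∸ 1))))))
        ≡ ∑ MC (λ c → ∑ MC (λ d → pairContribution c d))
  rhs≡∑∑ = begin
      sumℤ 1 n (λ i → sumℤ i n (λ j → f i j))
    ≡⟨ sumℤ≡∑𝟙 1 n MI (λ i → sumℤ i n (λ j → f i j)) NP.≤-refl ⟩
      ∑ MI (λ i → 𝟙 (inRange 1 n i) * sumℤ i n (λ j → f i j))
    ≡⟨ ∑-cong MI (λ i _ → trans (cong (𝟙 (inRange 1 n i) *_) (sumℤ≡∑𝟙 i n MI (f i) NP.≤-refl))
          (trans (sym (∑-*ˡ MI (𝟙 (inRange 1 n i)) (λ j → 𝟙 (inRange i n j) * f i j)))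
            (∑-cong MI (λ j _ → guardedᵢⱼₙ i j _ _ (λ 1≤i i≤j j≤n → trans (cong₂ _+_ (descent-term≡∑∑ i j 1≤i i≤j j≤n) (ν-product-term≡∑∑ i j 1≤i i≤j j≤n))
                  (sym (∑∑-+-MC (λ c d → descentPart i j c d) (λ c d → comparisonPart i j c d)))))))) ⟩
      ∑ MI (λ i → ∑ MI (λ j → 𝟙 (inRange 1 n i) * (𝟙 (inRange i n j) * ∑ MC (λ c → ∑ MC (λ d → descentPart i j c d + comparisonPart i j c d)))))
    ≡⟨ ∑-cong MI (λ i _ → ∑-cong MI (λ j _ → trans (cong (𝟙 (inRange 1 n i) *_) (∑∑-*ˡ MC MC (𝟙 (inRange i n j)) (λ c d → descentPart i j c d + comparisonPart i j c d)))
          (∑∑-*ˡ MC MC (𝟙 (inRange 1 n i)) (λ c d → 𝟙 (inRange i n j) * (descentPart i j c d + comparisonPart i j c d))))) ⟩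
      ∑ MI (λ i → ∑ MI (λ j → ∑ MC (λ c → ∑ MC (λ d → summand i j c d))))
    ≡⟨ ∑⁴-comm MI MI MC summand ⟩
      ∑ MC (λ c → ∑ MC (λ d → ∑ MI (λ i → ∑ MI (λ j → summand i j c d))))
    ≡⟨ ∑-cong MC (λ c _ → ∑-cong MC (λ d _ → summands≡pairContribution c d)) ⟩
      ∑ MC (λ c → ∑ MC (λ d → pairContribution c d)) ∎
    where
    open ≡-Reasoning
    f : ℕ → ℕ → ℤ
    f i j = (+ lam i - + lam j) * sumℤ 1 (N ∸ 1) (λ k → + s n lam σ N i j N k - + s n lam σ N i j k k)
          + sumℤ 1 N (λ k → sumℤ (suc j) n (λ l →
              (+ ν n lam σ N i j k - + ν n lam σ N i j (k ∸ 1))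
                * (+ ν n lam σ N i l k - + ν n lam σ N (suc i) l (k ∸ 1))))
    ∑∑-+-MC : ∀ (f g : ℕ → ℕ → ℤ) → ∑ MC (λ c → ∑ MC (λ d → f c d + g c d)) ≡ ∑ MC (λ c → ∑ MC (λ d → f c d)) + ∑ MC (λ c → ∑ MC (λ d → g c d))
    ∑∑-+-MC f g = trans (∑-cong MC (λ c _ → ∑-+ MC (f c) (g c))) (∑-+ MC (λ c → ∑ MC (f c)) (λ c → ∑ MC (g c)))

  quinvTriple : ℕ → ℕ → ℕ → Bool
  quinvTriple c d r = (c <ᵇ d) ∧ (height d <ᵇ height c) ∧ not (Q n lam σ (σ (suc r) c) (σ r c) (σ r d))

  lhsPair : ℕ → ℕ → ℤ
  lhsPair c d = 𝟙 (inRange 1 W c) * (𝟙 (inRange 1 W d) * ∑ MI (λ r → 𝟙 (inRange 1 (height d) r) * 𝟙 (quinvTriple c d r)))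

  quinvBar≡∑∑ : + quinvBar n lam σ ≡ ∑ MC (λ c → ∑ MC (λ d → lhsPair c d))
  quinvBar≡∑∑ = trans (sumℕ≡∑𝟙 1 W MC _ NP.≤-refl) (∑-cong MC (λ c _ →
      trans (cong (𝟙 (inRange 1 W c) *_) (trans (sumℕ≡∑𝟙 1 W MC (λ d → count 1 (height d) (quinvTriple c d)) NP.≤-refl)
        (∑-cong MC (λ d _ → cong (𝟙 (inRange 1 W d) *_) (count≡∑𝟙 1 (height d) MI (quinvTriple c d) (s≤s (conj≤n d)))))))
      (sym (∑-*ˡ MC (𝟙 (inRange 1 W c)) (λ d → 𝟙 (inRange 1 W d) * ∑ MI (λ r → 𝟙 (inRange 1 (height d) r) * 𝟙 (quinvTriple c d r)))))))

  quinvTriple-split : ∀ c d r → 1 ≤ c → 1 ≤ d → height d < height c → 1 ≤ r → r ≤ height d →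
    𝟙 (quinvTriple c d r) ≡ descent r c + comparison r c d
  quinvTriple-split c d r 1≤c 1≤d d<c 1≤r r≤d =
    trans (cong₂ (λ u v → 𝟙 (u ∧ v ∧ not (Q n lam σ (σ (suc r) c) (σ r c) (σ r d)))) c<d (<ᵇ-true d<c))
      (trans (QIdentity.¬Q-split (σ (suc r) c) (σ r c) (σ r d))
        (sym (cong₃ (λ a b c → 𝟙 (b <ᵇ a) + (𝟙 (c ≤ᵇ b) - 𝟙 (c <ᵇ a))) top-c bottom-c bottom-d)))
    where
    c<d : (c <ᵇ d) ≡ true
    c<d = <ᵇ-true (NP.≰⇒> (λ d≤c → NP.<⇒≱ d<c (conj-antitone c d 1≤d d≤c)))
    top-c : entry (suc r) c ≡ σ (suc r) c
    top-c = entry-cell (suc r) c (s≤s z≤n) (NP.≤-<-trans r≤d d<c) 1≤c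
    bottom-c : entry r c ≡ σ r c
    bottom-c = entry-cell r c 1≤r (NP.≤-trans r≤d (NP.<⇒≤ d<c)) 1≤c
    bottom-d : entry r d ≡ σ r d
    bottom-d = entry-cell r d 1≤r r≤d 1≤d
    cong₃ : ∀ (f : ℕ → ℕ → ℕ → ℤ) {a a' b b' c c'} → a ≡ a' → b ≡ b' → c ≡ c' → f a b c ≡ f a' b' c'
    cong₃ f refl refl refl = refl

  lhsPair≡pairContribution : ∀ c d → lhsPair c d ≡ pairContribution c d
  lhsPair≡pairContribution c d = guarded₂ (inRange 1 W c) (inRange 1 W d) _ _ inner
    where
    inner : inRange 1 W c ≡ true → inRange 1 W d ≡ true →
      ∑ MI (λ r → 𝟙 (inRange 1 (height d) r) * 𝟙 (quinvTriple c d r))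
        ≡ 𝟙 (height d <ᵇ height c) * ∑ MI (λ i → 𝟙 (inRange 1 (height d) i) * (descent i c + comparison i c d))
    inner c∈ d∈ = go (height d <ᵇ height c) refl
      where
      rhs-sum : ℤ
      rhs-sum = ∑ MI (λ i → 𝟙 (inRange 1 (height d) i) * (descent i c + comparison i c d))
      go : ∀ x → (height d <ᵇ height c) ≡ x →
        ∑ MI (λ r → 𝟙 (inRange 1 (height d) r) * 𝟙 (quinvTriple c d r)) ≡ 𝟙 (height d <ᵇ height c) * rhs-sum
      go false d≮c = trans (∑-vanish MI _ (λ r _ →
          trans (cong (λ z → 𝟙 (inRange 1 (height d) r) * 𝟙 ((c <ᵇ d) ∧ z ∧ not (Q n lam σ (σ (suc r) c) (σ r c) (σ r d)))) d≮c)
            (trans (cong (λ b → 𝟙 (inRange 1 (height d) r) * 𝟙 b) (BP.∧-zeroʳ (c <ᵇ d))) (ZP.*-zeroʳ (𝟙 (inRange 1 (height d) r))))))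
        (sym (cong (λ z → 𝟙 z * rhs-sum) d≮c))
      go true d<c = trans (∑-cong MI (λ r _ → pointwise r)) (sym (trans (cong (λ z → 𝟙 z * rhs-sum) d<c) (ZP.*-identityˡ rhs-sum)))
        where
        pointwise : ∀ r → 𝟙 (inRange 1 (height d) r) * 𝟙 (quinvTriple c d r)
                        ≡ 𝟙 (inRange 1 (height d) r) * (descent r c + comparison r c d)
        pointwise r with inRange 1 (height d) r in r∈
        ... | false = refl
        ... | true = cong (+ 1 *_) (quinvTriple-split c d r
              (≤ᵇ-sound (proj₁ (∧-true {1 ≤ᵇ c} c∈))) (≤ᵇ-sound (proj₁ (∧-true {1 ≤ᵇ d} d∈))) (<ᵇ-sound d<c)
              (≤ᵇ-sound (proj₁ (∧-true {1 ≤ᵇ r} r∈))) (≤ᵇ-sound (proj₂ (∧-true {1 ≤ᵇ r} r∈))))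

  quinvBar-formula : + quinvBar n lam σ ≡ sumℤ 1 n (λ i → sumℤ i n (λ j →
            (+ lam i - + lam j) * sumℤ 1 (N ∸ 1) (λ k → + s n lam σ N i j N k - + s n lam σ N i j k k)
          + sumℤ 1 N (λ k → sumℤ (suc j) n (λ l →
              (+ ν n lam σ N i j k - + ν n lam σ N i j (k ∸ 1))
                * (+ ν n lam σ N i l k - + ν n lam σ N (suc i) l (k ∸ 1))))))
  quinvBar-formula = trans quinvBar≡∑∑ (trans (∑-cong MC (λ c _ → ∑-cong MC (λ d _ → lhsPair≡pairContribution c d))) (sym rhs≡∑∑))


theorem8p2 : (n : ℕ) (lam : ℕ → ℕ) (σ : ℕ → ℕ → ℕ) (N : ℕ) →
    IsPartition n lam → IsFilling n lam σ → LargestEntry n lam σ N →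
    Canonical n lam σ →
    (∀ i j → 1 ≤ i → i ≤ j → j ≤ n →
      let νk = λ k → + ν n lam σ N i j k
          sk = λ m h → + s n lam σ N i j m h
          sr = λ m h k → sumℤ h k (λ a → sk m a)
      in (+ D n lam σ i j ≡ + (j ∸ i) * sumℤ 1 (N ∸ 1) (λ k → sk N k - sk k k))
       × (+ ηbar n lam σ i j ≡
            sumℤ 1 (N ∸ 1) (λ k → sumℤ 1 k (λ h →
              (sk (suc k) h - sk k h) * (νk k - sr k h k)))
          + sumℤ 1 N (λ k → + ((ν n lam σ N i j k ∸ ν n lam σ N i j (k ∸ 1)) C 2))
          + sumℤ 1 (N ∸ 1) (λ k → sumℤ 1 k (λ h → (sk (suc k) h - sk k h) * sk k h))
          + sumℤ 1 (N ∸ 1) (λ k →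
              (νk (suc k) - sr (suc k) 1 k - νk k + sr k 1 k) * (νk k - sr k 1 k))))
    × (+ quinvBar n lam σ ≡
        sumℤ 1 n (λ i → sumℤ i n (λ j →
          (+ lam i - + lam j)
            * sumℤ 1 (N ∸ 1) (λ k → + s n lam σ N i j N k - + s n lam σ N i j k k)
          + sumℤ 1 N (λ k → sumℤ (suc j) n (λ l →
              (+ ν n lam σ N i j k - + ν n lam σ N i j (k ∸ 1))
                * (+ ν n lam σ N i l k - + ν n lam σ N (suc i) l (k ∸ 1)))))))
theorem8p2 n lam σ N isPartition isFilling largest canonical =
  (λ i j 1≤i i≤j j≤n → let open Strip i j 1≤i i≤j j≤n in descent-formula , ηbar-formula canonical) ,
  quinvBar-formula
  where
  open Filling n lam σ N isPartition isFilling largest using (module Strip)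
  open QuinvBar n lam σ N isPartition isFilling largest using (quinvBar-formula)
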